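{- Let $M$ be a map. Then $\operatorname{wt}_M$ is a polynomial in the variable $\gamma$ of degree (at most) \[ d(M):=2 (\text{number of connected components of $M$}) - \chi(M), \] where \[\chi(M):=|V(M)|-|\mathcal{E}(M)|+|F(M)|\] is the Euler characteristic of $M$. The polynomial $\operatorname{wt}_M(\gamma)$ is an even (respectively, odd) polynomial if and only if the Euler characteristic $\chi(M)$ is an even number (respectively, an odd number).
   Context: A pairing of a finite set $S$ is a partition of $S$ into two-element blocks. A map is a triple $M=(\mathcal{B},\mathcal{W},\mathcal{E})$ of pairings of the same set $S$ (elements of $S$ are called edge-sides). For two pairings $P,P'$ of $S$, $\mathcal{L}(P,P')$ is the bipartite graph whose vertices are the pairs of $P$ and of $P'$ and whose edges are the elements of $S$ (edge $s$ joins the pair of $P$ and the pair of $P'$ containing $s$); it is a disjoint union of even polygons. The faces $F(M)$ of $M$ are the polygons of $\mathcal{L}(\mathcal{B},\mathcal{W})$; the black vertices $V_\bullet(M)$ are the polygons of $\mathcal{L}(\mathcal{B},\mathcal{E})$, the white vertices $V_\circ(M)$ the polygons of $\mathcal{L}(\mathcal{W},\mathcal{E})$, and $V(M)=V_\bullet(M)\sqcup V_\circ(M)$; the edges $\mathcal{E}(M)$ are the pairs of $\mathcal{E}$. Connected components of $M$ are the classes of the equivalence relation on $S$ generated by $x\sim y$ if $x,y$ are partners in $\mathcal{B}$, $\mathcal{W}$ or $\mathcal{E}$. Fix $\alpha>0$ and $\gamma:=\frac{1-\alpha}{\sqrt{\alpha}}$. For an edge $E=\{s_1,s_2\}$ of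 $M$: $E$ is straight if $s_1,s_2$ lie in the same face and the number of edge-sides strictly between them along that polygon is even; twisted if they lie in the same face and this number is odd; interface if they lie in different faces. Set $\operatorname{wt}_{M,E}=1$, $\gamma$, $\tfrac12$ respectively. Edge removal: for a pairing $P$ of $S$ and distinct $s_1,s_2\in S$, define $P_{\{s_1,s_2\}}$ (a pairing of $S\setminus\{s_1,s_2\}$) as $P\setminus\{\{s_1,s_2\}\}$ if $\{s_1,s_2\}\in P$, and otherwise, with $t_1,t_2$ the partners of $s_1,s_2$, as $(P\setminus\{\{s_1,t_1\},\{s_2,t_2\}\})\cup\{\{t_1,t_2\}\}$. Then $M\setminus E:=(\mathcal{B}_E,\mathcal{W}_E,\mathcal{E}_E)$; removals of different edges commute. A history is a linear order $\prec$ on the $n$ edges of $M$; listing the edges as $E_1\prec\dots\prec E_n$ and setting $M_i=M\setminus\{E_1,\dots,E_i\}$, define $\operatorname{wt}_{M,\prec}=\prod_{0\le i\le n-1}\operatorname{wt}_{M_i,E_{i+1}}$, and $\operatorname{wt}_M:=\frac{1}{n!}\sum_{\prec}\operatorname{wt}_{M,\prec}$ (the "measure of non-orientability" of $M$). -}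

module Defs where

open import Data.Bool using (Bool; true; false; if_then_else_; _∧_; _∨_; not)
open import Data.Nat as ℕ using (ℕ; zero; suc; _!)
open import Data.Nat.Properties using (_!≢0)
open import Data.Fin using (Fin; toℕ)
open import Data.Fin.Properties using (_≟_)
open import Data.List using (List; []; _∷_; _++_; map; concatMap; filter; length; foldr; allFin)
open import Data.Product using (_×_; _,_; proj₁; proj₂)
open import Data.Integer as ℤ using (ℤ; +_)
open import Data.Rational as ℚ using (ℚ; 0ℚ; 1ℚ; ½)
open import Relation.Nullary.Decidable.Core using (T?)
open import Relation.Nullary using (does; ¬_)
open import Data.Nat.Divisibility using (_∣_)
open import Relation.Binary.PropositionalEquality using (_≡_; _≢_)

-- Pairings of S = Fin m : fixed-point-free involutions.
-- (The pair of P containing x is {x , P x}.)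

record Pairing (m : ℕ) : Set where
  field
    pr     : Fin m → Fin m
    invol  : ∀ x → pr (pr x) ≡ x
    noFix  : ∀ x → pr x ≢ x
open Pairing public

-- A map (B , W , E) : three pairings of the same set of edge-sides Fin m.
record Map (m : ℕ) : Set where
  field
    𝓑 : Pairing m
    𝓦 : Pairing m
    𝓔 : Pairing m
open Map public

_==_ : ∀ {m} → Fin m → Fin m → Bool
x == y = does (x ≟ y)

_<ᵇF_ : ∀ {m} → Fin m → Fin m → Bool
x <ᵇF y = toℕ x ℕ.<ᵇ toℕ y

anyFin : ∀ {m} → (Fin m → Bool) → Bool
anyFin {m} p = foldr (λ x b → p x ∨ b) false (allFin m)

countFin : ∀ {m} → (Fin m → Bool) → ℕ
countFin {m} p = length (filter (λ x → T? (p x)) (allFin m))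

-- Subsets as Boolean predicates.  One closure step under a list of
-- generating maps, and the closure (m steps suffice on Fin m).
Sub : ℕ → Set
Sub m = Fin m → Bool

step : ∀ {m} → List (Fin m → Fin m) → Sub m → Sub m
step {m} gs A y = A y ∨ anyFin (λ x → A x ∧ foldr (λ g b → (g x == y) ∨ b) false gs)

iter : ∀ {m} → ℕ → List (Fin m → Fin m) → Sub m → Sub m
iter zero    gs A = A
iter (suc k) gs A = iter k gs (step gs A)

-- class of x under the equivalence relation generated by x ~ g x (g ∈ gs)
cls : ∀ {m} → List (Fin m → Fin m) → Fin m → Sub m
cls {m} gs x = iter m gs (λ y → y == x)

-- number of equivalence classes: count the classes via their least element
numClasses : ∀ {m} → List (Fin m → Fin m) → ℕ
numClasses {m} gs = countFin (λ x → not (anyFin (λ y → cls gs x y ∧ (y <ᵇF x))))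

-- Polygons of L(P,P') are the classes of S under the relation generated
-- by "partners in P" and "partners in P'" (edges of a component of the
-- bipartite graph L(P,P') are exactly such a class).

module _ {m : ℕ} (M : Map m) where
  private
    b w e : Fin m → Fin m
    b = pr (𝓑 M)
    w = pr (𝓦 M)
    e = pr (𝓔 M)

  #faces : ℕ
  #faces = numClasses (b ∷ w ∷ [])

  #blackVertices : ℕ
  #blackVertices = numClasses (b ∷ e ∷ [])

  #whiteVertices : ℕ
  #whiteVertices = numClasses (w ∷ e ∷ [])

  #vertices : ℕ
  #vertices = #blackVertices ℕ.+ #whiteVertices

  edgeList : List (Fin m × Fin m)
  edgeList = map (λ x → x , e x) (filter (λ x → toℕ x ℕ.<? toℕ (e x)) (allFin m))

  #edges : ℕ
  #edges = length edgeList

  #components : ℕ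
  #components = numClasses (b ∷ w ∷ e ∷ [])

  χ : ℤ
  χ = (+ #vertices ℤ.- + #edges) ℤ.+ + #faces

  d : ℤ
  d = + (2 ℕ.* #components) ℤ.- χ

-- During a history we keep S = Fin m fixed and only update the three
-- raw pairing functions; removed edge-sides are simply never visited
-- again (the pairings restricted to the remaining sides are those of
-- M_i).

Raw : ℕ → Set
Raw m = (Fin m → Fin m) × (Fin m → Fin m) × (Fin m → Fin m)

removeP : ∀ {m} → (Fin m → Fin m) → Fin m → Fin m → (Fin m → Fin m)
removeP P s₁ s₂ =
  if P s₁ == s₂ then P
  else (λ x → if x == P s₁ then P s₂ else if x == P s₂ then P s₁ else P x)

removeEdge : ∀ {m} → Raw m → Fin m × Fin m → Raw m
removeEdge (b , w , e) (s₁ , s₂) =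
  removeP b s₁ s₂ , removeP w s₁ s₂ , removeP e s₁ s₂

-- Walk along the face polygon of s: x₀ = s, x₁ = b x₀, x₂ = w x₁, x₃ = b x₂, …
-- (walk j s = x_j); consecutive x_j, x_{j+1} share a pair of 𝓑 or 𝓦.
walk : ∀ {m} → (Fin m → Fin m) → (Fin m → Fin m) → ℕ → Fin m → Fin m
walk b w zero    s = s
walk b w (suc j) s = walk w b j (b s)

data EdgeType : Set where
  straight twisted interface : EdgeType

-- first j ∈ {1,…,k} with x_j = s₂ (if any).  s₂ = x_j with j-1 edge-sides
-- strictly between; the polygon has at most m sides, so k = m suffices.
firstHit : ∀ {m} → (Fin m → Fin m) → (Fin m → Fin m) → Fin m → Fin m → ℕ → ℕ → EdgeType
firstHit b w s₁ s₂ zero    j = interface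
firstHit b w s₁ s₂ (suc k) j =
  if walk b w j s₁ == s₂
  then (if (j ℕ.% 2) ℕ.≡ᵇ 0 then twisted else straight)
  else firstHit b w s₁ s₂ k (suc j)

edgeType : ∀ {m} → Raw m → Fin m × Fin m → EdgeType
edgeType {m} (b , w , e) (s₁ , s₂) = firstHit b w s₁ s₂ m 1

-- A monomial  c · γ^k  is recorded as (number of factors ½ , k).
-- wt_{M,E} = 1, γ, ½  for straight, twisted, interface.
Mono : Set
Mono = ℕ × ℕ

monoMul : EdgeType → Mono → Mono
monoMul straight  (h , k) = h , k
monoMul twisted   (h , k) = h , suc k
monoMul interface (h , k) = suc h , k

-- wt_{M,≺} for the history given as the list E₁ ≺ … ≺ Eₙ
histWt : ∀ {m} → Raw m → List (Fin m × Fin m) → Mono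
histWt R []       = 0 , 0
histWt R (E ∷ Es) = monoMul (edgeType R E) (histWt (removeEdge R E) Es)

insertions : ∀ {A : Set} → A → List A → List (List A)
insertions a []       = (a ∷ []) ∷ []
insertions a (x ∷ xs) = (a ∷ x ∷ xs) ∷ map (x ∷_) (insertions a xs)

perms : ∀ {A : Set} → List A → List (List A)
perms []       = [] ∷ []
perms (x ∷ xs) = concatMap (insertions x) (perms xs)

halfPow : ℕ → ℚ
halfPow zero    = 1ℚ
halfPow (suc h) = ½ ℚ.* halfPow h

raw : ∀ {m} → Map m → Raw m
raw M = pr (𝓑 M) , pr (𝓦 M) , pr (𝓔 M)

-- Coefficient of γ^k in  wt_M = (1/n!) Σ_≺ wt_{M,≺}
-- (γ treated as a formal variable).
wtCoeff : ∀ {m} → Map m → ℕ → ℚ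
wtCoeff M k =
  (+ 1 ℚ./ (n !)) {{n !≢0}} ℚ.*
  foldr ℚ._+_ 0ℚ
    (map (λ h → let mo = histWt (raw M) h in
                if proj₂ mo ℕ.≡ᵇ k then halfPow (proj₁ mo) else 0ℚ)
         (perms (edgeList M)))
  where n = #edges M

EvenPoly : (ℕ → ℚ) → Set
EvenPoly p = ∀ k → ¬ (2 ∣ k) → p k ≡ 0ℚ

OddPoly : (ℕ → ℚ) → Set
OddPoly p = ∀ k → 2 ∣ k → p k ≡ 0ℚ

DegreeAtMost : (ℕ → ℚ) → ℤ → Set
DegreeAtMost p D = ∀ k → D ℤ.< + k → p k ≡ 0ℚ

EvenInt : ℤ → Set
EvenInt z = 2 ∣ ℤ.∣ z ∣

OddInt : ℤ → Set
OddInt z = ¬ (2 ∣ ℤ.∣ z ∣)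

module Submission where

-- Removing one edge E of a map lowers 2·#components + #edges − #vertices − #faces by t + 2δ with
-- δ ≥ 0, where t = 1 if E is twisted and t = 0 otherwise: the edge count drops by one, an interface
-- edge merges two faces, a twisted edge keeps its face, a straight edge splits its face unless an end
-- of E is a leaf (which then disappears as a vertex), and the number of components can only grow when
-- a straight edge splits its face, and then by at most one.  Summed along a history with k twisted
-- edges this gives d(M) = k + 2n with n ≥ 0.  Every coefficient of wt_M is a sum of positive
-- contributions of histories, so γ^k occurs in wt_M exactly when some history has k twisted edges;
-- hence deg wt_M ≤ d(M), and all occurring exponents have the parity of d(M), that is, of χ(M).

open import Defs
open import Data.Bool using (Bool; true; false; if_then_else_; _∧_; _∨_; not; T)
open import Data.Bool.Properties using (∧-zeroʳ; ∨-zeroʳ; ∧-identityʳ; ∨-comm)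
open import Data.Empty using (⊥; ⊥-elim)
open import Data.Fin using (Fin; toℕ) renaming (zero to fz; suc to fs)
open import Data.Fin.Properties using (_≟_; toℕ-injective; pigeonhole; toℕ<n)
open import Data.Integer as ℤ using (ℤ)
open import Data.Integer.Divisibility.Signed using (∣ᵤ⇒∣; ∣⇒∣ᵤ; ∣m∣n⇒∣m-n) renaming (_∣_ to _ℤ∣_)
open import Data.Integer.Properties as ZP using (pos-+)
import Data.Integer.Tactic.RingSolver as ℤ-Solver
open import Data.List using (List; []; _∷_; map; filter; length; foldr; tabulate; concatMap; allFin)
open import Data.List.Membership.Propositional using (_∈_)
open import Data.List.Membership.Propositional.Properties using (∈-map⁻; ∈-concatMap⁻; ∈-concatMap⁺; ∈-allFin)
open import Data.List.Properties using (length-map; filter-≐)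
open import Data.List.Relation.Binary.Permutation.Propositional as Perm using (_↭_; ↭-sym)
open import Data.List.Relation.Unary.All using (All; []; _∷_)
open import Data.List.Relation.Unary.AllPairs using ([]; _∷_)
open import Data.List.Relation.Unary.Any using (Any; here; there)
open import Data.List.Relation.Unary.Unique.Propositional using (Unique)
open import Data.List.Relation.Unary.Unique.Propositional.Properties using (allFin⁺)
open import Data.Nat as ℕ using (ℕ; zero; suc; _+_; _*_; _∸_; _≤_; _<_; z≤n; s≤s; _%_; _!)
open import Data.Nat.DivMod using ([m+n]%n≡m%n)
open import Data.Nat.Divisibility using (_∣_; _∣?_; ∣m∣n⇒∣m+n; ∣m+n∣m⇒∣n; m∣m*n)
open import Data.Nat.Properties hiding (_≟_)
open import Data.Nat.Tactic.RingSolver using (solve-∀)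
open import Data.Product using (_×_; _,_; proj₁; proj₂; Σ; ∃)
open import Data.Rational as ℚ using (ℚ; 0ℚ; ½; Positive; NonNegative)
import Data.Rational.Properties as QP
open import Data.Sum using (_⊎_; inj₁; inj₂)
open import Data.Unit using (tt)
open import Function.Bundles using (_⇔_; mk⇔; Equivalence)
open import Relation.Binary.Definitions using (tri<; tri≈; tri>)
open import Relation.Binary.PropositionalEquality
open import Relation.Nullary using (does; ¬_; yes; no; Dec)
open import Relation.Nullary.Decidable.Core using (T?)

indicator : Bool → ℕ
indicator b = if b then 1 else 0

count : ∀ {n} → (Fin n → Bool) → ℕ
count {zero} p = 0
count {suc n} p = indicator (p fz) + count (λ x → p (fs x))

any : ∀ {n} → (Fin n → Bool) → Bool
any {zero} p = false
any {suc n} p = p fz ∨ any (λ x → p (fs x))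

length-filter-tabulate : ∀ {n} {A : Set} (p : A → Bool) (f : Fin n → A) →
  length (filter (λ x → T? (p x)) (tabulate f)) ≡ count (λ x → p (f x))
length-filter-tabulate {zero} p f = refl
length-filter-tabulate {suc n} p f with p (f fz)
... | true = cong suc (length-filter-tabulate p (λ x → f (fs x)))
... | false = length-filter-tabulate p (λ x → f (fs x))

countFin≡count : ∀ {m} (p : Fin m → Bool) → countFin p ≡ count p
countFin≡count p = length-filter-tabulate p (λ x → x)

foldr-∨-tabulate : ∀ {n} {A : Set} (p : A → Bool) (f : Fin n → A) →
  foldr (λ x b → p x ∨ b) false (tabulate f) ≡ any (λ x → p (f x))
foldr-∨-tabulate {zero} p f = refl
foldr-∨-tabulate {suc n} p f = cong (p (f fz) ∨_) (foldr-∨-tabulate p (λ x → f (fs x)))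

anyFin≡any : ∀ {m} (p : Fin m → Bool) → anyFin p ≡ any p
anyFin≡any p = foldr-∨-tabulate p (λ x → x)

any-intro : ∀ {n} (p : Fin n → Bool) (x : Fin n) → p x ≡ true → any p ≡ true
any-intro p fz e rewrite e = refl
any-intro p (fs x) e with p fz
... | true = refl
... | false = any-intro (λ y → p (fs y)) x e

any-elim : ∀ {n} (p : Fin n → Bool) → any p ≡ true → Σ (Fin n) λ x → p x ≡ true
any-elim {zero} p ()
any-elim {suc n} p e with p fz in eq
... | true = fz , eq
... | false with any-elim (λ y → p (fs y)) e
... | x , ex = fs x , ex

any-false-elim : ∀ {n} (p : Fin n → Bool) → any p ≡ false → ∀ x → p x ≡ false
any-false-elim p e x with p x in eq
... | false = refl
... | true with any-intro p x eq
... | e2 = trans (sym e2) e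

any-false-intro : ∀ {n} (p : Fin n → Bool) → (∀ x → p x ≡ false) → any p ≡ false
any-false-intro {zero} p h = refl
any-false-intro {suc n} p h rewrite h fz = any-false-intro (λ y → p (fs y)) (λ y → h (fs y))

anyFin-intro : ∀ {m} (p : Fin m → Bool) (x : Fin m) → p x ≡ true → anyFin p ≡ true
anyFin-intro p x e = trans (anyFin≡any p) (any-intro p x e)

anyFin-elim : ∀ {m} (p : Fin m → Bool) → anyFin p ≡ true → Σ (Fin m) λ x → p x ≡ true
anyFin-elim p e = any-elim p (trans (sym (anyFin≡any p)) e)

anyFin-false-elim : ∀ {m} (p : Fin m → Bool) → anyFin p ≡ false → ∀ x → p x ≡ false
anyFin-false-elim p e = any-false-elim p (trans (sym (anyFin≡any p)) e)

anyFin-false-intro : ∀ {m} (p : Fin m → Bool) → (∀ x → p x ≡ false) → anyFin p ≡ false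
anyFin-false-intro p h = trans (anyFin≡any p) (any-false-intro p h)

count-cong : ∀ {n} (p q : Fin n → Bool) → (∀ x → p x ≡ q x) → count p ≡ count q
count-cong {zero} p q h = refl
count-cong {suc n} p q h rewrite h fz = cong (_ +_) (count-cong (λ x → p (fs x)) (λ x → q (fs x)) (λ x → h (fs x)))

count≤n : ∀ {n} (p : Fin n → Bool) → count p ≤ n
count≤n {zero} p = z≤n
count≤n {suc n} p with p fz
... | true = s≤s (count≤n (λ x → p (fs x)))
... | false = m≤n⇒m≤1+n (count≤n (λ x → p (fs x)))

count-split : ∀ {n} (p q : Fin n → Bool) →
  count p ≡ count (λ x → p x ∧ q x) + count (λ x → p x ∧ not (q x))
count-split {zero} p q = refl
count-split {suc n} p q with p fz | q fz
... | true | true = cong suc (count-split (λ x → p (fs x)) (λ x → q (fs x)))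
... | true | false = trans (cong suc (count-split (λ x → p (fs x)) (λ x → q (fs x)))) (sym (+-suc _ _))
... | false | true = count-split (λ x → p (fs x)) (λ x → q (fs x))
... | false | false = count-split (λ x → p (fs x)) (λ x → q (fs x))

count-mono : ∀ {n} (p q : Fin n → Bool) → (∀ x → p x ≡ true → q x ≡ true) → count p ≤ count q
count-mono {zero} p q h = z≤n
count-mono {suc n} p q h with p fz in ep | q fz in eq
... | true | true = s≤s (count-mono (λ x → p (fs x)) (λ x → q (fs x)) (λ x → h (fs x)))
... | true | false with trans (sym (h fz ep)) eq
... | ()
count-mono {suc n} p q h | false | true = m≤n⇒m≤1+n (count-mono (λ x → p (fs x)) (λ x → q (fs x)) (λ x → h (fs x)))
count-mono {suc n} p q h | false | false = count-mono (λ x → p (fs x)) (λ x → q (fs x)) (λ x → h (fs x))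

count-zero : ∀ {n} (p : Fin n → Bool) → (∀ x → p x ≡ false) → count p ≡ 0
count-zero {zero} p h = refl
count-zero {suc n} p h rewrite h fz = count-zero (λ x → p (fs x)) (λ x → h (fs x))

count-at : ∀ {n} (p : Fin n → Bool) (a : Fin n) →
  count (λ x → p x ∧ (x == a)) ≡ indicator (p a)
count-at {suc n} p fz with p fz
... | true = cong suc (count-zero (λ x → p (fs x) ∧ false) (λ x → ∧-zeroʳ (p (fs x))))
... | false = count-zero (λ x → p (fs x) ∧ false) (λ x → ∧-zeroʳ (p (fs x)))
count-at {suc n} p (fs a) with p fz
... | true = count-at (λ x → p (fs x)) a
... | false = count-at (λ x → p (fs x)) a

f≢t : false ≡ true → ⊥
f≢t ()

t≢f : true ≡ false → ⊥
t≢f ()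

bool-ext : ∀ {a b : Bool} → (b ≡ true → a ≡ true) → (a ≡ true → b ≡ true) → a ≡ b
bool-ext {true} {true} f g = refl
bool-ext {true} {false} f g = sym (g refl)
bool-ext {false} {true} f g = f refl
bool-ext {false} {false} f g = refl

∧-elim : ∀ {a b : Bool} → a ∧ b ≡ true → a ≡ true × b ≡ true
∧-elim {true} {true} e = refl , refl

∧-l : ∀ {a : Bool} (b : Bool) → a ∧ b ≡ true → a ≡ true
∧-l {true} b e = refl

∧-r : ∀ (a : Bool) {b : Bool} → a ∧ b ≡ true → b ≡ true
∧-r true e = e

∧-intro : ∀ {a b : Bool} → a ≡ true → b ≡ true → a ∧ b ≡ true
∧-intro refl refl = refl

not≡true⇒≡false : ∀ {a : Bool} → not a ≡ true → a ≡ false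
not≡true⇒≡false {false} e = refl

not≡false⇒≡true : ∀ {a : Bool} → not a ≡ false → a ≡ true
not≡false⇒≡true {true} e = refl

∨-elim : ∀ {a b : Bool} → a ∨ b ≡ true → a ≡ true ⊎ b ≡ true
∨-elim {true} e = inj₁ refl
∨-elim {false} e = inj₂ e

∨-introˡ : ∀ {a b : Bool} → a ≡ true → a ∨ b ≡ true
∨-introˡ refl = refl

∨-introʳ : ∀ (a : Bool) {b : Bool} → b ≡ true → a ∨ b ≡ true
∨-introʳ true e = refl
∨-introʳ false e = e

==-refl : ∀ {m} (x : Fin m) → (x == x) ≡ true
==-refl x with x ≟ x
... | yes _ = refl
... | no ne = ⊥-elim (ne refl)

==⇒≡ : ∀ {m} {x y : Fin m} → (x == y) ≡ true → x ≡ y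
==⇒≡ {x = x} {y} e with x ≟ y
... | yes p = p
==⇒≡ {x = x} {y} () | no _

≢⇒==false : ∀ {m} {x y : Fin m} → x ≢ y → (x == y) ≡ false
≢⇒==false {x = x} {y} ne with x ≟ y
... | yes p = ⊥-elim (ne p)
... | no _ = refl

≡⇒== : ∀ {m} {x y : Fin m} → x ≡ y → (x == y) ≡ true
≡⇒== {x = x} refl = ==-refl x

Fun : ℕ → Set
Fun m = Fin m → Fin m

data Reach {m} (gs : List (Fun m)) : Fin m → Fin m → Set where
  done : ∀ {x} → Reach gs x x
  move : ∀ {x y} (g : Fun m) → g ∈ gs → Reach gs (g x) y → Reach gs x y

Reach-trans : ∀ {m} {gs : List (Fun m)} {x y z} → Reach gs x y → Reach gs y z → Reach gs x z
Reach-trans done q = q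
Reach-trans (move g i p) q = move g i (Reach-trans p q)

Reach-snoc : ∀ {m} {gs : List (Fun m)} {x y} (g : Fun m) → g ∈ gs → Reach gs x y → Reach gs x (g y)
Reach-snoc g i p = Reach-trans p (move g i done)

Reach-one : ∀ {m} {gs : List (Fun m)} {x} (g : Fun m) → g ∈ gs → Reach gs x (g x)
Reach-one g i = move g i done

hit : ∀ {m} → List (Fun m) → Fin m → Fin m → Bool
hit gs x y = foldr (λ g b → (g x == y) ∨ b) false gs

hit⇒∈ : ∀ {m} (gs : List (Fun m)) x y → hit gs x y ≡ true → Σ (Fun m) λ g → g ∈ gs × g x ≡ y
hit⇒∈ [] x y ()
hit⇒∈ (g ∷ gs) x y e with g x == y in eq
... | true = g , here refl , ==⇒≡ eq
... | false with hit⇒∈ gs x y e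
... | h , i , p = h , there i , p

hit-intro : ∀ {m} (gs : List (Fun m)) x (g : Fun m) → g ∈ gs → hit gs x (g x) ≡ true
hit-intro (g ∷ gs) x .g (here refl) rewrite ==-refl (g x) = refl
hit-intro (h ∷ gs) x g (there i) rewrite hit-intro gs x g i = ∨-zeroʳ _

anyFin-ext : ∀ {m} (p q : Fin m → Bool) → (∀ x → p x ≡ q x) → anyFin p ≡ anyFin q
anyFin-ext p q h with anyFin p in ep | anyFin q in eq
... | true | true = refl
... | false | false = refl
... | true | false with anyFin-elim p ep
... | x , px = trans (sym (trans (sym (h x)) px)) (anyFin-false-elim q eq x)
anyFin-ext p q h | false | true with anyFin-elim q eq
... | x , qx = trans (sym (anyFin-false-elim p ep x)) (trans (h x) qx)

step-ext : ∀ {m} (gs : List (Fun m)) A B → A ≗ B → step gs A ≗ step gs B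
step-ext gs A B h y rewrite h y = cong (B y ∨_) (anyFin-ext _ _ (λ x → cong (_∧ hit gs x y) (h x)))

iter-suc : ∀ {m} k (gs : List (Fun m)) A → iter (suc k) gs A ≗ step gs (iter k gs A)
iter-suc zero gs A y = refl
iter-suc (suc k) gs A y = iter-suc k gs (step gs A) y

step-mono : ∀ {m} (gs : List (Fun m)) A y → A y ≡ true → step gs A y ≡ true
step-mono gs A y e rewrite e = refl

iter-sound : ∀ {m} (gs : List (Fun m)) x k A → (∀ z → A z ≡ true → Reach gs x z) →
  ∀ y → iter k gs A y ≡ true → Reach gs x y
iter-sound gs x zero A h y e = h y e
iter-sound gs x (suc k) A h y e = iter-sound gs x k (step gs A) h' y e
  where
  h' : ∀ z → step gs A z ≡ true → Reach gs x z
  h' z e' with A z in eA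
  ... | true = h z eA
  ... | false with anyFin-elim _ e'
  ... | w , ew with A w in eAw
  ... | true with hit⇒∈ gs w z ew
  ... | g , i , gw rewrite sym gw = Reach-snoc g i (h w eAw)
  h' z e' | false | w , () | false

cls-sound : ∀ {m} (gs : List (Fun m)) x y → cls gs x y ≡ true → Reach gs x y
cls-sound {m} gs x y e = iter-sound gs x m (λ z → z == x) (λ z ez → subst (λ u → Reach gs x u) (sym (==⇒≡ ez)) done) y e

Closed : ∀ {m} → List (Fun m) → Sub m → Set
Closed gs S = ∀ y → step gs S y ≡ true → S y ≡ true

iter-mono : ∀ {m} (gs : List (Fun m)) k A y → A y ≡ true → iter k gs A y ≡ true
iter-mono gs zero A y e = e
iter-mono gs (suc k) A y e = iter-mono gs k (step gs A) y (step-mono gs A y e)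

closed-stable : ∀ {m} (gs : List (Fun m)) k j A → Closed gs (iter k gs A) → iter (j + k) gs A ≗ iter k gs A
closed-stable gs k zero A c y = refl
closed-stable gs k (suc j) A c y =
  trans (iter-suc (j + k) gs A y) (trans (step-ext gs _ _ (closed-stable gs k j A c) y) lem)
  where
  lem : step gs (iter k gs A) y ≡ iter k gs A y
  lem = bool-ext (step-mono gs (iter k gs A) y) (c y)

step-grows-count : ∀ {m} (gs : List (Fun m)) S y → step gs S y ≡ true → S y ≡ false →
  suc (count S) ≤ count (step gs S)
step-grows-count gs S y e1 e2 = begin
  suc (count S)                  ≡⟨ +-comm 1 (count S) ⟩
  count S + 1                    ≡⟨ cong (_+ 1) (count-cong _ _ old) ⟨
  count kept + 1                 ≤⟨ +-monoʳ-≤ (count kept) one-new ⟩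
  count kept + count new         ≡⟨ count-split (step gs S) S ⟨
  count (step gs S)              ∎
  where
  open ≤-Reasoning
  kept new : Sub _
  kept x = step gs S x ∧ S x
  new x = step gs S x ∧ not (S x)
  old : ∀ x → kept x ≡ S x
  old x with S x
  ... | false = ∧-zeroʳ _
  ... | true = refl
  one-new : 1 ≤ count new
  one-new = subst (_≤ count new) (count-at (λ _ → true) y)
    (count-mono (_== y) new (λ x x==y → subst (λ u → new u ≡ true) (sym (==⇒≡ x==y)) (cong₂ _∧_ e1 (cong not e2))))

closed-or-grows : ∀ {m} (gs : List (Fun m)) S → Closed gs S ⊎ Σ (Fin m) λ y → step gs S y ≡ true × S y ≡ false
closed-or-grows gs S with anyFin (λ y → step gs S y ∧ not (S y)) in e
... | true with anyFin-elim _ e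
... | y , ey = inj₂ (y , proj₁ (∧-elim ey) , not≡true⇒≡false (proj₂ (∧-elim ey)))
closed-or-grows gs S | false = inj₁ λ y ey → lem y ey (anyFin-false-elim _ e y)
  where
  lem : ∀ y → step gs S y ≡ true → step gs S y ∧ not (S y) ≡ false → S y ≡ true
  lem y ey h = not≡false⇒≡true (trans (sym (cong (_∧ not (S y)) ey)) h)

-- A step that does not close the set adds a new element, so after m steps it is closed.
iter-closes-or-grows : ∀ {m} (gs : List (Fun m)) A → 1 ≤ count A → ∀ K →
  (Σ ℕ λ k → k ≤ K × Closed gs (iter k gs A)) ⊎ (suc K ≤ count (iter K gs A))
iter-closes-or-grows gs A h zero = inj₂ h
iter-closes-or-grows gs A h (suc K) with iter-closes-or-grows gs A h K
... | inj₁ (k , k≤ , c) = inj₁ (k , m≤n⇒m≤1+n k≤ , c)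
... | inj₂ c with closed-or-grows gs (iter K gs A)
... | inj₁ cl = inj₁ (K , n≤1+n K , cl)
... | inj₂ (y , e1 , e2) = inj₂ (≤-trans (s≤s c) (≤-trans (step-grows-count gs _ y e1 e2)
                                    (≤-reflexive (count-cong _ _ (λ z → sym (iter-suc K gs A z))))))

iter-m-closed : ∀ {m} (gs : List (Fun m)) A → 1 ≤ count A → Closed gs (iter m gs A)
iter-m-closed {m} gs A h with iter-closes-or-grows gs A h m
... | inj₂ c = ⊥-elim (<⇒≱ c (count≤n _))
... | inj₁ (k , k≤ , c) = λ y ey → trans (eqv y) (c y (trans (sym (step-ext gs _ _ eqv y)) ey))
  where
  eqv : iter m gs A ≗ iter k gs A
  eqv z = subst (λ u → iter u gs A z ≡ iter k gs A z) (m∸n+n≡m k≤) (closed-stable gs k (m ℕ.∸ k) A c z)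

closed-reach : ∀ {m} (gs : List (Fun m)) S → Closed gs S → ∀ {x y} → Reach gs x y → S x ≡ true → S y ≡ true
closed-reach gs S c done e = e
closed-reach gs S c {x} (move g i p) e = closed-reach gs S c p (c (g x) (lem))
  where
  lem : step gs S (g x) ≡ true
  lem with S (g x)
  ... | true = refl
  ... | false = anyFin-intro _ x (subst (λ u → u ∧ hit gs x (g x) ≡ true) (sym e) (hit-intro gs x g i))

cls-complete : ∀ {m} (gs : List (Fun m)) x y → Reach gs x y → cls gs x y ≡ true
cls-complete {m} gs x y p =
  closed-reach gs _ (iter-m-closed gs (λ z → z == x) one) p (iter-mono gs m _ x (==-refl x))
  where
  one : 1 ≤ count (λ z → z == x)
  one = ≤-reflexive (sym (count-at (λ _ → true) x))

<ᵇF⇒< : ∀ {m} {y x : Fin m} → (y <ᵇF x) ≡ true → toℕ y < toℕ x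
<ᵇF⇒< {y = y} {x} e = <ᵇ⇒< (toℕ y) (toℕ x) (subst T (sym e) tt)

<⇒<ᵇF : ∀ {m} {y x : Fin m} → toℕ y < toℕ x → (y <ᵇF x) ≡ true
<⇒<ᵇF {y = y} {x} p with toℕ y ℕ.<ᵇ toℕ x | <⇒<ᵇ p
... | true | _ = refl

Rel : ℕ → Set
Rel m = Fin m → Fin m → Bool

record EquivalenceOn {m} (L : Sub m) (r : Rel m) : Set where
  field
    refl-on : ∀ x → L x ≡ true → r x x ≡ true
    sym-on : ∀ x y → L x ≡ true → L y ≡ true → r x y ≡ true → r y x ≡ true
    trans-on : ∀ x y z → L x ≡ true → L y ≡ true → L z ≡ true → r x y ≡ true → r y z ≡ true → r x z ≡ true
open EquivalenceOn public

isClassMin : ∀ {m} → Sub m → Rel m → Fin m → Bool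
isClassMin L r x = L x ∧ not (anyFin (λ y → L y ∧ (r x y ∧ (y <ᵇF x))))

-- Defs.numClasses restricted to the live sides L: each class is counted at its least element.
#classes : ∀ {m} → Sub m → Rel m → ℕ
#classes L r = countFin (λ x → L x ∧ not (anyFin (λ y → L y ∧ (r x y ∧ (y <ᵇF x)))))

#classes≡count : ∀ {m} (L : Sub m) r → #classes L r ≡ count (isClassMin L r)
#classes≡count L r = countFin≡count (isClassMin L r)

isClassMin-live : ∀ {m} (L : Sub m) r x → isClassMin L r x ≡ true → L x ≡ true
isClassMin-live L r x e = ∧-l _ e

isClassMin-dead : ∀ {m} (L : Sub m) r x → L x ≡ false → isClassMin L r x ≡ false
isClassMin-dead L r x e rewrite e = refl

isClassMin-below : ∀ {m} (L : Sub m) r x y → isClassMin L r x ≡ true → L y ≡ true → r x y ≡ true → toℕ y < toℕ x → ⊥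
isClassMin-below L r x y e ly rxy lt =
  f≢t (trans (sym (anyFin-false-elim _ (not≡true⇒≡false (∧-r (L x) e)) y)) (∧-intro ly (∧-intro rxy (<⇒<ᵇF lt))))

isClassMin-intro : ∀ {m} (L : Sub m) r x → L x ≡ true → (∀ y → L y ≡ true → r x y ≡ true → toℕ y < toℕ x → ⊥) →
  isClassMin L r x ≡ true
isClassMin-intro L r x lx h = ∧-intro lx (cong not (anyFin-false-intro _ λ y → lem y))
  where
  lem : ∀ y → L y ∧ (r x y ∧ (y <ᵇF x)) ≡ false
  lem y with L y ∧ (r x y ∧ (y <ᵇF x)) in e
  ... | false = refl
  ... | true = ⊥-elim (h y (∧-l _ e) (∧-l _ (∧-r (L y) e)) (<ᵇF⇒< (∧-r (r x y) (∧-r (L y) e))))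

notClassMin-elim : ∀ {m} (L : Sub m) r x → L x ≡ true → isClassMin L r x ≡ false →
  Σ (Fin m) λ y → L y ≡ true × r x y ≡ true × toℕ y < toℕ x
notClassMin-elim L r x lx e with anyFin (λ y → L y ∧ (r x y ∧ (y <ᵇF x))) in ea
... | true with anyFin-elim _ ea
... | y , ey = y , ∧-l _ ey , ∧-l _ (∧-r (L y) ey) , <ᵇF⇒< (∧-r (r x y) (∧-r (L y) ey))
notClassMin-elim L r x lx e | false rewrite lx with e
... | ()

classMin-exists-below : ∀ {m} (L : Sub m) r → EquivalenceOn L r → ∀ n a → toℕ a < n → L a ≡ true →
  Σ (Fin m) λ z → r a z ≡ true × isClassMin L r z ≡ true
classMin-exists-below L r E (suc n) a lt la with isClassMin L r a in e
... | true = a , refl-on E a la , e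
... | false with notClassMin-elim L r a la e
... | y , ly , ray , y<a with classMin-exists-below L r E n y (≤-trans y<a (≤-pred lt)) ly
... | z , ryz , mz = z , trans-on E a y z la ly (isClassMin-live L r z mz) ray ryz , mz

classMin-exists : ∀ {m} (L : Sub m) r → EquivalenceOn L r → ∀ a → L a ≡ true →
  Σ (Fin m) λ z → r a z ≡ true × isClassMin L r z ≡ true
classMin-exists L r E a la = classMin-exists-below L r E (suc (toℕ a)) a ≤-refl la

classMin-≤ : ∀ {m} (L : Sub m) r → EquivalenceOn L r → ∀ z y → isClassMin L r z ≡ true → L y ≡ true → r z y ≡ true → toℕ z ≤ toℕ y
classMin-≤ L r E z y mz ly rzy with <-cmp (toℕ y) (toℕ z)
... | tri< a _ _ = ⊥-elim (isClassMin-below L r z y mz ly rzy a)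
... | tri≈ _ b _ = ≤-reflexive (sym b)
... | tri> _ _ c = <⇒≤ c

classMin-unique : ∀ {m} (L : Sub m) r → EquivalenceOn L r → ∀ x y → isClassMin L r x ≡ true → isClassMin L r y ≡ true → r x y ≡ true → x ≡ y
classMin-unique L r E x y mx my rxy =
  toℕ-injective (≤-antisym (classMin-≤ L r E x y mx (isClassMin-live L r y my) rxy)
                           (classMin-≤ L r E y x my (isClassMin-live L r x mx) (sym-on E x y (isClassMin-live L r x mx) (isClassMin-live L r y my) rxy)))

not-involutive : ∀ b → not (not b) ≡ b
not-involutive true = refl
not-involutive false = refl

count-remove : ∀ {m} (p : Fin m → Bool) a → count p ≡ count (λ x → p x ∧ not (x == a)) + indicator (p a)
count-remove p a = trans (count-split p (λ x → not (x == a)))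
  (cong (count (λ x → p x ∧ not (x == a)) +_)
    (trans (count-cong _ _ (λ x → cong (p x ∧_) (not-involutive (x == a)))) (count-at p a)))

EquivalenceOn-⊆ : ∀ {m} (L L' : Sub m) r → EquivalenceOn L r → (∀ x → L' x ≡ true → L x ≡ true) → EquivalenceOn L' r
EquivalenceOn-⊆ L L' r E h = record
  { refl-on = λ x lx → refl-on E x (h x lx)
  ; sym-on = λ x y lx ly → sym-on E x y (h x lx) (h y ly)
  ; trans-on = λ x y z lx ly lz → trans-on E x y z (h x lx) (h y ly) (h z lz) }

isClassMin-cong : ∀ {m} (L L' : Sub m) r r' → (∀ x → L x ≡ L' x) →
  (∀ x y → L x ≡ true → L y ≡ true → r x y ≡ r' x y) → ∀ x → isClassMin L r x ≡ isClassMin L' r' x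
isClassMin-cong L L' r r' hL hr x with L x in lx
... | false rewrite sym (hL x) | lx = refl
... | true rewrite sym (hL x) | lx = cong not (anyFin-ext _ _ lem)
  where
  lem : ∀ y → L y ∧ (r x y ∧ (y <ᵇF x)) ≡ L' y ∧ (r' x y ∧ (y <ᵇF x))
  lem y with L y in ly
  ... | false rewrite sym (hL y) | ly = refl
  ... | true rewrite sym (hL y) | ly | hr x y lx ly = refl

#classes-cong : ∀ {m} (L L' : Sub m) r r' → (∀ x → L x ≡ L' x) →
  (∀ x y → L x ≡ true → L y ≡ true → r x y ≡ r' x y) → #classes L r ≡ #classes L' r'
#classes-cong L L' r r' hL hr = trans (#classes≡count L r) (trans (count-cong _ _ (isClassMin-cong L L' r r' hL hr)) (sym (#classes≡count L' r')))

isClassMin-anti : ∀ {m} (L : Sub m) r r' → (∀ x y → L x ≡ true → L y ≡ true → r x y ≡ true → r' x y ≡ true) →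
  ∀ x → isClassMin L r' x ≡ true → isClassMin L r x ≡ true
isClassMin-anti L r r' h x e = isClassMin-intro L r x (isClassMin-live L r' x e)
  (λ y ly rxy lt → isClassMin-below L r' x y e ly (h x y (isClassMin-live L r' x e) ly rxy) lt)

#classes-anti : ∀ {m} (L : Sub m) r r' → (∀ x y → L x ≡ true → L y ≡ true → r x y ≡ true → r' x y ≡ true) →
  #classes L r' ≤ #classes L r
#classes-anti L r r' h = subst₂ _≤_ (sym (#classes≡count L r')) (sym (#classes≡count L r)) (count-mono _ _ (isClassMin-anti L r r' h))

merge : ∀ {m} → Rel m → Fin m → Fin m → Rel m
merge r a b x y = r x y ∨ ((r x a ∧ r b y) ∨ (r x b ∧ r a y))

merge-sym : ∀ {m} (r : Rel m) a b x y → merge r a b x y ≡ merge r b a x y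
merge-sym r a b x y = cong (r x y ∨_) (∨-comm (r x a ∧ r b y) (r x b ∧ r a y))

isClassMin-merge-survives : ∀ {m} (L : Sub m) r r' a b → EquivalenceOn L r → L a ≡ true → L b ≡ true →
  (∀ x y → L x ≡ true → L y ≡ true → r' x y ≡ merge r a b x y) →
  ∀ za zb → r a za ≡ true → isClassMin L r za ≡ true → r b zb ≡ true → isClassMin L r zb ≡ true → toℕ zb < toℕ za →
  ∀ x → x ≢ za → isClassMin L r x ≡ true → isClassMin L r' x ≡ true
isClassMin-merge-survives L r r' a b E la lb hr' za zb raza mza rbzb mzb lt x ne mx = isClassMin-intro L r' x lx λ y ly r'xy y<x → case y ly r'xy y<x (∨-elim (trans (sym (hr' x y lx ly)) r'xy))
  where
  lza : L za ≡ true
  lza = isClassMin-live L r za mza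
  lzb : L zb ≡ true
  lzb = isClassMin-live L r zb mzb
  lx : L x ≡ true
  lx = isClassMin-live L r x mx
  case : ∀ y → L y ≡ true → r' x y ≡ true → toℕ y < toℕ x →
    r x y ≡ true ⊎ ((r x a ∧ r b y) ∨ (r x b ∧ r a y)) ≡ true → ⊥
  case y ly _ y<x (inj₁ rxy) = isClassMin-below L r x y mx ly rxy y<x
  case y ly _ y<x (inj₂ c) with ∨-elim c
  ... | inj₁ c1 = ne (classMin-unique L r E x za mx mza
                        (trans-on E x a za lx la lza (∧-l _ c1) raza))
  ... | inj₂ c2 = <-irrefl refl (<-trans y<x (≤-<-trans (≤-reflexive (cong toℕ xzb)) (<-≤-trans lt zay)))
    where
    xzb : x ≡ zb
    xzb = classMin-unique L r E x zb mx mzb (trans-on E x b zb lx lb lzb (∧-l _ c2) rbzb)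
    zay : toℕ za ≤ toℕ y
    zay = classMin-≤ L r E za y mza ly (trans-on E za a y lza la ly (sym-on E a za la lza raza) (∧-r (r x b) c2))

#classes-merge-ordered : ∀ {m} (L : Sub m) r r' a b → EquivalenceOn L r → L a ≡ true → L b ≡ true → r a b ≡ false →
  (∀ x y → L x ≡ true → L y ≡ true → r' x y ≡ merge r a b x y) →
  ∀ za zb → r a za ≡ true → isClassMin L r za ≡ true → r b zb ≡ true → isClassMin L r zb ≡ true → toℕ zb < toℕ za →
  suc (#classes L r') ≡ #classes L r
#classes-merge-ordered {m} L r r' a b E la lb rab hr' za zb raza mza rbzb mzb lt =
  sym (trans (#classes≡count L r) (trans (count-split (isClassMin L r) (isClassMin L r'))
    (trans (cong₂ _+_ (count-cong _ _ part1) (trans (count-cong _ _ part2) (count-at (λ _ → true) za)))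
      (trans (+-comm _ 1) (cong suc (sym (#classes≡count L r')))))))
  where
  lza : L za ≡ true
  lza = isClassMin-live L r za mza
  lzb : L zb ≡ true
  lzb = isClassMin-live L r zb mzb
  r⊆r' : ∀ x y → L x ≡ true → L y ≡ true → r x y ≡ true → r' x y ≡ true
  r⊆r' x y lx ly e = trans (hr' x y lx ly) (∨-introˡ e)
  m'⇒m : ∀ x → isClassMin L r' x ≡ true → isClassMin L r x ≡ true
  m'⇒m = isClassMin-anti L r r' r⊆r'
  part1 : ∀ x → isClassMin L r x ∧ isClassMin L r' x ≡ isClassMin L r' x
  part1 x = bool-ext (λ e → ∧-intro (m'⇒m x e) e) (λ e → ∧-r (isClassMin L r x) e)
  notm'za : isClassMin L r' za ≡ false
  notm'za with isClassMin L r' za in e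
  ... | false = refl
  ... | true = ⊥-elim (isClassMin-below L r' za zb e lzb
                 (trans (hr' za zb lza lzb) (∨-introʳ (r za zb) (∨-introˡ (∧-intro (sym-on E a za la lza raza) rbzb)))) lt)
  part2 : ∀ x → isClassMin L r x ∧ not (isClassMin L r' x) ≡ true ∧ (x == za)
  part2 x = bool-ext bwd fwd
    where
    bwd : (x == za) ≡ true → isClassMin L r x ∧ not (isClassMin L r' x) ≡ true
    bwd e = subst (λ u → isClassMin L r u ∧ not (isClassMin L r' u) ≡ true) (sym (==⇒≡ {x = x} {y = za} e))
              (∧-intro mza (cong not notm'za))
    fwd : isClassMin L r x ∧ not (isClassMin L r' x) ≡ true → (x == za) ≡ true
    fwd e with x ≟ za
    ... | yes _ = refl
    ... | no ne = ⊥-elim (f≢t (trans (sym (not≡true⇒≡false (∧-r (isClassMin L r x) e))) (isClassMin-merge-survives L r r' a b E la lb hr' za zb raza mza rbzb mzb lt x ne (∧-l _ e))))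

#classes-merge : ∀ {m} (L : Sub m) r r' a b → EquivalenceOn L r → L a ≡ true → L b ≡ true → r a b ≡ false →
  (∀ x y → L x ≡ true → L y ≡ true → r' x y ≡ merge r a b x y) →
  suc (#classes L r') ≡ #classes L r
#classes-merge L r r' a b E la lb rab hr' with classMin-exists L r E a la | classMin-exists L r E b lb
... | za , raza , mza | zb , rbzb , mzb with <-cmp (toℕ zb) (toℕ za)
... | tri< lt _ _ = #classes-merge-ordered L r r' a b E la lb rab hr' za zb raza mza rbzb mzb lt
... | tri> _ _ gt = #classes-merge-ordered L r r' b a E lb la rba (λ x y lx ly → trans (hr' x y lx ly) (merge-sym r a b x y)) zb za rbzb mzb raza mza gt
  where
  rba : r b a ≡ false
  rba with r b a in e
  ... | false = refl
  ... | true = trans (sym (sym-on E b a lb la e)) rab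
... | tri≈ _ eq _ = ⊥-elim (t≢f (trans (sym (trans-on E a za b la lza lb raza
                        (subst (λ u → r u b ≡ true) (toℕ-injective eq) (sym-on E b zb lb (isClassMin-live L r zb mzb) rbzb)))) rab))
  where lza = isClassMin-live L r za mza

del : ∀ {m} → Sub m → Fin m → Sub m
del L s x = L x ∧ not (x == s)

del-live : ∀ {m} (L : Sub m) s x → del L s x ≡ true → L x ≡ true
del-live L s x e = ∧-l _ e

del-ne : ∀ {m} (L : Sub m) s x → del L s x ≡ true → x ≢ s
del-ne L s x e p = f≢t (trans (sym (cong not (≡⇒== p))) (∧-r (L x) e))

del-intro : ∀ {m} (L : Sub m) s x → L x ≡ true → x ≢ s → del L s x ≡ true
del-intro L s x lx ne = ∧-intro lx (cong not (≢⇒==false ne))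

del-at : ∀ {m} (L : Sub m) s → del L s s ≡ false
del-at L s rewrite ==-refl s = ∧-zeroʳ (L s)

#classes-del-singleton : ∀ {m} (L : Sub m) r s → EquivalenceOn L r → L s ≡ true →
  (∀ y → L y ≡ true → r s y ≡ true → y ≡ s) → suc (#classes (del L s) r) ≡ #classes L r
#classes-del-singleton L r s E ls iso =
  sym (trans (#classes≡count L r) (trans (count-remove (isClassMin L r) s)
    (trans (cong₂ _+_ (count-cong _ _ pw) (cong indicator ms))
      (trans (+-comm _ 1) (cong suc (sym (#classes≡count (del L s) r)))))))
  where
  ms : isClassMin L r s ≡ true
  ms = isClassMin-intro L r s ls (λ y ly rsy lt → <-irrefl (cong toℕ (iso y ly rsy)) lt)
  pw : ∀ x → isClassMin L r x ∧ not (x == s) ≡ isClassMin (del L s) r x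
  pw x = dc (x ≟ s)
    where
    dc : Dec (x ≡ s) → isClassMin L r x ∧ not (x == s) ≡ isClassMin (del L s) r x
    dc (yes refl) = trans (cong (λ b → isClassMin L r x ∧ not b) (==-refl x))
                     (trans (∧-zeroʳ _) (sym (isClassMin-dead (del L x) r x (del-at L x))))
    dc (no ne) = trans (cong (λ b → isClassMin L r x ∧ not b) (≢⇒==false ne)) (bool-ext bwd fwd)
     where
       fwd : isClassMin L r x ∧ true ≡ true → isClassMin (del L s) r x ≡ true
       fwd e = isClassMin-intro (del L s) r x (del-intro L s x (isClassMin-live L r x e') ne)
                 (λ y ly rxy lt → isClassMin-below L r x y e' (del-live L s y ly) rxy lt)
         where e' = trans (sym (∧-identityʳ _)) e
       bwd : isClassMin (del L s) r x ≡ true → isClassMin L r x ∧ true ≡ true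
       bwd e = ∧-intro (isClassMin-intro L r x lx λ y ly rxy lt → case y ly rxy lt) refl
         where
         lx : L x ≡ true
         lx = del-live L s x (isClassMin-live (del L s) r x e)
         case : ∀ y → L y ≡ true → r x y ≡ true → toℕ y < toℕ x → ⊥
         case y ly rxy lt with y ≟ s
         ... | yes refl = ne (iso x lx (sym-on E x y lx ls rxy))
         ... | no ne' = isClassMin-below (del L s) r x y e (del-intro L s y ly ne') rxy lt

count-swap : ∀ {m} (P Q : Fin m → Bool) a b → P a ≡ true → Q b ≡ true → P b ≡ false → Q a ≡ false →
  (∀ x → x ≢ a → x ≢ b → P x ≡ Q x) → count P ≡ count Q
count-swap P Q a b pa qb pb qa h =
  trans (count-remove P a) (trans (cong₂ _+_ (count-cong _ _ pw) (trans (cong indicator pa)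
     (sym (cong indicator qb)))) (sym (count-remove Q b)))
  where
  pw : ∀ x → P x ∧ not (x == a) ≡ Q x ∧ not (x == b)
  pw x with x ≟ a | x ≟ b
  ... | yes refl | _ = trans (∧-zeroʳ _) (sym (trans (cong (_∧ _) qa) refl))
  ... | no _ | yes refl = trans (cong (_∧ true) pb) (sym (∧-zeroʳ _))
  ... | no n1 | no n2 = cong (_∧ true) (h x n1 n2)

#classes-del-nonMin : ∀ {m} (L : Sub m) r s z → EquivalenceOn L r → r s z ≡ true → isClassMin L r z ≡ true → z ≢ s →
  #classes (del L s) r ≡ #classes L r
#classes-del-nonMin L r s z E rsz mz zs = trans (#classes≡count (del L s) r) (trans (count-cong _ _ pw) (sym (#classes≡count L r)))
  where
  lz : L z ≡ true
  lz = isClassMin-live L r z mz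
  pw : ∀ x → isClassMin (del L s) r x ≡ isClassMin L r x
  pw x = dc (x ≟ s)
   where
   dc : Dec (x ≡ s) → isClassMin (del L s) r x ≡ isClassMin L r x
   dc (yes refl) = trans (isClassMin-dead (del L x) r x (del-at L x)) (sym notms)
     where
     notms : isClassMin L r x ≡ false
     notms with isClassMin L r x in e
     ... | false = refl
     ... | true = ⊥-elim (zs (sym (classMin-unique L r E x z e mz rsz)))
   dc (no xs) = bool-ext bwd fwd
     where
     fwd : isClassMin (del L s) r x ≡ true → isClassMin L r x ≡ true
     fwd e = isClassMin-intro L r x lx case
       where
       lx : L x ≡ true
       lx = del-live L s x (isClassMin-live (del L s) r x e)
       case : ∀ y → L y ≡ true → r x y ≡ true → toℕ y < toℕ x → ⊥
       case y ly rxy lt with y ≟ s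
       ... | no ys = isClassMin-below (del L s) r x y e (del-intro L s y ly ys) rxy lt
       ... | yes refl = isClassMin-below (del L y) r x z e (del-intro L y z lz zs)
                          (trans-on E x y z lx ly lz rxy rsz)
                          (<-trans (≤∧≢⇒< (classMin-≤ L r E z y mz ly (sym-on E y z ly lz rsz)) (λ q → zs (toℕ-injective q))) lt)
     bwd : isClassMin L r x ≡ true → isClassMin (del L s) r x ≡ true
     bwd e = isClassMin-intro (del L s) r x (del-intro L s x (isClassMin-live L r x e) xs)
               (λ y ly rxy lt → isClassMin-below L r x y e (del-live L s y ly) rxy lt)

#classes-del-min : ∀ {m} (L : Sub m) r z y0 → EquivalenceOn L r → isClassMin L r z ≡ true →
  L y0 ≡ true → y0 ≢ z → r z y0 ≡ true → #classes (del L z) r ≡ #classes L r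
#classes-del-min L r z y0 E mz ly0 ne0 rsy0 = trans (#classes≡count (del L z) r) (trans (sym swap) (sym (#classes≡count L r)))
  where
  ls : L z ≡ true
  ls = isClassMin-live L r z mz
  Ed : EquivalenceOn (del L z) r
  Ed = EquivalenceOn-⊆ L (del L z) r E (del-live L z)
  ex : Σ (Fin _) λ z' → r y0 z' ≡ true × isClassMin (del L z) r z' ≡ true
  ex = classMin-exists (del L z) r Ed y0 (del-intro L z y0 ly0 ne0)
  z' : Fin _
  z' = proj₁ ex
  ry0z' : r y0 z' ≡ true
  ry0z' = proj₁ (proj₂ ex)
  mz' : isClassMin (del L z) r z' ≡ true
  mz' = proj₂ (proj₂ ex)
  lz'd : del L z z' ≡ true
  lz'd = isClassMin-live (del L z) r z' mz'
  lz' : L z' ≡ true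
  lz' = del-live L z z' lz'd
  z'≢z : z' ≢ z
  z'≢z = del-ne L z z' lz'd
  rzz' : r z z' ≡ true
  rzz' = trans-on E z y0 z' ls ly0 lz' rsy0 ry0z'
  Pz' : isClassMin L r z' ≡ false
  Pz' with isClassMin L r z' in e
  ... | false = refl
  ... | true = ⊥-elim (z'≢z (classMin-unique L r E z' z e mz (sym-on E z z' ls lz' rzz')))
  swap : count (isClassMin L r) ≡ count (isClassMin (del L z) r)
  swap = count-swap (isClassMin L r) (isClassMin (del L z) r) z z' mz mz' Pz' (isClassMin-dead (del L z) r z (del-at L z)) pw
    where
    pw : ∀ x → x ≢ z → x ≢ z' → isClassMin L r x ≡ isClassMin (del L z) r x
    pw x xz xz' = bool-ext bwd fwd
      where
      fwd : isClassMin L r x ≡ true → isClassMin (del L z) r x ≡ true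
      fwd e = isClassMin-intro (del L z) r x (del-intro L z x (isClassMin-live L r x e) xz)
                (λ y ly rxy lt → isClassMin-below L r x y e (del-live L z y ly) rxy lt)
      bwd : isClassMin (del L z) r x ≡ true → isClassMin L r x ≡ true
      bwd e = isClassMin-intro L r x lx case
        where
        lx : L x ≡ true
        lx = del-live L z x (isClassMin-live (del L z) r x e)
        case : ∀ y → L y ≡ true → r x y ≡ true → toℕ y < toℕ x → ⊥
        case y ly rxy lt with y ≟ z
        ... | no yz = isClassMin-below (del L z) r x y e (del-intro L z y ly yz) rxy lt
        ... | yes refl = xz' (classMin-unique (del L y) r Ed x z' e mz' (trans-on E x y z' lx ly lz' rxy rzz'))

#classes-del-nonsingleton : ∀ {m} (L : Sub m) r s y0 → EquivalenceOn L r → L s ≡ true → L y0 ≡ true → y0 ≢ s → r s y0 ≡ true →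
  #classes (del L s) r ≡ #classes L r
#classes-del-nonsingleton L r s y0 E ls ly0 ne0 rsy0 with classMin-exists L r E s ls
... | z , rsz , mz with z ≟ s
... | no zs = #classes-del-nonMin L r s z E rsz mz zs
... | yes refl = #classes-del-min L r z y0 E mz ly0 ne0 rsy0

InvolutiveOn : ∀ {m} → Sub m → List (Fun m) → Set
InvolutiveOn {m} L gs = ∀ (g : Fun m) → g ∈ gs → ∀ x → L x ≡ true → L (g x) ≡ true × g (g x) ≡ x

Reach-live : ∀ {m} (L : Sub m) gs → InvolutiveOn L gs → ∀ {x y} → Reach gs x y → L x ≡ true → L y ≡ true
Reach-live L gs G done lx = lx
Reach-live L gs G {x} (move g i p) lx = Reach-live L gs G p (proj₁ (G g i x lx))

Reach-sym : ∀ {m} (L : Sub m) gs → InvolutiveOn L gs → ∀ {x y} → Reach gs x y → L x ≡ true → Reach gs y x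
Reach-sym L gs G done lx = done
Reach-sym L gs G {x} (move g i p) lx =
  Reach-trans (Reach-sym L gs G p (proj₁ (G g i x lx)))
              (move g i (subst (Reach gs (g (g x))) (proj₂ (G g i x lx)) done))

cls-equivalenceOn : ∀ {m} (L : Sub m) gs → InvolutiveOn L gs → EquivalenceOn L (cls gs)
cls-equivalenceOn L gs G = record
  { refl-on = λ x lx → cls-complete gs x x done
  ; sym-on = λ x y lx ly e → cls-complete gs y x (Reach-sym L gs G (cls-sound gs x y e) lx)
  ; trans-on = λ x y z lx ly lz e1 e2 → cls-complete gs x z (Reach-trans (cls-sound gs x y e1) (cls-sound gs y z e2)) }

record InvolutionOn {m} (L : Sub m) (p : Fun m) : Set where
  field
    live : ∀ x → L x ≡ true → L (p x) ≡ true
    inv : ∀ x → L x ≡ true → p (p x) ≡ x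
    nofix : ∀ x → L x ≡ true → p x ≢ x
open InvolutionOn public

involutiveOn₂ : ∀ {m} (L : Sub m) p q → InvolutionOn L p → InvolutionOn L q → InvolutiveOn L (p ∷ q ∷ [])
involutiveOn₂ L p q P Q .p (here refl) x lx = live P x lx , inv P x lx
involutiveOn₂ L p q P Q .q (there (here refl)) x lx = live Q x lx , inv Q x lx

isEven : ℕ → Bool
isEven zero = true
isEven (suc n) = not (isEven n)

isEven-+-even : ∀ a n → isEven n ≡ true → isEven (a + n) ≡ isEven a
isEven-+-even zero n e = e
isEven-+-even (suc a) n e = cong not (isEven-+-even a n e)

isEven-+-odd : ∀ a n → isEven n ≡ false → isEven (a + n) ≡ not (isEven a)
isEven-+-odd zero n e = e
isEven-+-odd (suc a) n e = cong not (isEven-+-odd a n e)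

alternate : ∀ {m} → Fun m → Fun m → ℕ → Fun m
alternate p q j = if isEven j then p else q

alternate-swap : ∀ {m} (p q : Fun m) j → alternate q p j ≡ alternate p q (suc j)
alternate-swap p q j with isEven j
... | true = refl
... | false = refl

walk-suc : ∀ {m} (p q : Fun m) j s → walk p q (suc j) s ≡ alternate p q j (walk p q j s)
walk-suc p q zero s = refl
walk-suc p q (suc j) s = trans (walk-suc q p j (p s)) (cong (λ f → f (walk q p j (p s))) (alternate-swap p q j))

least : (P : ℕ → Bool) → ∀ n → P n ≡ true →
  Σ ℕ λ k → k ≤ n × P k ≡ true × (∀ i → i < k → P i ≡ false)
least P n pn = scan 0 n (λ i ()) refl
  where
  scan : ∀ k fuel → (∀ i → i < k → P i ≡ false) → k + fuel ≡ n →
    Σ ℕ λ k → k ≤ n × P k ≡ true × (∀ i → i < k → P i ≡ false)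
  scan k fuel h eq with P k in e
  ... | true = k , subst (k ≤_) eq (m≤m+n k fuel) , e , h
  scan k zero h eq | false = ⊥-elim (f≢t (trans (sym e) (trans (cong P (trans (sym (+-identityʳ k)) eq)) pn)))
  scan k (suc fuel) h eq | false = scan (suc k) fuel h' (trans (sym (+-suc k fuel)) eq)
    where
    h' : ∀ i → i < suc k → P i ≡ false
    h' i i<sk with m≤n⇒m<n∨m≡n (≤-pred i<sk)
    ... | inj₁ lt = h i lt
    ... | inj₂ refl = e

alternate-∈ : ∀ {m} (gs : List (Fun m)) p q → p ∈ gs → q ∈ gs → ∀ i → alternate p q i ∈ gs
alternate-∈ gs p q ip iq i with isEven i
... | true = ip
... | false = iq

-- The polygon of L(p,q) through s: W j is the j-th side of the walk s, p s, q (p s), …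
module Polygon {m} (L : Sub m) (p q : Fun m) (P : InvolutionOn L p) (Q : InvolutionOn L q) (s : Fin m) (ls : L s ≡ true) where

  W : ℕ → Fin m
  W j = walk p q j s

  W-suc : ∀ j → W (suc j) ≡ alternate p q j (W j)
  W-suc j = walk-suc p q j s

  f-live : ∀ j x → L x ≡ true → L (alternate p q j x) ≡ true
  f-live j x lx with isEven j
  ... | true = live P x lx
  ... | false = live Q x lx

  f-inv : ∀ j x → L x ≡ true → alternate p q j (alternate p q j x) ≡ x
  f-inv j x lx with isEven j
  ... | true = inv P x lx
  ... | false = inv Q x lx

  f-nofix : ∀ j x → L x ≡ true → alternate p q j x ≢ x
  f-nofix j x lx with isEven j
  ... | true = nofix P x lx
  ... | false = nofix Q x lx

  alternate-isEven : ∀ i j → isEven i ≡ isEven j → alternate p q i ≡ alternate p q j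
  alternate-isEven i j e rewrite e = refl

  W-live : ∀ j → L (W j) ≡ true
  W-live zero = ls
  W-live (suc j) rewrite W-suc j = f-live j (W j) (W-live j)

  W-back : ∀ j → alternate p q j (W (suc j)) ≡ W j
  W-back j rewrite W-suc j = f-inv j (W j) (W-live j)

  -- Stepping inwards from both ends keeps the two sides equal; an odd gap ends in a fixed point of p or q.
  no-odd-return : ∀ d a → isEven d ≡ false → W a ≡ W (a + d) → ⊥
  no-odd-return zero a () e
  no-odd-return (suc zero) a _ e = f-nofix a (W a) (W-live a) (sym (trans e (trans (cong W (+-comm a 1)) (W-suc a))))
  no-odd-return (suc (suc d)) a pd e = no-odd-return d (suc a) pd' e'
    where
    pd' : isEven d ≡ false
    pd' = trans (sym (not-involutive (isEven d))) pd
    b' : ℕ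
    b' = suc a + d
    idx : a + suc (suc d) ≡ suc b'
    idx = trans (+-suc a (suc d)) (cong suc (+-suc a d))
    pb : isEven b' ≡ isEven a
    pb = trans (isEven-+-odd (suc a) d pd') (not-involutive (isEven a))
    e' : W (suc a) ≡ W (suc a + d)
    e' = begin
        W (suc a)                      ≡⟨ W-suc a ⟩
        alternate p q a (W a)                 ≡⟨ cong (alternate p q a) (trans e (cong W idx)) ⟩
        alternate p q a (W (suc b'))          ≡⟨ cong (λ f → f (W (suc b'))) (alternate-isEven a b' (sym pb)) ⟩
        alternate p q b' (W (suc b'))         ≡⟨ W-back b' ⟩
        W b' ∎
      where open ≡-Reasoning

  even-return-shift : ∀ a d → isEven d ≡ true → W a ≡ W (a + d) → W 0 ≡ W d
  even-return-shift zero d pd e = e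
  even-return-shift (suc a) d pd e = even-return-shift a d pd e'
    where
    e' : W a ≡ W (a + d)
    e' = begin
      W a                               ≡⟨ sym (W-back a) ⟩
      alternate p q a (W (suc a))              ≡⟨ cong (alternate p q a) e ⟩
      alternate p q a (W (suc (a + d)))        ≡⟨ cong (λ f → f (W (suc (a + d)))) (alternate-isEven a (a + d) (sym (isEven-+-even a d pd))) ⟩
      alternate p q (a + d) (W (suc (a + d)))  ≡⟨ W-back (a + d) ⟩
      W (a + d) ∎
      where open ≡-Reasoning

  period-exists : Σ ℕ λ d → 0 < d × d ≤ m × W d ≡ W 0
  period-exists with pigeonhole (n<1+n m) (λ (i : Fin (suc m)) → W (toℕ i))
  ... | i , j , i<j , eq = dd , 0<dd , dd≤m , sym pe
    where
    a b dd : ℕ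
    a = toℕ i
    b = toℕ j
    dd = b ∸ a
    bad : b ≡ a + dd
    bad = sym (m+[n∸m]≡n (<⇒≤ i<j))
    0<dd : 0 < dd
    0<dd = m<n⇒0<n∸m i<j
    dd≤m : dd ≤ m
    dd≤m = ≤-trans (m∸n≤m b a) (≤-pred (toℕ<n j))
    eq' : W a ≡ W (a + dd)
    eq' = trans eq (cong W bad)
    pe : W 0 ≡ W dd
    pe with isEven dd in pd
    ... | true = even-return-shift a dd pd eq'
    ... | false = ⊥-elim (no-odd-return dd a pd eq')

  isPer : ℕ → Bool
  isPer k = not (k ℕ.≡ᵇ 0) ∧ (W k == W 0)

  least-period : Σ ℕ λ k → k ≤ proj₁ period-exists × isPer k ≡ true × (∀ i → i < k → isPer i ≡ false)
  least-period = least isPer (proj₁ period-exists)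
    (∧-intro (lem (proj₁ (proj₂ period-exists))) (≡⇒== (proj₂ (proj₂ (proj₂ period-exists)))))
    where
    lem : ∀ {d} → 0 < d → not (d ℕ.≡ᵇ 0) ≡ true
    lem {suc d} _ = refl

  abstract
    period : ℕ
    period = proj₁ least-period

    period≤m : period ≤ m
    period≤m = ≤-trans (proj₁ (proj₂ least-period)) (proj₁ (proj₂ (proj₂ period-exists)))

    walk-period : W period ≡ W 0
    walk-period = ==⇒≡ (∧-r (not (period ℕ.≡ᵇ 0)) (proj₁ (proj₂ (proj₂ least-period))))

    period-pos : 0 < period
    period-pos = lem period (∧-l _ (proj₁ (proj₂ (proj₂ least-period))))
      where
      lem : ∀ k → not (k ℕ.≡ᵇ 0) ≡ true → 0 < k
      lem (suc k) _ = s≤s z≤n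

    period-minimal : ∀ i → 0 < i → i < period → W i ≢ W 0
    period-minimal i 0<i i<Tp e with proj₂ (proj₂ (proj₂ least-period)) i i<Tp
    ... | h = f≢t (trans (sym h) (∧-intro (lem i 0<i) (≡⇒== e)))
      where
      lem : ∀ k → 0 < k → not (k ℕ.≡ᵇ 0) ≡ true
      lem (suc k) _ = refl

  period-even : isEven period ≡ true
  period-even with isEven period in e
  ... | true = refl
  ... | false = ⊥-elim (no-odd-return period 0 e (sym walk-period))

  walk-injective-< : ∀ a b → a < b → b < period → W a ≢ W b
  walk-injective-< a b a<b b<Tp e with isEven (b ∸ a) in pd
  ... | false = no-odd-return (b ∸ a) a pd (trans e (cong W (sym (m+[n∸m]≡n (<⇒≤ a<b)))))
  ... | true = period-minimal (b ∸ a) (m<n⇒0<n∸m a<b) (≤-<-trans (m∸n≤m b a) b<Tp)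
                 (sym (even-return-shift a (b ∸ a) pd (trans e (cong W (sym (m+[n∸m]≡n (<⇒≤ a<b)))))))

  W-periodic : ∀ j → W (j + period) ≡ W j
  W-periodic zero = walk-period
  W-periodic (suc j) = begin
    W (suc (j + period))             ≡⟨ W-suc (j + period) ⟩
    alternate p q (j + period) (W (j + period))  ≡⟨ cong₂ (λ f x → f x) (alternate-isEven (j + period) j (isEven-+-even j period period-even)) (W-periodic j) ⟩
    alternate p q j (W j)              ≡⟨ sym (W-suc j) ⟩
    W (suc j) ∎
    where open ≡-Reasoning

  reduce : ∀ j → Σ ℕ λ i → i < period × W j ≡ W i
  reduce j = go j j ≤-refl
    where
    go : ∀ fuel j → j ≤ fuel → Σ ℕ λ i → i < period × W j ≡ W i
    go fuel j j≤ with j ℕ.<? period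
    ... | yes lt = j , lt , refl
    go zero j j≤ | no nlt = ⊥-elim (nlt (≤-trans (s≤s j≤) period-pos))
    go (suc fuel) j j≤ | no nlt with go fuel (j ∸ period) (≤-trans (∸-monoʳ-≤ j period-pos) (∸-monoˡ-≤ 1 j≤))
    ... | i , i<Tp , e = i , i<Tp , trans (cong W (sym (m∸n+n≡m (≮⇒≥ nlt)))) (trans (W-periodic (j ∸ period)) e)

  alternate-even : ∀ j → isEven j ≡ true → alternate p q j ≡ p
  alternate-even j e rewrite e = refl

  alternate-odd : ∀ j → isEven j ≡ false → alternate p q j ≡ q
  alternate-odd j e rewrite e = refl

  isEven-pred : ∀ j b → isEven (suc j) ≡ b → isEven j ≡ not b
  isEven-pred j b e = trans (sym (not-involutive (isEven j))) (cong not e)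

  p-orbit : ∀ j → Σ ℕ λ i → W i ≡ p (W j)
  p-orbit j with isEven j in e
  ... | true = suc j , trans (W-suc j) (cong (λ f → f (W j)) (alternate-even j e))
  p-orbit zero | false = ⊥-elim (t≢f e)
  p-orbit (suc j) | false = j , trans (sym (W-back j)) (cong (λ f → f (W (suc j))) (alternate-even j (isEven-pred j false e)))

  q-orbit : ∀ j → Σ ℕ λ i → W i ≡ q (W j)
  q-orbit j with isEven j in e
  ... | false = suc j , trans (W-suc j) (cong (λ f → f (W j)) (alternate-odd j e))
  q-orbit (suc j) | true = j , trans (sym (W-back j)) (cong (λ f → f (W (suc j))) (alternate-odd j (isEven-pred j true e)))
  q-orbit zero | true = lem period period-even walk-period period-pos
    where
    lem : ∀ t → isEven t ≡ true → W t ≡ W 0 → 0 < t → Σ ℕ λ i → W i ≡ q (W 0)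
    lem (suc t) pe wt _ = t , trans (sym (W-back t)) (cong₂ (λ f x → f x) (alternate-odd t (isEven-pred t true pe)) wt)

  reach⇒on-walk : ∀ {x y} → Reach (p ∷ q ∷ []) x y → ∀ j → W j ≡ x → Σ ℕ λ i → W i ≡ y
  reach⇒on-walk done j e = j , e
  reach⇒on-walk (move .p (here refl) r) j e with p-orbit j
  ... | i , ei = reach⇒on-walk r i (trans ei (cong p e))
  reach⇒on-walk (move .q (there (here refl)) r) j e with q-orbit j
  ... | i , ei = reach⇒on-walk r i (trans ei (cong q e))

  cls⇒on-walk : ∀ y → cls (p ∷ q ∷ []) s y ≡ true → Σ ℕ λ i → i < period × W i ≡ y
  cls⇒on-walk y e with reach⇒on-walk (cls-sound _ s y e) 0 refl
  ... | i , ei with reduce i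
  ... | k , k<T , ek = k , k<T , trans (sym ek) ei

  walk-reach : ∀ j → Reach (p ∷ q ∷ []) s (W j)
  walk-reach zero = done
  walk-reach (suc j) with isEven j in e
  ... | true = subst (Reach (p ∷ q ∷ []) s) (sym (trans (W-suc j) (cong (λ f → f (W j)) (alternate-even j e))))
                 (Reach-snoc p (here refl) (walk-reach j))
  ... | false = subst (Reach (p ∷ q ∷ []) s) (sym (trans (W-suc j) (cong (λ f → f (W j)) (alternate-odd j e))))
                 (Reach-snoc q (there (here refl)) (walk-reach j))

  walk-arc : ∀ (gs' : List (Fun m)) (p' q' : Fun m) → p' ∈ gs' → q' ∈ gs' → ∀ a k →
    (∀ i → a ≤ i → i < a + k → alternate p' q' i (W i) ≡ alternate p q i (W i)) → Reach gs' (W a) (W (a + k))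
  walk-arc gs' p' q' ip iq a zero h = subst (λ u → Reach gs' (W a) (W u)) (sym (+-identityʳ a)) done
  walk-arc gs' p' q' ip iq a (suc k) h =
    subst (λ u → Reach gs' (W a) (W u)) (sym (+-suc a k))
      (subst (Reach gs' (W a)) (trans (h (a + k) (m≤m+n a k) (+-monoʳ-< a (n<1+n k))) (sym (W-suc (a + k))))
        (Reach-snoc (alternate p' q' (a + k)) (alternate-∈ gs' p' q' ip iq (a + k))
          (walk-arc gs' p' q' ip iq a k (λ i a≤ i< → h i a≤ (<-trans i< (+-monoʳ-< a (n<1+n k)))))))

  period≥2 : 2 ≤ period
  period≥2 with period | period-even | period-pos
  ... | suc zero | () | _
  ... | suc (suc t) | _ | _ = s≤s (s≤s z≤n)

  T1 : ℕ
  T1 = period ∸ 1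

  sucT1 : suc T1 ≡ period
  sucT1 = trans (+-comm 1 T1) (m∸n+n≡m {period} {1} (≤-trans (s≤s z≤n) period≥2))

  parT1 : isEven T1 ≡ false
  parT1 = trans (sym (not-involutive (isEven T1))) (cong not (trans (cong isEven sucT1) period-even))

  WT1 : W T1 ≡ q s
  WT1 = trans (sym (W-back T1)) (cong₂ (λ f x → f x) (alternate-odd T1 parT1) (trans (cong W sucT1) walk-period))

  T1<Tp : T1 < period
  T1<Tp = subst (T1 <_) sucT1 ≤-refl

  p-even : ∀ j → isEven j ≡ true → p (W j) ≡ W (suc j)
  p-even j e = sym (trans (W-suc j) (cong (λ f → f (W j)) (alternate-even j e)))

  p-odd : ∀ j → isEven (suc j) ≡ false → p (W (suc j)) ≡ W j
  p-odd j e = trans (cong (λ f → f (W (suc j))) (sym (alternate-even j (isEven-pred j false e)))) (W-back j)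

  q-odd : ∀ j → isEven j ≡ false → q (W j) ≡ W (suc j)
  q-odd j e = sym (trans (W-suc j) (cong (λ f → f (W j)) (alternate-odd j e)))

  q-even : ∀ j → isEven (suc j) ≡ true → q (W (suc j)) ≡ W j
  q-even j e = trans (cong (λ f → f (W (suc j))) (sym (alternate-odd j (isEven-pred j true e)))) (W-back j)

  walk-cls : ∀ j → cls (p ∷ q ∷ []) s (W j) ≡ true
  walk-cls j = cls-complete _ s (W j) (walk-reach j)

  walk-injective : ∀ i j → i < period → j < period → i ≢ j → W i ≢ W j
  walk-injective i j i< j< ne e with <-cmp i j
  ... | tri< a _ _ = walk-injective-< i j a j< e
  ... | tri≈ _ b _ = ne b
  ... | tri> _ _ c = walk-injective-< j i c i< (sym e)

del2 : ∀ {m} → Sub m → Fin m → Fin m → Sub m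
del2 L s1 s2 = del (del L s1) s2

del2-intro : ∀ {m} (L : Sub m) s1 s2 x → L x ≡ true → x ≢ s1 → x ≢ s2 → del2 L s1 s2 x ≡ true
del2-intro L s1 s2 x lx n1 n2 = del-intro (del L s1) s2 x (del-intro L s1 x lx n1) n2

del2-live : ∀ {m} (L : Sub m) s1 s2 x → del2 L s1 s2 x ≡ true → L x ≡ true
del2-live L s1 s2 x e = del-live L s1 x (del-live (del L s1) s2 x e)

del2-ne1 : ∀ {m} (L : Sub m) s1 s2 x → del2 L s1 s2 x ≡ true → x ≢ s1
del2-ne1 L s1 s2 x e = del-ne L s1 x (del-live (del L s1) s2 x e)

del2-ne2 : ∀ {m} (L : Sub m) s1 s2 x → del2 L s1 s2 x ≡ true → x ≢ s2
del2-ne2 L s1 s2 x e = del-ne (del L s1) s2 x e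

module PairRemoval {m} (L : Sub m) (P : Fun m) (IP : InvolutionOn L P) (s1 s2 : Fin m)
           (l1 : L s1 ≡ true) (l2 : L s2 ≡ true) (ne : s1 ≢ s2) where

  P' : Fun m
  P' = removeP P s1 s2
  L' : Sub m
  L' = del2 L s1 s2

  rem-same : P s1 ≡ s2 → ∀ x → P' x ≡ P x
  rem-same e x rewrite ≡⇒== e = refl

  rem-diff : P s1 ≢ s2 → ∀ x → P' x ≡ (if x == P s1 then P s2 else if x == P s2 then P s1 else P x)
  rem-diff n x rewrite ≢⇒==false n = refl

  rem-t1 : P s1 ≢ s2 → P' (P s1) ≡ P s2
  rem-t1 n rewrite rem-diff n (P s1) | ==-refl (P s1) = refl

  P-injective : ∀ {a b} → L a ≡ true → L b ≡ true → P a ≡ P b → a ≡ b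
  P-injective {a} {b} la lb e = trans (sym (inv IP a la)) (trans (cong P e) (inv IP b lb))

  t1≢t2 : P s1 ≢ P s2
  t1≢t2 e = ne (P-injective l1 l2 e)

  rem-t2 : P s1 ≢ s2 → P' (P s2) ≡ P s1
  rem-t2 n rewrite rem-diff n (P s2) | ≢⇒==false (λ e → t1≢t2 (sym e)) | ==-refl (P s2) = refl

  rem-other : ∀ x → x ≢ P s1 → x ≢ P s2 → P' x ≡ P x
  rem-other x n1 n2 = dc (P s1 ≟ s2)
    where
    dc : Dec (P s1 ≡ s2) → P' x ≡ P x
    dc (yes e) = rem-same e x
    dc (no n) rewrite rem-diff n x | ≢⇒==false n1 | ≢⇒==false n2 = refl

  P-hit1 : ∀ x → L x ≡ true → P x ≡ s1 → x ≡ P s1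
  P-hit1 x lx e = trans (sym (inv IP x lx)) (cong P e)

  P-hit2 : ∀ x → L x ≡ true → P x ≡ s2 → x ≡ P s2
  P-hit2 x lx e = trans (sym (inv IP x lx)) (cong P e)

  t2≢s1 : P s1 ≢ s2 → P s2 ≢ s1
  t2≢s1 n e = n (trans (cong P (sym e)) (inv IP s2 l2))

  rem-inv : InvolutionOn L' P'
  rem-inv = dc (P s1 ≟ s2)
   where
   dc : Dec (P s1 ≡ s2) → InvolutionOn L' P'
   dc (yes e) = record
     { live = λ x lx → del2-intro L s1 s2 (P' x) (subst (λ u → L u ≡ true) (sym (rem-same e x)) (live IP x (del2-live L s1 s2 x lx)))
                         (λ h → del2-ne2 L s1 s2 x lx (trans (P-hit1 x (del2-live L s1 s2 x lx) (trans (sym (rem-same e x)) h)) e))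
                         (λ h → del2-ne1 L s1 s2 x lx (trans (P-hit2 x (del2-live L s1 s2 x lx) (trans (sym (rem-same e x)) h))
                                    (trans (cong P (sym e)) (inv IP s1 l1))))
     ; inv = λ x lx → trans (rem-same e (P' x)) (trans (cong P (rem-same e x)) (inv IP x (del2-live L s1 s2 x lx)))
     ; nofix = λ x lx h → nofix IP x (del2-live L s1 s2 x lx) (trans (sym (rem-same e x)) h) }
   dc (no n) = record { live = lv ; inv = iv ; nofix = nf }
     where
     lt1 : L' (P s1) ≡ true
     lt1 = del2-intro L s1 s2 (P s1) (live IP s1 l1) (nofix IP s1 l1) n
     lt2 : L' (P s2) ≡ true
     lt2 = del2-intro L s1 s2 (P s2) (live IP s2 l2) (t2≢s1 n) (nofix IP s2 l2)
     lv : ∀ x → L' x ≡ true → L' (P' x) ≡ true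
     lv x lx with x ≟ P s1 | x ≟ P s2
     ... | yes refl | _ = subst (λ u → L' u ≡ true) (sym (rem-t1 n)) lt2
     ... | no _ | yes refl = subst (λ u → L' u ≡ true) (sym (rem-t2 n)) lt1
     ... | no n1 | no n2 = subst (λ u → L' u ≡ true) (sym (rem-other x n1 n2))
             (del2-intro L s1 s2 (P x) (live IP x (del2-live L s1 s2 x lx))
               (λ h → n1 (P-hit1 x (del2-live L s1 s2 x lx) h)) (λ h → n2 (P-hit2 x (del2-live L s1 s2 x lx) h)))
     iv : ∀ x → L' x ≡ true → P' (P' x) ≡ x
     iv x lx with x ≟ P s1 | x ≟ P s2
     ... | yes refl | _ = trans (cong P' (rem-t1 n)) (rem-t2 n)
     ... | no _ | yes refl = trans (cong P' (rem-t2 n)) (rem-t1 n)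
     ... | no n1 | no n2 = trans (cong P' (rem-other x n1 n2))
             (trans (rem-other (P x) (λ h → del2-ne1 L s1 s2 x lx (P-injective lx' l1 h))
                                      (λ h → del2-ne2 L s1 s2 x lx (P-injective lx' l2 h)))
                (inv IP x lx'))
       where lx' = del2-live L s1 s2 x lx
     nf : ∀ x → L' x ≡ true → P' x ≢ x
     nf x lx h with x ≟ P s1 | x ≟ P s2
     ... | yes refl | _ = t1≢t2 (sym (trans (sym (rem-t1 n)) h))
     ... | no _ | yes refl = t1≢t2 (trans (sym (rem-t2 n)) h)
     ... | no n1 | no n2 = nofix IP x (del2-live L s1 s2 x lx) (trans (sym (rem-other x n1 n2)) h)

cls-⊆ : ∀ {m} (L' : Sub m) gs' → InvolutiveOn L' gs' → (Y : Rel m) → EquivalenceOn L' Y →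
  (∀ g → g ∈ gs' → ∀ x → L' x ≡ true → Y x (g x) ≡ true) →
  ∀ x y → L' x ≡ true → L' y ≡ true → cls gs' x y ≡ true → Y x y ≡ true
cls-⊆ L' gs' G Y EY h x y lx ly e = go (cls-sound gs' x y e) lx
  where
  go : ∀ {x y} → Reach gs' x y → L' x ≡ true → Y x y ≡ true
  go {x} done lx = refl-on EY x lx
  go {x} {y} (move g i p) lx = trans-on EY x (g x) y lx lgx (Reach-live L' gs' G p lgx) (h g i x lx) (go p lgx)
    where lgx = proj₁ (G g i x lx)

∈pair-dec : ∀ {m} (s1 s2 x : Fin m) → (x ≡ s1 ⊎ x ≡ s2) ⊎ (x ≢ s1 × x ≢ s2)
∈pair-dec s1 s2 x with x ≟ s1 | x ≟ s2
... | yes p | _ = inj₁ (inj₁ p)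
... | no _ | yes p = inj₁ (inj₂ p)
... | no n1 | no n2 = inj₂ (n1 , n2)

-- Old classes restricted to the surviving sides are contained in X once every survivor adjacent
-- to s1 or s2 is X-related to c: map s1 and s2 to c and follow any old path.
module OldClasses {m} (L : Sub m) (s1 s2 : Fin m) (gs : List (Fun m)) (G : InvolutiveOn L gs)
       (X : Rel m) (EX : EquivalenceOn (del2 L s1 s2) X)
       (edgeOK : ∀ g → g ∈ gs → ∀ x → del2 L s1 s2 x ≡ true → del2 L s1 s2 (g x) ≡ true → X x (g x) ≡ true)
       (c : Fin m) (lc : del2 L s1 s2 c ≡ true)
       (nb : ∀ g → g ∈ gs → ∀ i → (i ≡ s1 ⊎ i ≡ s2) → del2 L s1 s2 (g i) ≡ true → X c (g i) ≡ true) where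

  L' : Sub m
  L' = del2 L s1 s2

  π : Fin m → Fin m
  π x with ∈pair-dec s1 s2 x
  ... | inj₁ _ = c
  ... | inj₂ _ = x

  π-live : ∀ x → L x ≡ true → L' (π x) ≡ true
  π-live x lx with ∈pair-dec s1 s2 x
  ... | inj₁ _ = lc
  ... | inj₂ (n1 , n2) = del2-intro L s1 s2 x lx n1 n2

  π-id : ∀ x → L' x ≡ true → π x ≡ x
  π-id x lx with ∈pair-dec s1 s2 x
  ... | inj₁ (inj₁ e) = ⊥-elim (del2-ne1 L s1 s2 x lx e)
  ... | inj₁ (inj₂ e) = ⊥-elim (del2-ne2 L s1 s2 x lx e)
  ... | inj₂ _ = refl

  stepX : ∀ g → g ∈ gs → ∀ x → L x ≡ true → X (π x) (π (g x)) ≡ true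
  stepX g i x lx with ∈pair-dec s1 s2 x | ∈pair-dec s1 s2 (g x)
  ... | inj₁ _ | inj₁ _ = refl-on EX c lc
  ... | inj₁ xs | inj₂ (n1 , n2) = nb g i x xs (del2-intro L s1 s2 (g x) (proj₁ (G g i x lx)) n1 n2)
  ... | inj₂ (n1 , n2) | inj₁ gs' = sym-on EX c x lc lx' (subst (λ u → X c u ≡ true) (proj₂ (G g i x lx))
                                    (nb g i (g x) gs' (subst (λ u → L' u ≡ true) (sym (proj₂ (G g i x lx))) lx')))
    where lx' = del2-intro L s1 s2 x lx n1 n2
  ... | inj₂ (n1 , n2) | inj₂ (merge-old , merge-ab) = edgeOK g i x (del2-intro L s1 s2 x lx n1 n2) (del2-intro L s1 s2 (g x) (proj₁ (G g i x lx)) merge-old merge-ab)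

  go : ∀ {x y} → Reach gs x y → L x ≡ true → X (π x) (π y) ≡ true
  go {x} done lx = refl-on EX (π x) (π-live x lx)
  go {x} {y} (move g i p) lx = trans-on EX (π x) (π (g x)) (π y) (π-live x lx) (π-live (g x) lgx) (π-live y (Reach-live L gs G p lgx))
                                 (stepX g i x lx) (go p lgx)
    where lgx = proj₁ (G g i x lx)

  old-classes-⊆ : ∀ x y → L' x ≡ true → L' y ≡ true → cls gs x y ≡ true → X x y ≡ true
  old-classes-⊆ x y lx ly e = subst₂ (λ u v → X u v ≡ true) (π-id x lx) (π-id y ly)
                          (go (cls-sound gs x y e) (del2-live L s1 s2 x lx))

#classes-del2-nonsingleton : ∀ {m} (L : Sub m) r s1 s2 → EquivalenceOn L r → L s1 ≡ true → L s2 ≡ true → s1 ≢ s2 →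
  ∀ y1 → L y1 ≡ true → y1 ≢ s1 → r s1 y1 ≡ true →
  ∀ y2 → L y2 ≡ true → y2 ≢ s1 → y2 ≢ s2 → r s2 y2 ≡ true →
  #classes (del2 L s1 s2) r ≡ #classes L r
#classes-del2-nonsingleton L r s1 s2 E l1 l2 ne y1 ly1 n1 r1 y2 ly2 n21 n22 r2 =
  trans (#classes-del-nonsingleton (del L s1) r s2 y2 (EquivalenceOn-⊆ L (del L s1) r E (del-live L s1))
           (del-intro L s1 s2 l2 (λ e → ne (sym e))) (del-intro L s1 y2 ly2 n21) n22 r2)
        (#classes-del-nonsingleton L r s1 y1 E l1 ly1 n1 r1)

#classes-del2-pair : ∀ {m} (L : Sub m) r s1 s2 → EquivalenceOn L r → L s1 ≡ true → L s2 ≡ true → s1 ≢ s2 →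
  r s1 s2 ≡ true → (∀ y → L y ≡ true → r s1 y ≡ true → y ≡ s1 ⊎ y ≡ s2) →
  suc (#classes (del2 L s1 s2) r) ≡ #classes L r
#classes-del2-pair L r s1 s2 E l1 l2 ne r12 cl =
  trans (#classes-del-singleton (del L s1) r s2 (EquivalenceOn-⊆ L (del L s1) r E (del-live L s1))
           (del-intro L s1 s2 l2 (λ e → ne (sym e))) iso)
        (#classes-del-nonsingleton L r s1 s2 E l1 l2 (λ e → ne (sym e)) r12)
  where
  iso : ∀ y → del L s1 y ≡ true → r s2 y ≡ true → y ≡ s2
  iso y ly r2y with cl y (del-live L s1 y ly) (trans-on E s1 s2 y l1 l2 (del-live L s1 y ly) r12 r2y)
  ... | inj₁ e = ⊥-elim (del-ne L s1 y ly e)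
  ... | inj₂ e = e

merge-cases : ∀ {m} (r : Rel m) a b x y → merge r a b x y ≡ true →
  r x y ≡ true ⊎ ((r x a ≡ true × r b y ≡ true) ⊎ (r x b ≡ true × r a y ≡ true))
merge-cases r a b x y e with ∨-elim e
... | inj₁ h = inj₁ h
... | inj₂ h with ∨-elim h
... | inj₁ h2 = inj₂ (inj₁ (∧-l _ h2 , ∧-r (r x a) h2))
... | inj₂ h3 = inj₂ (inj₂ (∧-l _ h3 , ∧-r (r x b) h3))

merge-old : ∀ {m} (r : Rel m) a b x y → r x y ≡ true → merge r a b x y ≡ true
merge-old r a b x y h = ∨-introˡ h

merge-ab : ∀ {m} (r : Rel m) a b x y → r x a ≡ true → r b y ≡ true → merge r a b x y ≡ true
merge-ab r a b x y h1 h2 = ∨-introʳ (r x y) (∨-introˡ (∧-intro h1 h2))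

merge-ba : ∀ {m} (r : Rel m) a b x y → r x b ≡ true → r a y ≡ true → merge r a b x y ≡ true
merge-ba r a b x y h1 h2 = ∨-introʳ (r x y) (∨-introʳ (r x a ∧ r b y) (∧-intro h1 h2))

merge-equivalenceOn : ∀ {m} (L : Sub m) r a b → EquivalenceOn L r → L a ≡ true → L b ≡ true → EquivalenceOn L (merge r a b)
merge-equivalenceOn L r a b E la lb = record { refl-on = λ x lx → merge-old r a b x x (refl-on E x lx) ; sym-on = sy' ; trans-on = tr' }
  where
  sy' : ∀ x y → L x ≡ true → L y ≡ true → merge r a b x y ≡ true → merge r a b y x ≡ true
  sy' x y lx ly e with merge-cases r a b x y e
  ... | inj₁ h = merge-old r a b y x (sym-on E x y lx ly h)
  ... | inj₂ (inj₁ (h1 , h2)) = merge-ba r a b y x (sym-on E b y lb ly h2) (sym-on E x a lx la h1)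
  ... | inj₂ (inj₂ (h1 , h2)) = merge-ab r a b y x (sym-on E a y la ly h2) (sym-on E x b lx lb h1)
  tr' : ∀ x y z → L x ≡ true → L y ≡ true → L z ≡ true → merge r a b x y ≡ true → merge r a b y z ≡ true → merge r a b x z ≡ true
  tr' x y z lx ly lz e1 e2 with merge-cases r a b x y e1 | merge-cases r a b y z e2
  ... | inj₁ h | inj₁ k = merge-old r a b x z (trans-on E x y z lx ly lz h k)
  ... | inj₁ h | inj₂ (inj₁ (k1 , k2)) = merge-ab r a b x z (trans-on E x y a lx ly la h k1) k2
  ... | inj₁ h | inj₂ (inj₂ (k1 , k2)) = merge-ba r a b x z (trans-on E x y b lx ly lb h k1) k2
  ... | inj₂ (inj₁ (h1 , h2)) | inj₁ k = merge-ab r a b x z h1 (trans-on E b y z lb ly lz h2 k)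
  ... | inj₂ (inj₁ (h1 , h2)) | inj₂ (inj₁ (k1 , k2)) = merge-ab r a b x z h1 k2
  ... | inj₂ (inj₁ (h1 , h2)) | inj₂ (inj₂ (k1 , k2)) = merge-old r a b x z (trans-on E x a z lx la lz h1 k2)
  ... | inj₂ (inj₂ (h1 , h2)) | inj₁ k = merge-ba r a b x z h1 (trans-on E a y z la ly lz h2 k)
  ... | inj₂ (inj₂ (h1 , h2)) | inj₂ (inj₁ (k1 , k2)) = merge-old r a b x z (trans-on E x b z lx lb lz h1 k2)
  ... | inj₂ (inj₂ (h1 , h2)) | inj₂ (inj₂ (k1 , k2)) = merge-ba r a b x z h1 k2

merge-trivial : ∀ {m} (L : Sub m) r a b → EquivalenceOn L r → L a ≡ true → L b ≡ true → r a b ≡ true →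
  ∀ x y → L x ≡ true → L y ≡ true → merge r a b x y ≡ r x y
merge-trivial L r a b E la lb rab x y lx ly = bool-ext (merge-old r a b x y) fwd
  where
  fwd : merge r a b x y ≡ true → r x y ≡ true
  fwd e with merge-cases r a b x y e
  ... | inj₁ h = h
  ... | inj₂ (inj₁ (h1 , h2)) = trans-on E x b y lx lb ly (trans-on E x a b lx la lb h1 rab) h2
  ... | inj₂ (inj₂ (h1 , h2)) = trans-on E x a y lx la ly (trans-on E x b a lx lb la h1 (sym-on E a b la lb rab)) h2

#classes-merge-≤ : ∀ {m} (L : Sub m) r a b → EquivalenceOn L r → L a ≡ true → L b ≡ true →
  #classes L r ≤ suc (#classes L (merge r a b))
#classes-merge-≤ L r a b E la lb with r a b in e
... | false = ≤-reflexive (sym (#classes-merge L r (merge r a b) a b E la lb e (λ x y _ _ → refl)))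
... | true = ≤-trans (≤-reflexive (#classes-cong L L r (merge r a b) (λ _ → refl)
                        (λ x y lx ly → sym (merge-trivial L r a b E la lb e x y lx ly)))) (n≤1+n _)

Reach-transfer : ∀ {m} (L : Sub m) gs gs' → InvolutiveOn L gs →
  (∀ g → g ∈ gs → ∀ x → L x ≡ true → Σ (Fun m) λ g' → g' ∈ gs' × g' x ≡ g x) →
  ∀ {x y} → Reach gs x y → L x ≡ true → Reach gs' x y
Reach-transfer L gs gs' G h done lx = done
Reach-transfer L gs gs' G h {x} (move g i p) lx with h g i x lx
... | g' , i' , e = move g' i' (subst (λ u → Reach gs' u _) (sym e) (Reach-transfer L gs gs' G h p (proj₁ (G g i x lx))))

isEven-%2 : ∀ i → ((i % 2) ℕ.≡ᵇ 0) ≡ isEven i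
isEven-%2 zero = refl
isEven-%2 (suc zero) = refl
isEven-%2 (suc (suc i)) =
  trans (cong (λ u → u ℕ.≡ᵇ 0) (trans (cong (_% 2) (+-comm 2 i)) ([m+n]%n≡m%n i 2)))
        (trans (isEven-%2 i) (sym (not-involutive (isEven i))))

sameFaceType : ℕ → EdgeType
sameFaceType i = if isEven i then twisted else straight

firstHit-miss : ∀ {m} (b w : Fun m) s1 s2 k j → (∀ i → j ≤ i → i < j + k → walk b w i s1 ≢ s2) →
  firstHit b w s1 s2 k j ≡ interface
firstHit-miss b w s1 s2 zero j h = refl
firstHit-miss b w s1 s2 (suc k) j h rewrite ≢⇒==false (h j ≤-refl (m<m+n j (s≤s z≤n))) =
  firstHit-miss b w s1 s2 k (suc j) (λ i j< i< → h i (<⇒≤ j<) (subst (i <_) (sym (+-suc j k)) i<))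

firstHit-hit : ∀ {m} (b w : Fun m) s1 s2 k j i0 → j ≤ i0 → i0 < j + k → walk b w i0 s1 ≡ s2 →
  (∀ i → j ≤ i → i < i0 → walk b w i s1 ≢ s2) → firstHit b w s1 s2 k j ≡ sameFaceType i0
firstHit-hit b w s1 s2 zero j i0 j≤ lt e h = ⊥-elim (<-irrefl refl (≤-<-trans j≤ (subst (i0 <_) (+-identityʳ j) lt)))
firstHit-hit b w s1 s2 (suc k) j i0 j≤ lt e h with m≤n⇒m<n∨m≡n j≤
... | inj₂ refl rewrite ≡⇒== e | isEven-%2 j = refl
... | inj₁ j< rewrite ≢⇒==false (h j ≤-refl j<) =
  firstHit-hit b w s1 s2 k (suc j) i0 j< (subst (i0 <_) (+-suc j k) lt) e (λ i j<i i< → h i (<⇒≤ j<i) i<)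

isEven-≢ : ∀ i j → isEven i ≢ isEven j → i ≢ j
isEven-≢ i j n refl = n refl

Fin⇒1≤ : ∀ {m} → Fin m → 1 ≤ m
Fin⇒1≤ fz = s≤s z≤n
Fin⇒1≤ (fs _) = s≤s z≤n

-- Removing the edge {s1, s2} with s2 = e s1: primed names refer to M ∖ E, and t1, t2 (u1, u2) are
-- the b-partners (w-partners) of s1, s2.
module EdgeRemoval {m} (L : Sub m) (b w e : Fun m) (IB : InvolutionOn L b) (IW : InvolutionOn L w) (IE : InvolutionOn L e)
            (s1 : Fin m) (l1 : L s1 ≡ true) where

  s2 : Fin m
  s2 = e s1
  l2 : L s2 ≡ true
  l2 = live IE s1 l1
  ne12 : s1 ≢ s2
  ne12 h = nofix IE s1 l1 (sym h)
  L' : Sub m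
  L' = del2 L s1 s2

  b' w' e' : Fun m
  b' = removeP b s1 s2
  w' = removeP w s1 s2
  e' = removeP e s1 s2

  module RB = PairRemoval L b IB s1 s2 l1 l2 ne12
  module RW = PairRemoval L w IW s1 s2 l1 l2 ne12
  module RE = PairRemoval L e IE s1 s2 l1 l2 ne12

  IB' : InvolutionOn L' b'
  IB' = RB.rem-inv
  IW' : InvolutionOn L' w'
  IW' = RW.rem-inv
  IE' : InvolutionOn L' e'
  IE' = RE.rem-inv

  e'≡e : ∀ x → e' x ≡ e x
  e'≡e = RE.rem-same refl

  l'-intro : ∀ x → L x ≡ true → x ≢ s1 → x ≢ s2 → L' x ≡ true
  l'-intro = del2-intro L s1 s2

  L'⇒L : ∀ x → L' x ≡ true → L x ≡ true
  L'⇒L = del2-live L s1 s2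

  t1 t2 u1 u2 : Fin m
  t1 = b s1
  t2 = b s2
  u1 = w s1
  u2 = w s2

  module Neighbours (P : Fun m) (IP : InvolutionOn L P) where
    module RP = PairRemoval L P IP s1 s2 l1 l2 ne12
    P' : Fun m
    P' = removeP P s1 s2

    lP1 : P s1 ≢ s2 → L' (P s1) ≡ true
    lP1 n = l'-intro (P s1) (live IP s1 l1) (nofix IP s1 l1) n

    lP2 : P s1 ≢ s2 → L' (P s2) ≡ true
    lP2 n = l'-intro (P s2) (live IP s2 l2) (RP.t2≢s1 n) (nofix IP s2 l2)

    surv : ∀ x → L' x ≡ true → L' (P x) ≡ true → P' x ≡ P x
    surv x lx lpx = RP.rem-other x (λ h → del2-ne1 L s1 s2 (P x) lpx (trans (cong P h) (inv IP s1 l1)))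
                                   (λ h → del2-ne2 L s1 s2 (P x) lpx (trans (cong P h) (inv IP s2 l2)))

    same-live : P s1 ≡ s2 → ∀ x → L' x ≡ true → L' (P x) ≡ true
    same-live e x lx = l'-intro (P x) (live IP x (L'⇒L x lx))
       (λ h → del2-ne2 L s1 s2 x lx (trans (RP.P-hit1 x (L'⇒L x lx) h) e))
       (λ h → del2-ne1 L s1 s2 x lx (trans (RP.P-hit2 x (L'⇒L x lx) h) (trans (cong P (sym e)) (inv IP s1 l1))))

    newEdge : (Y : Rel m) → EquivalenceOn L' Y →
      (∀ x → L' x ≡ true → L' (P x) ≡ true → Y x (P x) ≡ true) →
      (P s1 ≢ s2 → Y (P s1) (P s2) ≡ true) →
      ∀ x → L' x ≡ true → Y x (P' x) ≡ true
    newEdge Y EY old cross x lx = dc (P s1 ≟ s2)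
      where
      dc : Dec (P s1 ≡ s2) → Y x (P' x) ≡ true
      dc (yes e) = subst (λ u → Y x u ≡ true) (sym (RP.rem-same e x)) (old x lx (same-live e x lx))
      dc (no n) with x ≟ P s1 | x ≟ P s2
      ... | yes refl | _ = subst (λ u → Y x u ≡ true) (sym (RP.rem-t1 n)) (cross n)
      ... | no _ | yes refl = subst (λ u → Y x u ≡ true) (sym (RP.rem-t2 n)) (sym-on EY (P s1) (P s2) (lP1 n) (lP2 n) (cross n))
      ... | no n1 | no n2 = subst (λ u → Y x u ≡ true) (sym (RP.rem-other x n1 n2))
                              (old x lx (l'-intro (P x) (live IP x (L'⇒L x lx))
                                (λ h → n1 (RP.P-hit1 x (L'⇒L x lx) h)) (λ h → n2 (RP.P-hit2 x (L'⇒L x lx) h))))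

  module NbB = Neighbours b IB
  module NbW = Neighbours w IW

  Fgs Fgs' : List (Fun m)
  Fgs = b ∷ w ∷ []
  Fgs' = b' ∷ w' ∷ []
  Fr Fr' : Rel m
  Fr = cls Fgs
  Fr' = cls Fgs'
  GF : InvolutiveOn L Fgs
  GF = involutiveOn₂ L b w IB IW
  GF' : InvolutiveOn L' Fgs'
  GF' = involutiveOn₂ L' b' w' IB' IW'
  EF : EquivalenceOn L Fr
  EF = cls-equivalenceOn L Fgs GF
  EF' : EquivalenceOn L' Fr'
  EF' = cls-equivalenceOn L' Fgs' GF'
  EFr : EquivalenceOn L' Fr
  EFr = EquivalenceOn-⊆ L L' Fr EF L'⇒L

  Fb : ∀ x → Fr x (b x) ≡ true
  Fb x = cls-complete Fgs x (b x) (Reach-one b (here refl))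
  Fw : ∀ x → Fr x (w x) ≡ true
  Fw x = cls-complete Fgs x (w x) (Reach-one w (there (here refl)))
  Fb' : ∀ x → Fr' x (b' x) ≡ true
  Fb' x = cls-complete Fgs' x (b' x) (Reach-one b' (here refl))
  Fw' : ∀ x → Fr' x (w' x) ≡ true
  Fw' x = cls-complete Fgs' x (w' x) (Reach-one w' (there (here refl)))

  newF-sub : (Y : Rel m) → EquivalenceOn L' Y →
    (∀ x → L' x ≡ true → L' (b x) ≡ true → Y x (b x) ≡ true) →
    (∀ x → L' x ≡ true → L' (w x) ≡ true → Y x (w x) ≡ true) →
    (b s1 ≢ s2 → Y t1 t2 ≡ true) → (w s1 ≢ s2 → Y u1 u2 ≡ true) →
    ∀ x y → L' x ≡ true → L' y ≡ true → Fr' x y ≡ true → Y x y ≡ true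
  newF-sub Y EY ob ow cb cw = cls-⊆ L' Fgs' GF' Y EY h
    where
    h : ∀ g → g ∈ Fgs' → ∀ x → L' x ≡ true → Y x (g x) ≡ true
    h .b' (here refl) = NbB.newEdge Y EY ob cb
    h .w' (there (here refl)) = NbW.newEdge Y EY ow cw

  obFr : ∀ x → L' x ≡ true → L' (b x) ≡ true → Fr x (b x) ≡ true
  obFr x _ _ = Fb x
  owFr : ∀ x → L' x ≡ true → L' (w x) ≡ true → Fr x (w x) ≡ true
  owFr x _ _ = Fw x

  NBF : Rel m → Fin m → Set
  NBF X c = ∀ g → g ∈ Fgs → ∀ i → (i ≡ s1 ⊎ i ≡ s2) → L' (g i) ≡ true → X c (g i) ≡ true

  nbF-intro : ∀ X c → (L' t1 ≡ true → X c t1 ≡ true) → (L' t2 ≡ true → X c t2 ≡ true) →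
    (L' u1 ≡ true → X c u1 ≡ true) → (L' u2 ≡ true → X c u2 ≡ true) → NBF X c
  nbF-intro X c h1 h2 h3 h4 .b (here refl) i (inj₁ refl) = h1
  nbF-intro X c h1 h2 h3 h4 .b (here refl) i (inj₂ refl) = h2
  nbF-intro X c h1 h2 h3 h4 .w (there (here refl)) i (inj₁ refl) = h3
  nbF-intro X c h1 h2 h3 h4 .w (there (here refl)) i (inj₂ refl) = h4

  oldF-sub : (X : Rel m) → EquivalenceOn L' X → (∀ x y → L' x ≡ true → L' y ≡ true → Fr' x y ≡ true → X x y ≡ true) →
    ∀ c → L' c ≡ true → NBF X c →
    ∀ x y → L' x ≡ true → L' y ≡ true → Fr x y ≡ true → X x y ≡ true
  oldF-sub X EX sup c lc nb = OldClasses.old-classes-⊆ L s1 s2 Fgs GF X EX eok c lc nb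
    where
    eok : ∀ g → g ∈ Fgs → ∀ x → L' x ≡ true → L' (g x) ≡ true → X x (g x) ≡ true
    eok .b (here refl) x lx lgx = sup x (b x) lx lgx (subst (λ u → Fr' x u ≡ true) (NbB.surv x lx lgx) (Fb' x))
    eok .w (there (here refl)) x lx lgx = sup x (w x) lx lgx (subst (λ u → Fr' x u ≡ true) (NbW.surv x lx lgx) (Fw' x))

  module FaceArcs (s : Fin m) (ls : L s ≡ true) where
    module As = Polygon L b w IB IW s ls
    open As using (W; period; T1)

    alternate-unchanged : ∀ i → (isEven i ≡ true → W i ≢ t1 × W i ≢ t2) → (isEven i ≡ false → W i ≢ u1 × W i ≢ u2) →
      alternate b' w' i (W i) ≡ alternate b w i (W i)
    alternate-unchanged i hb hw with isEven i in e
    ... | true = RB.rem-other (W i) (proj₁ (hb refl)) (proj₂ (hb refl))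
    ... | false = RW.rem-other (W i) (proj₁ (hw refl)) (proj₂ (hw refl))

    face-arc : (∀ i → 1 ≤ i → i < T1 → (isEven i ≡ true → W i ≢ t1 × W i ≢ t2) × (isEven i ≡ false → W i ≢ u1 × W i ≢ u2)) →
      Fr' (b s) (w s) ≡ true
    face-arc cond = cls-complete Fgs' (b s) (w s)
      (subst₂ (Reach Fgs') refl (trans (cong W idx) As.WT1)
        (As.walk-arc Fgs' b' w' (here refl) (there (here refl)) 1 (T1 ∸ 1)
          (λ i 1≤ i< → alternate-unchanged i (proj₁ (cond i 1≤ (subst (i <_) idx i<))) (proj₂ (cond i 1≤ (subst (i <_) idx i<))))))
      where
      T1≥1 : 1 ≤ T1
      T1≥1 = ≤-pred (subst (2 ≤_) (sym As.sucT1) As.period≥2)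
      idx : 1 + (T1 ∸ 1) ≡ T1
      idx = m+[n∸m]≡n T1≥1

  module InterfaceEdge (h : Fr s1 s2 ≡ false) where
    nb1 : b s1 ≢ s2
    nb1 e = t≢f (trans (sym (subst (λ u → Fr s1 u ≡ true) e (Fb s1))) h)
    nw1 : w s1 ≢ s2
    nw1 e = t≢f (trans (sym (subst (λ u → Fr s1 u ≡ true) e (Fw s1))) h)
    Lt1 : L' t1 ≡ true
    Lt1 = NbB.lP1 nb1
    Lt2 : L' t2 ≡ true
    Lt2 = NbB.lP2 nb1
    Lu1 : L' u1 ≡ true
    Lu1 = NbW.lP1 nw1
    Lu2 : L' u2 ≡ true
    Lu2 = NbW.lP2 nw1
    lt1 : L t1 ≡ true
    lt1 = L'⇒L t1 Lt1
    lt2 : L t2 ≡ true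
    lt2 = L'⇒L t2 Lt2
    lu1 : L u1 ≡ true
    lu1 = L'⇒L u1 Lu1
    lu2 : L u2 ≡ true
    lu2 = L'⇒L u2 Lu2

    notCls : ∀ x → L x ≡ true → Fr s1 x ≡ true → Fr s2 x ≡ true → ⊥
    notCls x lx a c = t≢f (trans (sym (trans-on EF s1 x s2 l1 lx l2 a (sym-on EF s2 x l2 lx c))) h)

    module A1 = FaceArcs s1 l1
    module A2 = FaceArcs s2 l2

    arc1 : Fr' t1 u1 ≡ true
    arc1 = A1.face-arc cond
      where
      open A1.As
      cond : ∀ i → 1 ≤ i → i < T1 → (isEven i ≡ true → W i ≢ t1 × W i ≢ t2) × (isEven i ≡ false → W i ≢ u1 × W i ≢ u2)
      cond i 1≤ i< = (λ pe → (λ e → walk-injective i 1 i<Tp (<-≤-trans (s≤s (s≤s z≤n)) period≥2) (isEven-≢ i 1 (λ q → t≢f (trans (sym pe) q))) e)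
                            , (λ e → notCls t2 (L'⇒L t2 Lt2) (subst (λ u → Fr s1 u ≡ true) e (walk-cls i)) (Fb s2)))
                   , (λ po → (λ e → walk-injective i T1 i<Tp T1<Tp (λ q → <-irrefl q i<) (trans e (sym WT1)))
                            , (λ e → notCls u2 (L'⇒L u2 Lu2) (subst (λ u → Fr s1 u ≡ true) e (walk-cls i)) (Fw s2)))
        where i<Tp = <-trans i< T1<Tp

    arc2 : Fr' t2 u2 ≡ true
    arc2 = A2.face-arc cond
      where
      open A2.As
      cond : ∀ i → 1 ≤ i → i < T1 → (isEven i ≡ true → W i ≢ t1 × W i ≢ t2) × (isEven i ≡ false → W i ≢ u1 × W i ≢ u2)
      cond i 1≤ i< = (λ pe → (λ e → notCls t1 lt1 (Fb s1) (subst (λ u → Fr s2 u ≡ true) e (walk-cls i)))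
                            , (λ e → walk-injective i 1 i<Tp (<-≤-trans (s≤s (s≤s z≤n)) period≥2) (isEven-≢ i 1 (λ q → t≢f (trans (sym pe) q))) e))
                   , (λ po → (λ e → notCls u1 lu1 (Fw s1) (subst (λ u → Fr s2 u ≡ true) e (walk-cls i)))
                            , (λ e → walk-injective i T1 i<Tp T1<Tp (λ q → <-irrefl q i<) (trans e (sym WT1))))
        where i<Tp = <-trans i< T1<Tp

    F't1t2 : Fr' t1 t2 ≡ true
    F't1t2 = subst (λ u → Fr' t1 u ≡ true) (RB.rem-t1 nb1) (Fb' t1)
    F'u1u2 : Fr' u1 u2 ≡ true
    F'u1u2 = subst (λ u → Fr' u1 u ≡ true) (RW.rem-t1 nw1) (Fw' u1)

    nbF : NBF Fr' t1
    nbF = nbF-intro Fr' t1 (λ _ → refl-on EF' t1 Lt1) (λ _ → F't1t2) (λ _ → arc1)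
            (λ _ → trans-on EF' t1 t2 u2 Lt1 Lt2 Lu2 F't1t2 arc2)

    old⊆ : ∀ x y → L' x ≡ true → L' y ≡ true → Fr x y ≡ true → Fr' x y ≡ true
    old⊆ = oldF-sub Fr' EF' (λ x y _ _ e → e) t1 Lt1 nbF

    Frt1t2 : Fr t1 t2 ≡ false
    Frt1t2 with Fr t1 t2 in ee
    ... | false = refl
    ... | true = ⊥-elim (notCls t2 lt2 (trans-on EF s1 t1 t2 l1 lt1 lt2 (Fb s1) ee) (Fb s2))

    EM : EquivalenceOn L' (merge Fr t1 t2)
    EM = merge-equivalenceOn L' Fr t1 t2 EFr Lt1 Lt2

    new⊆ : ∀ x y → L' x ≡ true → L' y ≡ true → Fr' x y ≡ true → merge Fr t1 t2 x y ≡ true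
    new⊆ = newF-sub (merge Fr t1 t2) EM (λ x _ _ → merge-old Fr t1 t2 x (b x) (Fb x)) (λ x _ _ → merge-old Fr t1 t2 x (w x) (Fw x))
             (λ _ → merge-ab Fr t1 t2 t1 t2 (refl-on EF t1 lt1) (refl-on EF t2 lt2))
             (λ _ → merge-ab Fr t1 t2 u1 u2 (trans-on EF u1 s1 t1 lu1 l1 lt1 (sym-on EF s1 u1 l1 lu1 (Fw s1)) (Fb s1))
                                      (trans-on EF t2 s2 u2 lt2 l2 lu2 (sym-on EF s2 t2 l2 lt2 (Fb s2)) (Fw s2)))

    eqv : ∀ x y → L' x ≡ true → L' y ≡ true → Fr' x y ≡ merge Fr t1 t2 x y
    eqv x y lx ly = bool-ext bwd (new⊆ x y lx ly)
      where
      bwd : merge Fr t1 t2 x y ≡ true → Fr' x y ≡ true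
      bwd e with merge-cases Fr t1 t2 x y e
      ... | inj₁ k = old⊆ x y lx ly k
      ... | inj₂ (inj₁ (k1 , k2)) = trans-on EF' x t2 y lx Lt2 ly (trans-on EF' x t1 t2 lx Lt1 Lt2 (old⊆ x t1 lx Lt1 k1) F't1t2) (old⊆ t2 y Lt2 ly k2)
      ... | inj₂ (inj₂ (k1 , k2)) = trans-on EF' x t1 y lx Lt1 ly (trans-on EF' x t2 t1 lx Lt2 Lt1 (old⊆ x t2 lx Lt2 k1) (sym-on EF' t1 t2 Lt1 Lt2 F't1t2)) (old⊆ t1 y Lt1 ly k2)

    #faces-step : suc (#classes L' Fr') ≡ #classes L Fr
    #faces-step = trans (#classes-merge L' Fr Fr' t1 t2 EFr Lt1 Lt2 Frt1t2 eqv)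
                  (#classes-del2-nonsingleton L Fr s1 s2 EF l1 l2 ne12 t1 lt1 (nofix IB s1 l1) (Fb s1)
                                t2 lt2 (del2-ne1 L s1 s2 t2 Lt2) (del2-ne2 L s1 s2 t2 Lt2) (Fb s2))

    edge-type : firstHit b w s1 s2 m 1 ≡ interface
    edge-type = firstHit-miss b w s1 s2 m 1 (λ i _ _ ee → t≢f (trans (sym (subst (λ u → Fr s1 u ≡ true) ee (A1.As.walk-cls i))) h))

  module AS1 = FaceArcs s1 l1

  pred-positive : ∀ i → 1 ≤ i → i ≢ 1 → Σ ℕ λ i' → suc i' ≡ i × 1 ≤ i'
  pred-positive (suc zero) _ n = ⊥-elim (n refl)
  pred-positive (suc (suc i)) _ _ = suc i , refl , s≤s z≤n

  -- s2 = W j0 on the face walk from s1; the parity of j0 decides between twisted and straight.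
  module SameFace (h : Fr s1 s2 ≡ true) where
    open AS1.As

    orb : Σ ℕ λ i → i < period × W i ≡ s2
    orb = cls⇒on-walk s2 h
    j0 : ℕ
    j0 = proj₁ orb
    j0<Tp : j0 < period
    j0<Tp = proj₁ (proj₂ orb)
    Wj0 : W j0 ≡ s2
    Wj0 = proj₂ (proj₂ orb)

    dneq : ∀ i k → i < period → k < period → i ≢ k → W i ≢ W k
    dneq = walk-injective

    j0≢0 : j0 ≢ 0
    j0≢0 e = ne12 (trans (cong W (sym e)) Wj0)

    1≤j0 : 1 ≤ j0
    1≤j0 with j0 | j0≢0
    ... | zero | n = ⊥-elim (n refl)
    ... | suc _ | _ = s≤s z≤n

    1<Tp : 1 < period
    1<Tp = <-≤-trans (s≤s (s≤s z≤n)) period≥2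

    pos-s2 : ∀ i → i < period → W i ≡ s2 → i ≡ j0
    pos-s2 i i< e with i ℕ.≟ j0
    ... | yes p = p
    ... | no n = ⊥-elim (dneq i j0 i< j0<Tp n (trans e (sym Wj0)))

    edge-type : firstHit b w s1 s2 m 1 ≡ sameFaceType j0
    edge-type = firstHit-hit b w s1 s2 m 1 j0 1≤j0 (s≤s (≤-trans (<⇒≤ j0<Tp) period≤m)) Wj0
              (λ i 1≤ i< e → dneq i j0 (<-trans i< j0<Tp) j0<Tp (λ q → <-irrefl q i<) (trans e (sym Wj0)))

    b1≡ : b s1 ≡ s2 → j0 ≡ 1
    b1≡ e = sym (pos-s2 1 1<Tp e)

    w1≡ : w s1 ≡ s2 → j0 ≡ T1
    w1≡ e = sym (pos-s2 T1 T1<Tp (trans WT1 e))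

    Ft1t2 : Fr t1 t2 ≡ true
    Ft1t2 = trans-on EF t1 s1 t2 (live IB s1 l1) l1 (live IB s2 l2) (sym-on EF s1 t1 l1 (live IB s1 l1) (Fb s1))
              (trans-on EF s1 s2 t2 l1 l2 (live IB s2 l2) h (Fb s2))
    Fu1u2 : Fr u1 u2 ≡ true
    Fu1u2 = trans-on EF u1 s1 u2 (live IW s1 l1) l1 (live IW s2 l2) (sym-on EF s1 u1 l1 (live IW s1 l1) (Fw s1))
              (trans-on EF s1 s2 u2 l1 l2 (live IW s2 l2) h (Fw s2))

    new⊆Fr : (b s1 ≢ s2 → Fr t1 t2 ≡ true) → ∀ x y → L' x ≡ true → L' y ≡ true → Fr' x y ≡ true → Fr x y ≡ true
    new⊆Fr _ = newF-sub Fr EFr obFr owFr (λ _ → Ft1t2) (λ _ → Fu1u2)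

    face-arc-from : ∀ a k → (∀ i → a ≤ i → i < a + k → (isEven i ≡ true → W i ≢ t1 × W i ≢ t2) × (isEven i ≡ false → W i ≢ u1 × W i ≢ u2)) →
      Fr' (W a) (W (a + k)) ≡ true
    face-arc-from a k cond = cls-complete Fgs' (W a) (W (a + k))
      (walk-arc Fgs' b' w' (here refl) (there (here refl)) a k
        (λ i a≤ i< → AS1.alternate-unchanged i (proj₁ (cond i a≤ i<)) (proj₂ (cond i a≤ i<))))

    module TwistedEdge (pe : isEven j0 ≡ true) where
      nb1 : b s1 ≢ s2
      nb1 e = t≢f (trans (sym pe) (cong isEven (b1≡ e)))
      nw1 : w s1 ≢ s2
      nw1 e = t≢f (trans (sym pe) (trans (cong isEven (w1≡ e)) parT1))
      Lt1 : L' t1 ≡ true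
      Lt1 = NbB.lP1 nb1
      Lt2 : L' t2 ≡ true
      Lt2 = NbB.lP2 nb1
      Lu1 : L' u1 ≡ true
      Lu1 = NbW.lP1 nw1
      Lu2 : L' u2 ≡ true
      Lu2 = NbW.lP2 nw1
      lt1 : L t1 ≡ true
      lt1 = L'⇒L t1 Lt1
      lt2 : L t2 ≡ true
      lt2 = L'⇒L t2 Lt2

      Jj : ℕ
      Jj = j0 ∸ 1
      sJj : suc Jj ≡ j0
      sJj = trans (+-comm 1 Jj) (m∸n+n≡m 1≤j0)
      parJ : isEven Jj ≡ false
      parJ = trans (sym (not-involutive (isEven Jj))) (cong not (trans (cong isEven sJj) pe))
      Jj≢0 : Jj ≢ 0
      Jj≢0 e = t≢f (trans (sym pe) (trans (cong isEven (trans (sym sJj) (cong suc e))) refl))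
      1≤Jj : 1 ≤ Jj
      1≤Jj with Jj | Jj≢0
      ... | zero | n = ⊥-elim (n refl)
      ... | suc _ | _ = s≤s z≤n
      u2≡ : u2 ≡ W Jj
      u2≡ = trans (cong w (trans (sym Wj0) (cong W (sym sJj)))) (q-even Jj (trans (cong isEven sJj) pe))
      t2≡ : t2 ≡ W (suc j0)
      t2≡ = trans (cong b (sym Wj0)) (p-even j0 pe)
      j0<T1 : j0 < T1
      j0<T1 = ≤∧≢⇒< (≤-pred (subst (j0 <_) (sym sucT1) j0<Tp)) (λ q → t≢f (trans (sym pe) (trans (cong isEven q) parT1)))
      sj0<Tp : suc j0 < period
      sj0<Tp = ≤-<-trans j0<T1 T1<Tp
      Jj<j0 : Jj < j0
      Jj<j0 = subst (Jj <_) sJj ≤-refl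

      arc1 : Fr' t1 u2 ≡ true
      arc1 = subst₂ (λ u v → Fr' u v ≡ true) refl (trans (cong W (m+[n∸m]≡n 1≤Jj)) (sym u2≡))
               (face-arc-from 1 (Jj ∸ 1) cond)
        where
        cond : ∀ i → 1 ≤ i → i < 1 + (Jj ∸ 1) → (isEven i ≡ true → W i ≢ t1 × W i ≢ t2) × (isEven i ≡ false → W i ≢ u1 × W i ≢ u2)
        cond i 1≤ i< = (λ pi → dneq i 1 i<Tp 1<Tp (isEven-≢ i 1 (λ q → t≢f (trans (sym pi) q)))
                              , (λ e → dneq i (suc j0) i<Tp sj0<Tp (λ q → <-irrefl q (<-trans i<Jj (<-trans Jj<j0 (n<1+n j0)))) (trans e t2≡)))
                     , (λ po → (λ e → dneq i T1 i<Tp T1<Tp (λ q → <-irrefl q (<-trans i<Jj (<-trans Jj<j0 j0<T1))) (trans e (sym WT1)))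
                              , (λ e → dneq i Jj i<Tp (<-trans Jj<j0 j0<Tp) (λ q → <-irrefl q i<Jj) (trans e u2≡)))
          where
          i<Jj : i < Jj
          i<Jj = subst (i <_) (m+[n∸m]≡n 1≤Jj) i<
          i<Tp = <-trans i<Jj (<-trans Jj<j0 j0<Tp)

      arc2 : Fr' t2 u1 ≡ true
      arc2 = subst₂ (λ u v → Fr' u v ≡ true) (sym t2≡) (trans (cong W (m+[n∸m]≡n j0<T1)) WT1)
               (face-arc-from (suc j0) (T1 ∸ suc j0) cond)
        where
        cond : ∀ i → suc j0 ≤ i → i < suc j0 + (T1 ∸ suc j0) → (isEven i ≡ true → W i ≢ t1 × W i ≢ t2) × (isEven i ≡ false → W i ≢ u1 × W i ≢ u2)
        cond i sj0≤ i< = (λ pi → dneq i 1 i<Tp 1<Tp (isEven-≢ i 1 (λ q → t≢f (trans (sym pi) q)))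
                              , (λ e → dneq i (suc j0) i<Tp sj0<Tp (isEven-≢ i (suc j0) (λ q → t≢f (trans (sym pi) (trans q (cong not pe))))) (trans e t2≡)))
                     , (λ po → (λ e → dneq i T1 i<Tp T1<Tp (λ q → <-irrefl q i<T1) (trans e (sym WT1)))
                              , (λ e → dneq i Jj i<Tp (<-trans Jj<j0 j0<Tp) (λ q → <-irrefl (sym q) (<-≤-trans (<-trans Jj<j0 (n<1+n j0)) sj0≤)) (trans e u2≡)))
          where
          i<T1 : i < T1
          i<T1 = subst (i <_) (m+[n∸m]≡n j0<T1) i<
          i<Tp = <-trans i<T1 T1<Tp

      F't1t2 : Fr' t1 t2 ≡ true
      F't1t2 = subst (λ u → Fr' t1 u ≡ true) (RB.rem-t1 nb1) (Fb' t1)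
      F'u1u2 : Fr' u1 u2 ≡ true
      F'u1u2 = subst (λ u → Fr' u1 u ≡ true) (RW.rem-t1 nw1) (Fw' u1)

      nbF : NBF Fr' t1
      nbF = nbF-intro Fr' t1 (λ _ → refl-on EF' t1 Lt1) (λ _ → F't1t2) (λ _ → trans-on EF' t1 t2 u1 Lt1 Lt2 Lu1 F't1t2 arc2) (λ _ → arc1)

      eqv : ∀ x y → L' x ≡ true → L' y ≡ true → Fr' x y ≡ Fr x y
      eqv x y lx ly = bool-ext (oldF-sub Fr' EF' (λ x y _ _ e → e) t1 Lt1 nbF x y lx ly) (new⊆Fr (λ _ → Ft1t2) x y lx ly)

      #faces-step : #classes L' Fr' ≡ #classes L Fr
      #faces-step = trans (#classes-cong L' L' Fr' Fr (λ _ → refl) eqv)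
                  (#classes-del2-nonsingleton L Fr s1 s2 EF l1 l2 ne12 t1 lt1 (nofix IB s1 l1) (Fb s1)
                                t2 lt2 (del2-ne1 L s1 s2 t2 Lt2) (del2-ne2 L s1 s2 t2 Lt2) (Fb s2))

    module StraightEdge (po : isEven j0 ≡ false) (nb1 : b s1 ≢ s2) (nw1 : w s1 ≢ s2) where
      Lt1 : L' t1 ≡ true
      Lt1 = NbB.lP1 nb1
      Lt2 : L' t2 ≡ true
      Lt2 = NbB.lP2 nb1
      Lu1 : L' u1 ≡ true
      Lu1 = NbW.lP1 nw1
      Lu2 : L' u2 ≡ true
      Lu2 = NbW.lP2 nw1
      lt1 : L t1 ≡ true
      lt1 = L'⇒L t1 Lt1
      lt2 : L t2 ≡ true
      lt2 = L'⇒L t2 Lt2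
      lu1 : L u1 ≡ true
      lu1 = L'⇒L u1 Lu1

      Jj : ℕ
      Jj = j0 ∸ 1
      sJj : suc Jj ≡ j0
      sJj = trans (+-comm 1 Jj) (m∸n+n≡m 1≤j0)
      parJ : isEven Jj ≡ true
      parJ = trans (sym (not-involutive (isEven Jj))) (cong not (trans (cong isEven sJj) po))
      j0≢1 : j0 ≢ 1
      j0≢1 e = nb1 (trans (cong W (sym e)) Wj0)
      1≤Jj : 1 ≤ Jj
      1≤Jj with Jj | sJj
      ... | zero | q = ⊥-elim (j0≢1 (sym q))
      ... | suc _ | _ = s≤s z≤n
      t2≡ : t2 ≡ W Jj
      t2≡ = trans (cong b (trans (sym Wj0) (cong W (sym sJj)))) (p-odd Jj (trans (cong isEven sJj) po))
      u2≡ : u2 ≡ W (suc j0)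
      u2≡ = trans (cong w (sym Wj0)) (q-odd j0 po)
      j0<T1 : j0 < T1
      j0<T1 = ≤∧≢⇒< (≤-pred (subst (j0 <_) (sym sucT1) j0<Tp)) (λ q → nw1 (trans (sym WT1) (trans (cong W (sym q)) Wj0)))
      Jj<j0 : Jj < j0
      Jj<j0 = subst (Jj <_) sJj ≤-refl
      sj0<Tp : suc j0 < period
      sj0<Tp = ≤-<-trans j0<T1 T1<Tp

      -- The sides W 1, …, W Jj strictly between s1 and s2 are closed under b' and w': the face splits.
      InA : Fin m → Set
      InA y = Σ ℕ λ i → 1 ≤ i × i ≤ Jj × W i ≡ y

      i<Tp : ∀ i → i ≤ Jj → i < period
      i<Tp i i≤ = ≤-<-trans i≤ (<-trans Jj<j0 j0<Tp)

      clB : ∀ y → InA y → InA (b' y)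
      clB y (i , 1≤ , i≤ , refl) with i ℕ.≟ 1 | i ℕ.≟ Jj
      ... | yes refl | _ = Jj , 1≤Jj , ≤-refl , sym (trans (RB.rem-t1 nb1) t2≡)
      ... | no _ | yes refl = 1 , ≤-refl , 1≤Jj , sym (trans (cong b' (sym t2≡)) (RB.rem-t2 nb1))
      ... | no n1 | no nJ = res
        where
        bb : b' (W i) ≡ b (W i)
        bb = RB.rem-other (W i) (dneq i 1 (i<Tp i i≤) 1<Tp n1) (λ e → dneq i Jj (i<Tp i i≤) (i<Tp Jj ≤-refl) nJ (trans e t2≡))
        res : InA (b' (W i))
        res with isEven i in pi
        ... | true = suc i , s≤s z≤n , ≤∧≢⇒< i≤ nJ , sym (trans bb (p-even i pi))
        res | false with pred-positive i 1≤ n1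
        ... | i' , si' , 1≤i' = i' , 1≤i' , ≤-trans (n≤1+n i') (subst (_≤ Jj) (sym si') i≤) ,
                sym (trans bb (trans (cong (λ u → b (W u)) (sym si')) (p-odd i' (trans (cong isEven si') pi))))

      clW : ∀ y → InA y → InA (w' y)
      clW y (i , 1≤ , i≤ , refl) = res
        where
        ww : w' (W i) ≡ w (W i)
        ww = RW.rem-other (W i) (λ e → dneq i T1 (i<Tp i i≤) T1<Tp (λ q → <-irrefl q (≤-<-trans i≤ (<-trans Jj<j0 j0<T1))) (trans e (sym WT1)))
                                (λ e → dneq i (suc j0) (i<Tp i i≤) sj0<Tp (λ q → <-irrefl q (≤-<-trans i≤ (<-trans Jj<j0 (n<1+n j0)))) (trans e u2≡))
        res : InA (w' (W i))
        res with isEven i in pi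
        ... | false = suc i , s≤s z≤n , ≤∧≢⇒< i≤ (λ q → t≢f (trans (sym parJ) (trans (cong isEven (sym q)) pi))) , sym (trans ww (q-odd i pi))
        res | true with pred-positive i 1≤ (λ q → t≢f (trans (sym pi) (cong isEven q)))
        ... | i' , si' , 1≤i' = i' , 1≤i' , ≤-trans (n≤1+n i') (subst (_≤ Jj) (sym si') i≤) ,
                sym (trans ww (trans (cong (λ u → w (W u)) (sym si')) (q-even i' (trans (cong isEven si') pi))))

      reachA : ∀ {x y} → Reach Fgs' x y → InA x → InA y
      reachA done a = a
      reachA {x} (move .b' (here refl) r) a = reachA r (clB x a)
      reachA {x} (move .w' (there (here refl)) r) a = reachA r (clW x a)

      neg : Fr' t1 u1 ≡ false
      neg with Fr' t1 u1 in ee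
      ... | false = refl
      ... | true with reachA (cls-sound Fgs' t1 u1 ee) (1 , ≤-refl , 1≤Jj , refl)
      ... | i , _ , i≤ , wi = ⊥-elim (dneq i T1 (i<Tp i i≤) T1<Tp (λ q → <-irrefl q (≤-<-trans i≤ (<-trans Jj<j0 j0<T1))) (trans wi (sym WT1)))

      F't1t2 : Fr' t1 t2 ≡ true
      F't1t2 = subst (λ u → Fr' t1 u ≡ true) (RB.rem-t1 nb1) (Fb' t1)
      F'u1u2 : Fr' u1 u2 ≡ true
      F'u1u2 = subst (λ u → Fr' u1 u ≡ true) (RW.rem-t1 nw1) (Fw' u1)

      XM : Rel m
      XM = merge Fr' t1 u1
      EXM : EquivalenceOn L' XM
      EXM = merge-equivalenceOn L' Fr' t1 u1 EF' Lt1 Lu1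

      nbM : NBF XM t1
      nbM = nbF-intro XM t1 (λ _ → merge-old Fr' t1 u1 t1 t1 (refl-on EF' t1 Lt1)) (λ _ → merge-old Fr' t1 u1 t1 t2 F't1t2)
              (λ _ → merge-ab Fr' t1 u1 t1 u1 (refl-on EF' t1 Lt1) (refl-on EF' u1 Lu1))
              (λ _ → merge-ab Fr' t1 u1 t1 u2 (refl-on EF' t1 Lt1) F'u1u2)

      Ft1u1 : Fr t1 u1 ≡ true
      Ft1u1 = trans-on EF t1 s1 u1 lt1 l1 lu1 (sym-on EF s1 t1 l1 lt1 (Fb s1)) (Fw s1)

      eqv : ∀ x y → L' x ≡ true → L' y ≡ true → Fr x y ≡ XM x y
      eqv x y lx ly = bool-ext bwd (oldF-sub XM EXM (λ x y _ _ e → merge-old Fr' t1 u1 x y e) t1 Lt1 nbM x y lx ly)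
        where
        nw : ∀ x y → L' x ≡ true → L' y ≡ true → Fr' x y ≡ true → Fr x y ≡ true
        nw = new⊆Fr (λ _ → Ft1t2)
        bwd : XM x y ≡ true → Fr x y ≡ true
        bwd e with merge-cases Fr' t1 u1 x y e
        ... | inj₁ k = nw x y lx ly k
        ... | inj₂ (inj₁ (k1 , k2)) = trans-on EFr x u1 y lx Lu1 ly (trans-on EFr x t1 u1 lx Lt1 Lu1 (nw x t1 lx Lt1 k1) Ft1u1) (nw u1 y Lu1 ly k2)
        ... | inj₂ (inj₂ (k1 , k2)) = trans-on EFr x t1 y lx Lt1 ly (trans-on EFr x u1 t1 lx Lu1 Lt1 (nw x u1 lx Lu1 k1) (sym-on EFr t1 u1 Lt1 Lu1 Ft1u1)) (nw t1 y Lt1 ly k2)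

      #faces-step : #classes L' Fr' ≡ suc (#classes L Fr)
      #faces-step = sym (trans (cong suc (sym (#classes-del2-nonsingleton L Fr s1 s2 EF l1 l2 ne12 t1 lt1 (nofix IB s1 l1) (Fb s1)
                                t2 lt2 (del2-ne1 L s1 s2 t2 Lt2) (del2-ne2 L s1 s2 t2 Lt2) (Fb s2))))
                    (#classes-merge L' Fr' Fr t1 u1 EF' Lt1 Lu1 neg eqv))

  m≥1 : 1 ≤ m
  m≥1 = Fin⇒1≤ s1

  edge-type-blackLeaf : b s1 ≡ s2 → firstHit b w s1 s2 m 1 ≡ straight
  edge-type-blackLeaf eb = firstHit-hit b w s1 s2 m 1 1 ≤-refl (s≤s m≥1) eb (λ i 1≤ i< → ⊥-elim (<-irrefl refl (≤-<-trans 1≤ i<)))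

  b-s2≡s1 : b s1 ≡ s2 → b s2 ≡ s1
  b-s2≡s1 eb = trans (cong b (sym eb)) (inv IB s1 l1)
  w-s2≡s1 : w s1 ≡ s2 → w s2 ≡ s1
  w-s2≡s1 ew = trans (cong w (sym ew)) (inv IW s1 l1)

  same-face-via-b : b s1 ≡ s2 → Fr s1 s2 ≡ true
  same-face-via-b eb = subst (λ u → Fr s1 u ≡ true) eb (Fb s1)
  same-face-via-w : w s1 ≡ s2 → Fr s1 s2 ≡ true
  same-face-via-w ew = subst (λ u → Fr s1 u ≡ true) ew (Fw s1)

  removed⇒dead : ∀ x → (x ≡ s1 ⊎ x ≡ s2) → L' x ≡ true → ⊥
  removed⇒dead x (inj₁ e) lx = del2-ne1 L s1 s2 x lx e
  removed⇒dead x (inj₂ e) lx = del2-ne2 L s1 s2 x lx e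

  module BlackLeaf (eb : b s1 ≡ s2) (nw1 : w s1 ≢ s2) where
    Lu1 : L' u1 ≡ true
    Lu1 = NbW.lP1 nw1
    Lu2 : L' u2 ≡ true
    Lu2 = NbW.lP2 nw1
    lu1 : L u1 ≡ true
    lu1 = L'⇒L u1 Lu1
    lu2 : L u2 ≡ true
    lu2 = L'⇒L u2 Lu2
    Fs12 : Fr s1 s2 ≡ true
    Fs12 = same-face-via-b eb
    Fu1u2 : Fr u1 u2 ≡ true
    Fu1u2 = trans-on EF u1 s1 u2 lu1 l1 lu2 (sym-on EF s1 u1 l1 lu1 (Fw s1)) (trans-on EF s1 s2 u2 l1 l2 lu2 Fs12 (Fw s2))
    F'u1u2 : Fr' u1 u2 ≡ true
    F'u1u2 = subst (λ u → Fr' u1 u ≡ true) (RW.rem-t1 nw1) (Fw' u1)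
    nbF : NBF Fr' u1
    nbF = nbF-intro Fr' u1 (λ lt → ⊥-elim (removed⇒dead t1 (inj₂ eb) lt)) (λ lt → ⊥-elim (removed⇒dead t2 (inj₁ (b-s2≡s1 eb)) lt))
            (λ _ → refl-on EF' u1 Lu1) (λ _ → F'u1u2)
    eqv : ∀ x y → L' x ≡ true → L' y ≡ true → Fr' x y ≡ Fr x y
    eqv x y lx ly = bool-ext (oldF-sub Fr' EF' (λ x y _ _ e → e) u1 Lu1 nbF x y lx ly)
                             (newF-sub Fr EFr obFr owFr (λ n → ⊥-elim (n eb)) (λ _ → Fu1u2) x y lx ly)
    #faces-step : #classes L' Fr' ≡ #classes L Fr
    #faces-step = trans (#classes-cong L' L' Fr' Fr (λ _ → refl) eqv)
                  (#classes-del2-nonsingleton L Fr s1 s2 EF l1 l2 ne12 u1 lu1 (nofix IW s1 l1) (Fw s1)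
                                u2 lu2 (del2-ne1 L s1 s2 u2 Lu2) (del2-ne2 L s1 s2 u2 Lu2) (Fw s2))

  module WhiteLeaf (ew : w s1 ≡ s2) (nb1 : b s1 ≢ s2) where
    Lt1 : L' t1 ≡ true
    Lt1 = NbB.lP1 nb1
    Lt2 : L' t2 ≡ true
    Lt2 = NbB.lP2 nb1
    lt1 : L t1 ≡ true
    lt1 = L'⇒L t1 Lt1
    lt2 : L t2 ≡ true
    lt2 = L'⇒L t2 Lt2
    Fs12 : Fr s1 s2 ≡ true
    Fs12 = same-face-via-w ew
    Ft1t2 : Fr t1 t2 ≡ true
    Ft1t2 = trans-on EF t1 s1 t2 lt1 l1 lt2 (sym-on EF s1 t1 l1 lt1 (Fb s1)) (trans-on EF s1 s2 t2 l1 l2 lt2 Fs12 (Fb s2))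
    F't1t2 : Fr' t1 t2 ≡ true
    F't1t2 = subst (λ u → Fr' t1 u ≡ true) (RB.rem-t1 nb1) (Fb' t1)
    nbF : NBF Fr' t1
    nbF = nbF-intro Fr' t1 (λ _ → refl-on EF' t1 Lt1) (λ _ → F't1t2)
            (λ lu → ⊥-elim (removed⇒dead u1 (inj₂ ew) lu)) (λ lu → ⊥-elim (removed⇒dead u2 (inj₁ (w-s2≡s1 ew)) lu))
    eqv : ∀ x y → L' x ≡ true → L' y ≡ true → Fr' x y ≡ Fr x y
    eqv x y lx ly = bool-ext (oldF-sub Fr' EF' (λ x y _ _ e → e) t1 Lt1 nbF x y lx ly)
                             (newF-sub Fr EFr obFr owFr (λ _ → Ft1t2) (λ n → ⊥-elim (n ew)) x y lx ly)
    #faces-step : #classes L' Fr' ≡ #classes L Fr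
    #faces-step = trans (#classes-cong L' L' Fr' Fr (λ _ → refl) eqv)
                  (#classes-del2-nonsingleton L Fr s1 s2 EF l1 l2 ne12 t1 lt1 (nofix IB s1 l1) (Fb s1)
                                t2 lt2 (del2-ne1 L s1 s2 t2 Lt2) (del2-ne2 L s1 s2 t2 Lt2) (Fb s2))
    edge-type : firstHit b w s1 s2 m 1 ≡ straight
    edge-type = trans (SameFace.edge-type Fs12) (trans (cong sameFaceType (SameFace.w1≡ Fs12 ew)) (cong (λ u → if u then twisted else straight) AS1.As.parT1))

  Reach-pair-closed : ∀ (gs : List (Fun m)) → (∀ g → g ∈ gs → g s1 ≡ s2 × g s2 ≡ s1) →
    ∀ {x y} → Reach gs x y → (x ≡ s1 ⊎ x ≡ s2) → (y ≡ s1 ⊎ y ≡ s2)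
  Reach-pair-closed gs h done p = p
  Reach-pair-closed gs h (move g i r) (inj₁ refl) = Reach-pair-closed gs h r (inj₂ (proj₁ (h g i)))
  Reach-pair-closed gs h (move g i r) (inj₂ refl) = Reach-pair-closed gs h r (inj₁ (proj₂ (h g i)))

  module IsolatedEdge (eb : b s1 ≡ s2) (ew : w s1 ≡ s2) where
    nbvac : ∀ c → NBF Fr' c
    nbvac c = nbF-intro Fr' c (λ lt → ⊥-elim (removed⇒dead t1 (inj₂ eb) lt)) (λ lt → ⊥-elim (removed⇒dead t2 (inj₁ (b-s2≡s1 eb)) lt))
                (λ lu → ⊥-elim (removed⇒dead u1 (inj₂ ew) lu)) (λ lu → ⊥-elim (removed⇒dead u2 (inj₁ (w-s2≡s1 ew)) lu))
    eqv : ∀ x y → L' x ≡ true → L' y ≡ true → Fr' x y ≡ Fr x y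
    eqv x y lx ly = bool-ext (oldF-sub Fr' EF' (λ x y _ _ e → e) x lx (nbvac x) x y lx ly)
                             (newF-sub Fr EFr obFr owFr (λ n → ⊥-elim (n eb)) (λ n → ⊥-elim (n ew)) x y lx ly)
    clos : ∀ y → L y ≡ true → Fr s1 y ≡ true → y ≡ s1 ⊎ y ≡ s2
    clos y ly e = Reach-pair-closed Fgs hh (cls-sound Fgs s1 y e) (inj₁ refl)
      where
      hh : ∀ g → g ∈ Fgs → g s1 ≡ s2 × g s2 ≡ s1
      hh .b (here refl) = eb , b-s2≡s1 eb
      hh .w (there (here refl)) = ew , w-s2≡s1 ew
    #faces-step : suc (#classes L' Fr') ≡ #classes L Fr
    #faces-step = trans (cong suc (#classes-cong L' L' Fr' Fr (λ _ → refl) eqv))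
                  (#classes-del2-pair L Fr s1 s2 EF l1 l2 ne12 (same-face-via-b eb) clos)

module EdgeRemovalVertices {m} (L : Sub m) (b w e : Fun m) (IB : InvolutionOn L b) (IW : InvolutionOn L w) (IE : InvolutionOn L e)
            (s1 : Fin m) (l1 : L s1 ≡ true) where
  open EdgeRemoval L b w e IB IW IE s1 l1 public

  e'-edge : ∀ (Y : Rel m) → (∀ x → L' x ≡ true → Y x (e x) ≡ true) → ∀ x → L' x ≡ true → Y x (e' x) ≡ true
  e'-edge Y h x lx = subst (λ u → Y x u ≡ true) (sym (e'≡e x)) (h x lx)

  es : ∀ i → (i ≡ s1 ⊎ i ≡ s2) → (e i ≡ s1 ⊎ e i ≡ s2)
  es i (inj₁ refl) = inj₂ refl
  es i (inj₂ refl) = inj₁ (inv IE s1 l1)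

  module VertexClasses (P : Fun m) (IP : InvolutionOn L P) where
    module NP = Neighbours P IP
    P' : Fun m
    P' = removeP P s1 s2
    Vgs Vgs' : List (Fun m)
    Vgs = P ∷ e ∷ []
    Vgs' = P' ∷ e' ∷ []
    Vr Vr' : Rel m
    Vr = cls Vgs
    Vr' = cls Vgs'
    GV : InvolutiveOn L Vgs
    GV = involutiveOn₂ L P e IP IE
    GV' : InvolutiveOn L' Vgs'
    GV' = involutiveOn₂ L' P' e' NP.RP.rem-inv IE'
    EV : EquivalenceOn L Vr
    EV = cls-equivalenceOn L Vgs GV
    EV' : EquivalenceOn L' Vr'
    EV' = cls-equivalenceOn L' Vgs' GV'
    EVr : EquivalenceOn L' Vr
    EVr = EquivalenceOn-⊆ L L' Vr EV L'⇒L
    VP : ∀ x → Vr x (P x) ≡ true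
    VP x = cls-complete Vgs x (P x) (Reach-one P (here refl))
    Ve : ∀ x → Vr x (e x) ≡ true
    Ve x = cls-complete Vgs x (e x) (Reach-one e (there (here refl)))
    VP' : ∀ x → Vr' x (P' x) ≡ true
    VP' x = cls-complete Vgs' x (P' x) (Reach-one P' (here refl))
    Ve' : ∀ x → Vr' x (e' x) ≡ true
    Ve' x = cls-complete Vgs' x (e' x) (Reach-one e' (there (here refl)))
    Ve'' : ∀ x → Vr' x (e x) ≡ true
    Ve'' x = subst (λ u → Vr' x u ≡ true) (e'≡e x) (Ve' x)

    lp1 : L (P s1) ≡ true
    lp1 = live IP s1 l1
    lp2 : L (P s2) ≡ true
    lp2 = live IP s2 l2

    VPP : Vr (P s1) (P s2) ≡ true
    VPP = trans-on EV (P s1) s1 (P s2) lp1 l1 lp2 (sym-on EV s1 (P s1) l1 lp1 (VP s1)) (trans-on EV s1 s2 (P s2) l1 l2 lp2 (Ve s1) (VP s2))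

    new⊆ : ∀ x y → L' x ≡ true → L' y ≡ true → Vr' x y ≡ true → Vr x y ≡ true
    new⊆ = cls-⊆ L' Vgs' GV' Vr EVr hh
      where
      hh : ∀ g → g ∈ Vgs' → ∀ x → L' x ≡ true → Vr x (g x) ≡ true
      hh .P' (here refl) = NP.newEdge Vr EVr (λ x _ _ → VP x) (λ _ → VPP)
      hh .e' (there (here refl)) = e'-edge Vr (λ x _ → Ve x)

    old⊆ : ∀ c → L' c ≡ true → (∀ i → (i ≡ s1 ⊎ i ≡ s2) → L' (P i) ≡ true → Vr' c (P i) ≡ true) →
      ∀ x y → L' x ≡ true → L' y ≡ true → Vr x y ≡ true → Vr' x y ≡ true
    old⊆ c lc nbP = OldClasses.old-classes-⊆ L s1 s2 Vgs GV Vr' EV' eok c lc nb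
      where
      eok : ∀ g → g ∈ Vgs → ∀ x → L' x ≡ true → L' (g x) ≡ true → Vr' x (g x) ≡ true
      eok .P (here refl) x lx lgx = subst (λ u → Vr' x u ≡ true) (NP.surv x lx lgx) (VP' x)
      eok .e (there (here refl)) x lx lgx = Ve'' x
      nb : ∀ g → g ∈ Vgs → ∀ i → (i ≡ s1 ⊎ i ≡ s2) → L' (g i) ≡ true → Vr' c (g i) ≡ true
      nb .P (here refl) i is lgi = nbP i is lgi
      nb .e (there (here refl)) i is lgi = ⊥-elim (removed⇒dead (e i) (es i is) lgi)

    #vertices-step-leaf : P s1 ≡ s2 → suc (#classes L' Vr') ≡ #classes L Vr
    #vertices-step-leaf eP = trans (cong suc (#classes-cong L' L' Vr' Vr (λ _ → refl) eqv))
                         (#classes-del2-pair L Vr s1 s2 EV l1 l2 ne12 (Ve s1) clos)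
      where
      sP : P s2 ≡ s1
      sP = trans (cong P (sym eP)) (inv IP s1 l1)
      eqv : ∀ x y → L' x ≡ true → L' y ≡ true → Vr' x y ≡ Vr x y
      eqv x y lx ly = bool-ext (old⊆ x lx (λ i is lpi → ⊥-elim (removed⇒dead (P i) (ps i is) lpi)) x y lx ly) (new⊆ x y lx ly)
        where
        ps : ∀ i → (i ≡ s1 ⊎ i ≡ s2) → (P i ≡ s1 ⊎ P i ≡ s2)
        ps i (inj₁ refl) = inj₂ eP
        ps i (inj₂ refl) = inj₁ sP
      clos : ∀ y → L y ≡ true → Vr s1 y ≡ true → y ≡ s1 ⊎ y ≡ s2
      clos y ly ee = Reach-pair-closed Vgs hh (cls-sound Vgs s1 y ee) (inj₁ refl)
        where
        hh : ∀ g → g ∈ Vgs → g s1 ≡ s2 × g s2 ≡ s1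
        hh .P (here refl) = eP , sP
        hh .e (there (here refl)) = refl , inv IE s1 l1

    #vertices-step : P s1 ≢ s2 → #classes L' Vr' ≡ #classes L Vr
    #vertices-step nP = trans (#classes-cong L' L' Vr' Vr (λ _ → refl) eqv)
                        (#classes-del2-nonsingleton L Vr s1 s2 EV l1 l2 ne12 (P s1) lp1 (nofix IP s1 l1) (VP s1)
                                      (P s2) lp2 (del2-ne1 L s1 s2 (P s2) Lp2) (del2-ne2 L s1 s2 (P s2) Lp2) (VP s2))
      where
      Lp1 : L' (P s1) ≡ true
      Lp1 = NP.lP1 nP
      Lp2 : L' (P s2) ≡ true
      Lp2 = NP.lP2 nP
      VP'12 : Vr' (P s1) (P s2) ≡ true
      VP'12 = subst (λ u → Vr' (P s1) u ≡ true) (NP.RP.rem-t1 nP) (VP' (P s1))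
      nbP : ∀ i → (i ≡ s1 ⊎ i ≡ s2) → L' (P i) ≡ true → Vr' (P s1) (P i) ≡ true
      nbP i (inj₁ refl) _ = refl-on EV' (P s1) Lp1
      nbP i (inj₂ refl) _ = VP'12
      eqv : ∀ x y → L' x ≡ true → L' y ≡ true → Vr' x y ≡ Vr x y
      eqv x y lx ly = bool-ext (old⊆ (P s1) Lp1 nbP x y lx ly) (new⊆ x y lx ly)

  module VB = VertexClasses b IB
  module VW = VertexClasses w IW

  Cgs Cgs' : List (Fun m)
  Cgs = b ∷ w ∷ e ∷ []
  Cgs' = b' ∷ w' ∷ e' ∷ []
  Cr Cr' : Rel m
  Cr = cls Cgs
  Cr' = cls Cgs'

  involutiveOn₃ : ∀ (L : Sub m) p q r → InvolutionOn L p → InvolutionOn L q → InvolutionOn L r → InvolutiveOn L (p ∷ q ∷ r ∷ [])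
  involutiveOn₃ L p q r P Q R .p (here refl) x lx = live P x lx , inv P x lx
  involutiveOn₃ L p q r P Q R .q (there (here refl)) x lx = live Q x lx , inv Q x lx
  involutiveOn₃ L p q r P Q R .r (there (there (here refl))) x lx = live R x lx , inv R x lx

  GC : InvolutiveOn L Cgs
  GC = involutiveOn₃ L b w e IB IW IE
  GC' : InvolutiveOn L' Cgs'
  GC' = involutiveOn₃ L' b' w' e' IB' IW' IE'
  EC : EquivalenceOn L Cr
  EC = cls-equivalenceOn L Cgs GC
  EC' : EquivalenceOn L' Cr'
  EC' = cls-equivalenceOn L' Cgs' GC'
  ECr : EquivalenceOn L' Cr
  ECr = EquivalenceOn-⊆ L L' Cr EC L'⇒L

  Cb : ∀ x → Cr x (b x) ≡ true
  Cb x = cls-complete Cgs x (b x) (Reach-one b (here refl))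
  Cw : ∀ x → Cr x (w x) ≡ true
  Cw x = cls-complete Cgs x (w x) (Reach-one w (there (here refl)))
  Ce : ∀ x → Cr x (e x) ≡ true
  Ce x = cls-complete Cgs x (e x) (Reach-one e (there (there (here refl))))
  Cb' : ∀ x → Cr' x (b' x) ≡ true
  Cb' x = cls-complete Cgs' x (b' x) (Reach-one b' (here refl))
  Cw' : ∀ x → Cr' x (w' x) ≡ true
  Cw' x = cls-complete Cgs' x (w' x) (Reach-one w' (there (here refl)))
  Ce' : ∀ x → Cr' x (e x) ≡ true
  Ce' x = subst (λ u → Cr' x u ≡ true) (e'≡e x) (cls-complete Cgs' x (e' x) (Reach-one e' (there (there (here refl)))))

  F'⊆C' : ∀ x y → L' x ≡ true → L' y ≡ true → Fr' x y ≡ true → Cr' x y ≡ true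
  F'⊆C' x y lx ly ee = cls-complete Cgs' x y (Reach-transfer L' Fgs' Cgs' GF' hh (cls-sound Fgs' x y ee) lx)
    where
    hh : ∀ g → g ∈ Fgs' → ∀ x → L' x ≡ true → Σ (Fun m) λ g' → g' ∈ Cgs' × g' x ≡ g x
    hh .b' (here refl) x _ = b' , here refl , refl
    hh .w' (there (here refl)) x _ = w' , there (here refl) , refl

  old⊆C : (X : Rel m) → EquivalenceOn L' X → (∀ x y → L' x ≡ true → L' y ≡ true → Cr' x y ≡ true → X x y ≡ true) →
    ∀ c → L' c ≡ true → NBF X c →
    ∀ x y → L' x ≡ true → L' y ≡ true → Cr x y ≡ true → X x y ≡ true
  old⊆C X EX sup c lc nbf = OldClasses.old-classes-⊆ L s1 s2 Cgs GC X EX eok c lc nb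
    where
    eok : ∀ g → g ∈ Cgs → ∀ x → L' x ≡ true → L' (g x) ≡ true → X x (g x) ≡ true
    eok .b (here refl) x lx lgx = sup x (b x) lx lgx (subst (λ u → Cr' x u ≡ true) (NbB.surv x lx lgx) (Cb' x))
    eok .w (there (here refl)) x lx lgx = sup x (w x) lx lgx (subst (λ u → Cr' x u ≡ true) (NbW.surv x lx lgx) (Cw' x))
    eok .e (there (there (here refl))) x lx lgx = sup x (e x) lx lgx (Ce' x)
    nb : ∀ g → g ∈ Cgs → ∀ i → (i ≡ s1 ⊎ i ≡ s2) → L' (g i) ≡ true → X c (g i) ≡ true
    nb .b (here refl) = nbf b (here refl)
    nb .w (there (here refl)) = nbf w (there (here refl))
    nb .e (there (there (here refl))) i is lgi = ⊥-elim (removed⇒dead (e i) (es i is) lgi)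

  Cs12 : Cr s1 s2 ≡ true
  Cs12 = Ce s1

  Ct1t2 : Cr t1 t2 ≡ true
  Ct1t2 = trans-on EC t1 s1 t2 (live IB s1 l1) l1 (live IB s2 l2) (sym-on EC s1 t1 l1 (live IB s1 l1) (Cb s1))
              (trans-on EC s1 s2 t2 l1 l2 (live IB s2 l2) Cs12 (Cb s2))
  Cu1u2 : Cr u1 u2 ≡ true
  Cu1u2 = trans-on EC u1 s1 u2 (live IW s1 l1) l1 (live IW s2 l2) (sym-on EC s1 u1 l1 (live IW s1 l1) (Cw s1))
              (trans-on EC s1 s2 u2 l1 l2 (live IW s2 l2) Cs12 (Cw s2))

  new⊆C : ∀ x y → L' x ≡ true → L' y ≡ true → Cr' x y ≡ true → Cr x y ≡ true
  new⊆C = cls-⊆ L' Cgs' GC' Cr ECr hh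
    where
    hh : ∀ g → g ∈ Cgs' → ∀ x → L' x ≡ true → Cr x (g x) ≡ true
    hh .b' (here refl) = NbB.newEdge Cr ECr (λ x _ _ → Cb x) (λ _ → Ct1t2)
    hh .w' (there (here refl)) = NbW.newEdge Cr ECr (λ x _ _ → Cw x) (λ _ → Cu1u2)
    hh .e' (there (there (here refl))) = e'-edge Cr (λ x _ → Ce x)

  #components-step-isolated : b s1 ≡ s2 → w s1 ≡ s2 → suc (#classes L' Cr') ≡ #classes L Cr
  #components-step-isolated eb ew = trans (cong suc (#classes-cong L' L' Cr' Cr (λ _ → refl) eqv))
                              (#classes-del2-pair L Cr s1 s2 EC l1 l2 ne12 Cs12 clos)
    where
    eqv : ∀ x y → L' x ≡ true → L' y ≡ true → Cr' x y ≡ Cr x y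
    eqv x y lx ly = bool-ext (old⊆C Cr' EC' (λ _ _ _ _ k → k) x lx nbv x y lx ly) (new⊆C x y lx ly)
      where
      nbv : NBF Cr' x
      nbv = nbF-intro Cr' x (λ lt → ⊥-elim (removed⇒dead t1 (inj₂ eb) lt)) (λ lt → ⊥-elim (removed⇒dead t2 (inj₁ (b-s2≡s1 eb)) lt))
                (λ lu → ⊥-elim (removed⇒dead u1 (inj₂ ew) lu)) (λ lu → ⊥-elim (removed⇒dead u2 (inj₁ (w-s2≡s1 ew)) lu))
    clos : ∀ y → L y ≡ true → Cr s1 y ≡ true → y ≡ s1 ⊎ y ≡ s2
    clos y ly ee = Reach-pair-closed Cgs hh (cls-sound Cgs s1 y ee) (inj₁ refl)
      where
      hh : ∀ g → g ∈ Cgs → g s1 ≡ s2 × g s2 ≡ s1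
      hh .b (here refl) = eb , b-s2≡s1 eb
      hh .w (there (here refl)) = ew , w-s2≡s1 ew
      hh .e (there (there (here refl))) = refl , inv IE s1 l1

  #components-del2 : (b s1 ≢ s2 ⊎ w s1 ≢ s2) → #classes L' Cr ≡ #classes L Cr
  #components-del2 nn = #classes-del2-nonsingleton L Cr s1 s2 EC l1 l2 ne12 s2 l2 ne12' Cs12 (proj₁ y2) (proj₁ (proj₂ y2))
                    (proj₁ (proj₂ (proj₂ y2))) (proj₁ (proj₂ (proj₂ (proj₂ y2)))) (proj₂ (proj₂ (proj₂ (proj₂ y2))))
    where
    ne12' : s2 ≢ s1
    ne12' q = ne12 (sym q)
    y2f : (b s1 ≢ s2 ⊎ w s1 ≢ s2) → Σ (Fin m) λ y → L y ≡ true × y ≢ s1 × y ≢ s2 × Cr s2 y ≡ true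
    y2f (inj₁ nb) = t2 , live IB s2 l2 , RB.t2≢s1 nb , nofix IB s2 l2 , Cb s2
    y2f (inj₂ nw) = u2 , live IW s2 l2 , RW.t2≢s1 nw , nofix IW s2 l2 , Cw s2
    y2 : Σ (Fin m) λ y → L y ≡ true × y ≢ s1 × y ≢ s2 × Cr s2 y ≡ true
    y2 = y2f nn

  #components-bound : ∀ c → L' c ≡ true → NBF Fr' c → #classes L' Cr' ≤ #classes L' Cr
  #components-bound c lc nbf = #classes-anti L' Cr Cr' (old⊆C Cr' EC' (λ _ _ _ _ k → k) c lc nbC)
    where
    nbC : NBF Cr' c
    nbC g gi i is lgi = F'⊆C' c (g i) lc lgi (nbf g gi i is lgi)

  #components-bound-split : L' t1 ≡ true → L' u1 ≡ true → NBF (merge Fr' t1 u1) t1 → #classes L' Cr' ≤ suc (#classes L' Cr)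
  #components-bound-split Lt1 Lu1 nbf = ≤-trans (#classes-merge-≤ L' Cr' t1 u1 EC' Lt1 Lu1) (s≤s (#classes-anti L' Cr X (old⊆C X EX (λ x y _ _ k → merge-old Cr' t1 u1 x y k) t1 Lt1 nbX)))
    where
    X : Rel m
    X = merge Cr' t1 u1
    EX : EquivalenceOn L' X
    EX = merge-equivalenceOn L' Cr' t1 u1 EC' Lt1 Lu1
    lift : ∀ x y → L' x ≡ true → L' y ≡ true → merge Fr' t1 u1 x y ≡ true → X x y ≡ true
    lift x y lx ly k with merge-cases Fr' t1 u1 x y k
    ... | inj₁ h = merge-old Cr' t1 u1 x y (F'⊆C' x y lx ly h)
    ... | inj₂ (inj₁ (h1 , h2)) = merge-ab Cr' t1 u1 x y (F'⊆C' x t1 lx Lt1 h1) (F'⊆C' u1 y Lu1 ly h2)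
    ... | inj₂ (inj₂ (h1 , h2)) = merge-ba Cr' t1 u1 x y (F'⊆C' x u1 lx Lu1 h1) (F'⊆C' t1 y Lt1 ly h2)
    nbX : NBF X t1
    nbX g gi i is lgi = lift t1 (g i) Lt1 lgi (nbf g gi i is lgi)

#edgesOn : ∀ {m} → Sub m → Fun m → ℕ
#edgesOn L e = countFin (λ x → L x ∧ (x <ᵇF e x))

#facesOn : ∀ {m} → Sub m → Fun m → Fun m → ℕ
#facesOn L b w = #classes L (cls (b ∷ w ∷ []))

#verticesOn : ∀ {m} → Sub m → Fun m → Fun m → Fun m → ℕ
#verticesOn L b w e = #classes L (cls (b ∷ e ∷ [])) + #classes L (cls (w ∷ e ∷ []))

#componentsOn : ∀ {m} → Sub m → Fun m → Fun m → Fun m → ℕ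
#componentsOn L b w e = #classes L (cls (b ∷ w ∷ e ∷ []))

twists : EdgeType → ℕ
twists twisted = 1
twists straight = 0
twists interface = 0

∧-shuffle₄ : ∀ a b c d → ((a ∧ b) ∧ c) ∧ d ≡ ((a ∧ c) ∧ d) ∧ b
∧-shuffle₄ true true c d = sym (∧-identityʳ _)
∧-shuffle₄ true false c d = sym (∧-zeroʳ _)
∧-shuffle₄ false b c d = refl

≮⇒<ᵇF≡false : ∀ {m} (a b : Fin m) → ¬ (toℕ a < toℕ b) → (a <ᵇF b) ≡ false
≮⇒<ᵇF≡false a b n with a <ᵇF b in e
... | false = refl
... | true = ⊥-elim (n (<ᵇF⇒< e))

exactly-one-<ᵇF : ∀ {m} (x y : Fin m) → x ≢ y → indicator (x <ᵇF y) + indicator (y <ᵇF x) ≡ 1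
exactly-one-<ᵇF x y ne with <-cmp (toℕ x) (toℕ y)
... | tri< a _ c rewrite <⇒<ᵇF {y = x} {x = y} a | ≮⇒<ᵇF≡false y x (<⇒≯ a) = refl
... | tri≈ _ b _ = ⊥-elim (ne (toℕ-injective b))
... | tri> _ _ c rewrite <⇒<ᵇF {y = y} {x = x} c | ≮⇒<ᵇF≡false x y (<⇒≯ c) = refl

step-arith-isolated : ∀ C C' E E' Vb Vb' Vw Vw' F F' τ → suc C' ≡ C → suc E' ≡ E → suc Vb' ≡ Vb → suc Vw' ≡ Vw → suc F' ≡ F → τ ≡ straight →
  2 * C + E + (Vb' + Vw') + F' ≡ 2 * C' + E' + (Vb + Vw) + F + twists τ + 2 * 0
step-arith-isolated _ C' _ E' _ Vb' _ Vw' _ F' _ refl refl refl refl refl refl = lem C' E' Vb' Vw' F'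
  where
  lem : ∀ C' E' Vb' Vw' F' → 2 * suc C' + suc E' + (Vb' + Vw') + F' ≡ 2 * C' + E' + (suc Vb' + suc Vw') + suc F' + 0 + 2 * 0
  lem = solve-∀

step-arith-blackLeaf : ∀ C C' δ E E' Vb Vb' Vw Vw' F F' τ → C ≡ C' + δ → suc E' ≡ E → suc Vb' ≡ Vb → Vw' ≡ Vw → F' ≡ F → τ ≡ straight →
  2 * C + E + (Vb' + Vw') + F' ≡ 2 * C' + E' + (Vb + Vw) + F + twists τ + 2 * δ
step-arith-blackLeaf _ C' δ _ E' _ Vb' Vw _ F _ _ refl refl refl refl refl refl = lem C' δ E' Vb' Vw F
  where
  lem : ∀ C' δ E' Vb' Vw F → 2 * (C' + δ) + suc E' + (Vb' + Vw) + F ≡ 2 * C' + E' + (suc Vb' + Vw) + F + 0 + 2 * δ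
  lem = solve-∀

step-arith-whiteLeaf : ∀ C C' δ E E' Vb Vb' Vw Vw' F F' τ → C ≡ C' + δ → suc E' ≡ E → Vb' ≡ Vb → suc Vw' ≡ Vw → F' ≡ F → τ ≡ straight →
  2 * C + E + (Vb' + Vw') + F' ≡ 2 * C' + E' + (Vb + Vw) + F + twists τ + 2 * δ
step-arith-whiteLeaf _ C' δ _ E' Vb _ _ Vw' F _ _ refl refl refl refl refl refl = lem C' δ E' Vb Vw' F
  where
  lem : ∀ C' δ E' Vb Vw' F → 2 * (C' + δ) + suc E' + (Vb + Vw') + F ≡ 2 * C' + E' + (Vb + suc Vw') + F + 0 + 2 * δ
  lem = solve-∀

step-arith-interface : ∀ C C' δ E E' Vb Vb' Vw Vw' F F' τ → C ≡ C' + δ → suc E' ≡ E → Vb' ≡ Vb → Vw' ≡ Vw → suc F' ≡ F → τ ≡ interface →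
  2 * C + E + (Vb' + Vw') + F' ≡ 2 * C' + E' + (Vb + Vw) + F + twists τ + 2 * δ
step-arith-interface _ C' δ _ E' Vb _ Vw _ _ F' _ refl refl refl refl refl refl = lem C' δ E' Vb Vw F'
  where
  lem : ∀ C' δ E' Vb Vw F' → 2 * (C' + δ) + suc E' + (Vb + Vw) + F' ≡ 2 * C' + E' + (Vb + Vw) + suc F' + 0 + 2 * δ
  lem = solve-∀

step-arith-twisted : ∀ C C' δ E E' Vb Vb' Vw Vw' F F' τ → C ≡ C' + δ → suc E' ≡ E → Vb' ≡ Vb → Vw' ≡ Vw → F' ≡ F → τ ≡ twisted →
  2 * C + E + (Vb' + Vw') + F' ≡ 2 * C' + E' + (Vb + Vw) + F + twists τ + 2 * δ
step-arith-twisted _ C' δ _ E' Vb _ Vw _ F _ _ refl refl refl refl refl refl = lem C' δ E' Vb Vw F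
  where
  lem : ∀ C' δ E' Vb Vw F → 2 * (C' + δ) + suc E' + (Vb + Vw) + F ≡ 2 * C' + E' + (Vb + Vw) + F + 1 + 2 * δ
  lem = solve-∀

step-arith-straight : ∀ C C' δ E E' Vb Vb' Vw Vw' F F' τ → suc C ≡ C' + δ → suc E' ≡ E → Vb' ≡ Vb → Vw' ≡ Vw → F' ≡ suc F → τ ≡ straight →
  2 * C + E + (Vb' + Vw') + F' ≡ 2 * C' + E' + (Vb + Vw) + F + twists τ + 2 * δ
step-arith-straight C C' δ _ E' Vb _ Vw _ F _ _ h refl refl refl refl refl =
  trans (lem C E' Vb Vw F) (trans (cong (λ u → 2 * u + E' + (Vb + Vw) + F) h) (lem2 C' δ E' Vb Vw F))
  where
  lem : ∀ C E' Vb Vw F → 2 * C + suc E' + (Vb + Vw) + suc F ≡ 2 * suc C + E' + (Vb + Vw) + F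
  lem = solve-∀
  lem2 : ∀ C' δ E' Vb Vw F → 2 * (C' + δ) + E' + (Vb + Vw) + F ≡ 2 * C' + E' + (Vb + Vw) + F + 0 + 2 * δ
  lem2 = solve-∀

module EdgeRemovalInvariant {m} (L : Sub m) (b w e : Fun m) (IB : InvolutionOn L b) (IW : InvolutionOn L w) (IE : InvolutionOn L e)
            (s1 : Fin m) (l1 : L s1 ≡ true) where
  open EdgeRemovalVertices L b w e IB IW IE s1 l1

  #edges-step : suc (#edgesOn L' e') ≡ #edgesOn L e
  #edges-step = sym (begin
    #edgesOn L e ≡⟨ countFin≡count P0 ⟩
    count P0 ≡⟨ count-remove P0 s1 ⟩
    count P1 + indicator (P0 s1) ≡⟨ cong (_+ indicator (P0 s1)) (count-remove P1 s2) ⟩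
    count (λ x → P1 x ∧ not (x == s2)) + indicator (P1 s2) + indicator (P0 s1) ≡⟨ cong₂ (λ u v → u + v + indicator (P0 s1)) (count-cong _ _ pw) k2 ⟩
    count P' + indicator (s2 <ᵇF s1) + indicator (P0 s1) ≡⟨ cong (λ u → count P' + indicator (s2 <ᵇF s1) + indicator u) (cong (_∧ (s1 <ᵇF e s1)) l1) ⟩
    count P' + indicator (s2 <ᵇF s1) + indicator (s1 <ᵇF s2) ≡⟨ +-assoc (count P') _ _ ⟩
    count P' + (indicator (s2 <ᵇF s1) + indicator (s1 <ᵇF s2)) ≡⟨ cong (count P' +_) (trans (+-comm (indicator (s2 <ᵇF s1)) (indicator (s1 <ᵇF s2))) (exactly-one-<ᵇF s1 s2 ne12)) ⟩
    count P' + 1 ≡⟨ +-comm _ 1 ⟩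
    suc (count P') ≡⟨ cong suc (sym (countFin≡count P')) ⟩
    suc (#edgesOn L' e') ∎)
    where
    open ≡-Reasoning
    P0 P1 P' : Fin m → Bool
    P0 x = L x ∧ (x <ᵇF e x)
    P1 x = P0 x ∧ not (x == s1)
    P' x = L' x ∧ (x <ᵇF e' x)
    pw : ∀ x → ((L x ∧ (x <ᵇF e x)) ∧ not (x == s1)) ∧ not (x == s2) ≡ L' x ∧ (x <ᵇF e' x)
    pw x = trans (∧-shuffle₄ (L x) (x <ᵇF e x) (not (x == s1)) (not (x == s2))) (cong (L' x ∧_) (cong (x <ᵇF_) (sym (e'≡e x))))
    k2 : indicator (((L s2 ∧ (s2 <ᵇF e s2)) ∧ not (s2 == s1))) ≡ indicator (s2 <ᵇF s1)
    k2 rewrite l2 | inv IE s1 l1 | ≢⇒==false (λ q → ne12 (sym q)) = cong indicator (∧-identityʳ _)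

  -- 2C + E − V − F drops by the twists of the removed edge plus 2δ (both sides moved so that no
  -- subtraction occurs).
  StepEquation : ℕ → Set
  StepEquation δ = 2 * #componentsOn L b w e + #edgesOn L e + #verticesOn L' b' w' e' + #facesOn L' b' w' ≡
           2 * #componentsOn L' b' w' e' + #edgesOn L' e' + #verticesOn L b w e + #facesOn L b w + twists (firstHit b w s1 s2 m 1) + 2 * δ

  C C' : ℕ
  C = #classes L Cr
  C' = #classes L' Cr'

  E E' Vb Vb' Vw Vw' F F' : ℕ
  E = #edgesOn L e
  E' = #edgesOn L' e'
  Vb = #classes L VB.Vr
  Vb' = #classes L' VB.Vr'
  Vw = #classes L VW.Vr
  Vw' = #classes L' VW.Vr'
  F = #classes L Fr
  F' = #classes L' Fr'
  τ : EdgeType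
  τ = firstHit b w s1 s2 m 1

  diff : ∀ {x y} → x ≤ y → y ≡ x + (y ∸ x)
  diff le = sym (m+[n∸m]≡n le)

  step-invariant : Σ ℕ StepEquation
  step-invariant = go (b s1 ≟ s2) (w s1 ≟ s2)
   where
   go : Dec (b s1 ≡ s2) → Dec (w s1 ≡ s2) → Σ ℕ StepEquation
   go (yes eb) (yes ew) = 0 , step-arith-isolated C C' E E' Vb Vb' Vw Vw' F F' τ (#components-step-isolated eb ew) #edges-step (VB.#vertices-step-leaf eb) (VW.#vertices-step-leaf ew) (IsolatedEdge.#faces-step eb ew) (edge-type-blackLeaf eb)
   go (yes eb) (no nw) = C ∸ C' , step-arith-blackLeaf C C' (C ∸ C') E E' Vb Vb' Vw Vw' F F' τ (diff le) #edges-step (VB.#vertices-step-leaf eb) (VW.#vertices-step nw) (BlackLeaf.#faces-step eb nw) (edge-type-blackLeaf eb)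
     where
     le : C' ≤ C
     le = ≤-trans (#components-bound u1 (BlackLeaf.Lu1 eb nw) (BlackLeaf.nbF eb nw)) (≤-reflexive (#components-del2 (inj₂ nw)))
   go (no nb) (yes ew) = C ∸ C' , step-arith-whiteLeaf C C' (C ∸ C') E E' Vb Vb' Vw Vw' F F' τ (diff le) #edges-step (VB.#vertices-step nb) (VW.#vertices-step-leaf ew) (WhiteLeaf.#faces-step ew nb) (WhiteLeaf.edge-type ew nb)
     where
     le : C' ≤ C
     le = ≤-trans (#components-bound t1 (WhiteLeaf.Lt1 ew nb) (WhiteLeaf.nbF ew nb)) (≤-reflexive (#components-del2 (inj₁ nb)))
   go (no nb) (no nw) = byFace (Fr s1 s2) refl
     where
     byFace : ∀ v → Fr s1 s2 ≡ v → Σ ℕ StepEquation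
     byFace false h = C ∸ C' , step-arith-interface C C' (C ∸ C') E E' Vb Vb' Vw Vw' F F' τ (diff le) #edges-step (VB.#vertices-step nb) (VW.#vertices-step nw) (InterfaceEdge.#faces-step h) (InterfaceEdge.edge-type h)
       where
       le : C' ≤ C
       le = ≤-trans (#components-bound t1 (InterfaceEdge.Lt1 h) (InterfaceEdge.nbF h)) (≤-reflexive (#components-del2 (inj₁ nb)))
     byFace true h = byParity (isEven (SameFace.j0 h)) refl
       where
       byParity : ∀ v → isEven (SameFace.j0 h) ≡ v → Σ ℕ StepEquation
       byParity true pe = C ∸ C' , step-arith-twisted C C' (C ∸ C') E E' Vb Vb' Vw Vw' F F' τ (diff le) #edges-step (VB.#vertices-step nb) (VW.#vertices-step nw)
                         (SameFace.TwistedEdge.#faces-step h pe) (trans (SameFace.edge-type h) (cong (λ u → if u then twisted else straight) pe))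
         where
         le : C' ≤ C
         le = ≤-trans (#components-bound t1 (SameFace.TwistedEdge.Lt1 h pe) (SameFace.TwistedEdge.nbF h pe)) (≤-reflexive (#components-del2 (inj₁ nb)))
       byParity false po = suc C ∸ C' , step-arith-straight C C' (suc C ∸ C') E E' Vb Vb' Vw Vw' F F' τ (diff le) #edges-step (VB.#vertices-step nb) (VW.#vertices-step nw)
                         (SameFace.StraightEdge.#faces-step h po nb nw) (trans (SameFace.edge-type h) (cong (λ u → if u then twisted else straight) po))
         where
         le : C' ≤ suc C
         le = ≤-trans (#components-bound-split (SameFace.StraightEdge.Lt1 h po nb nw) (SameFace.StraightEdge.Lu1 h po nb nw) (SameFace.StraightEdge.nbM h po nb nw))
                      (s≤s (≤-reflexive (#components-del2 (inj₁ nb))))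

-- Covers L e Es: removing the edges Es one after the other uses up exactly the live sides L.
Covers : ∀ {m} → Sub m → Fun m → List (Fin m × Fin m) → Set
Covers L e [] = ∀ x → L x ≡ false
Covers L e ((a , c) ∷ Es) = L a ≡ true × c ≡ e a × Covers (del2 L a c) e Es

del2-ext : ∀ {m} (L L' : Sub m) a c → (∀ x → L x ≡ L' x) → ∀ x → del2 L a c x ≡ del2 L' a c x
del2-ext L L' a c h x rewrite h x = refl

Covers-extL : ∀ {m} (L L' : Sub m) e Es → (∀ x → L x ≡ L' x) → Covers L e Es → Covers L' e Es
Covers-extL L L' e [] h cv x = trans (sym (h x)) (cv x)
Covers-extL L L' e ((a , c) ∷ Es) h (la , ce , cv) =
  trans (sym (h a)) la , ce , Covers-extL (del2 L a c) (del2 L' a c) e Es (del2-ext L L' a c h) cv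

Covers-extE : ∀ {m} (L : Sub m) e e' Es → (∀ x → e x ≡ e' x) → Covers L e Es → Covers L e' Es
Covers-extE L e e' [] h cv = cv
Covers-extE L e e' ((a , c) ∷ Es) h (la , ce , cv) = la , trans ce (h a) , Covers-extE (del2 L a c) e e' Es h cv

#classes-empty : ∀ {m} (L : Sub m) r → (∀ x → L x ≡ false) → #classes L r ≡ 0
#classes-empty L r h = trans (#classes≡count L r) (count-zero _ (λ x → isClassMin-dead L r x (h x)))

#edgesOn-empty : ∀ {m} (L : Sub m) e → (∀ x → L x ≡ false) → #edgesOn L e ≡ 0
#edgesOn-empty L e h = trans (countFin≡count (λ x → L x ∧ (x <ᵇF e x))) (count-zero (λ x → L x ∧ (x <ᵇF e x)) (λ x → cong (_∧ (x <ᵇF e x)) (h x)))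

monoMul-twists : ∀ τ mo → proj₂ (monoMul τ mo) ≡ twists τ + proj₂ mo
monoMul-twists straight (h , k) = refl
monoMul-twists twisted (h , k) = refl
monoMul-twists interface (h , k) = refl

history-arith : ∀ P Q V' F' V F tw k n δ → P + V' + F' ≡ Q + V + F + tw + 2 * δ → Q ≡ V' + F' + k + 2 * n →
  P ≡ V + F + (tw + k) + 2 * (n + δ)
history-arith P Q V' F' V F tw k n δ h1 refl = +-cancelʳ-≡ (V' + F') P _ (trans (trans (l1 P V' F') h1) (l2 V' F' k n V F tw δ))
  where
  l1 : ∀ P V' F' → P + (V' + F') ≡ P + V' + F'
  l1 = solve-∀
  l2 : ∀ V' F' k n V F tw δ → V' + F' + k + 2 * n + V + F + tw + 2 * δ ≡ V + F + (tw + k) + 2 * (n + δ) + (V' + F')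
  l2 = solve-∀

history-invariant : ∀ {m} (Es : List (Fin m × Fin m)) (L : Sub m) (b w e : Fun m) → InvolutionOn L b → InvolutionOn L w → InvolutionOn L e → Covers L e Es →
  Σ ℕ λ n → 2 * #componentsOn L b w e + #edgesOn L e ≡ #verticesOn L b w e + #facesOn L b w + proj₂ (histWt (b , w , e) Es) + 2 * n
history-invariant [] L b w e IB IW IE cv = 0 , trans (cong₂ (λ u v → 2 * u + v) c0 e0) (sym (cong₂ (λ u v → u + v + 0 + 0) v0 f0))
  where
  c0 : #componentsOn L b w e ≡ 0
  c0 = #classes-empty L _ cv
  e0 : #edgesOn L e ≡ 0
  e0 = #edgesOn-empty L e cv
  v0 : #verticesOn L b w e ≡ 0
  v0 = cong₂ _+_ (#classes-empty L (cls (b ∷ e ∷ [])) cv) (#classes-empty L (cls (w ∷ e ∷ [])) cv)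
  f0 : #facesOn L b w ≡ 0
  f0 = #classes-empty L _ cv
history-invariant ((a , c) ∷ Es) L b w e IB IW IE (la , refl , cv) =
  let n , ih = history-invariant Es R.L' R.b' R.w' R.e' R.IB' R.IW' R.IE' (Covers-extE _ e _ Es (λ x → sym (R.e'≡e x)) cv)
      δ , step = EdgeRemovalInvariant.step-invariant L b w e IB IW IE a la
  in n + δ , trans (history-arith _ _ _ _ _ _ _ _ n δ step ih)
                   (cong (λ k → #verticesOn L b w e + #facesOn L b w + k + 2 * (n + δ)) (sym (monoMul-twists _ (histWt _ Es))))
  where module R = EdgeRemoval L b w e IB IW IE a la

∧-shuffle₅ : ∀ p q r s t → (((p ∧ q) ∧ r) ∧ s) ∧ t ≡ (((p ∧ s) ∧ t) ∧ q) ∧ r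
∧-shuffle₅ false q r s t = refl
∧-shuffle₅ true true true true true = refl
∧-shuffle₅ true true true true false = refl
∧-shuffle₅ true true true false true = refl
∧-shuffle₅ true true true false false = refl
∧-shuffle₅ true true false true true = refl
∧-shuffle₅ true true false true false = refl
∧-shuffle₅ true true false false true = refl
∧-shuffle₅ true true false false false = refl
∧-shuffle₅ true false true true true = refl
∧-shuffle₅ true false true true false = refl
∧-shuffle₅ true false true false true = refl
∧-shuffle₅ true false true false false = refl
∧-shuffle₅ true false false true true = refl
∧-shuffle₅ true false false true false = refl
∧-shuffle₅ true false false false true = refl
∧-shuffle₅ true false false false false = refl

Covers-swap : ∀ {m} (L : Sub m) (e : Fun m) → (∀ x → e (e x) ≡ x) → ∀ p q xs → Covers L e (p ∷ q ∷ xs) → Covers L e (q ∷ p ∷ xs)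
Covers-swap L e eI (a , c) (a2 , c2) xs (la , ce , la2' , ce2 , cv) =
  del2-live L a c a2 la2' , ce2 , del2-intro L a2 c2 a la (λ q → del2-ne1 L a c a2 la2' (sym q)) n2 , ce ,
  Covers-extL _ _ e xs (λ x → ∧-shuffle₅ (L x) _ _ _ _) cv
  where
  n2 : a ≢ c2
  n2 q = del2-ne2 L a c a2 la2' (trans (trans (sym (eI a2)) (cong e (sym (trans q ce2)))) (sym ce))

Covers-↭ : ∀ {m} (e : Fun m) → (∀ x → e (e x) ≡ x) → ∀ {xs ys} → xs ↭ ys → ∀ L → Covers L e xs → Covers L e ys
Covers-↭ e eI Perm.refl L cv = cv
Covers-↭ e eI (Perm.prep (a , c) p) L (la , ce , cv) = la , ce , Covers-↭ e eI p (del2 L a c) cv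
Covers-↭ e eI (Perm.swap (a , c) (a2 , c2) p) L cv with Covers-swap L e eI (a , c) (a2 , c2) _ cv
... | la2 , ce2 , la' , ce , cv' = la2 , ce2 , la' , ce , Covers-↭ e eI p _ cv'
Covers-↭ e eI (Perm.trans p q) L cv = Covers-↭ e eI q L (Covers-↭ e eI p L cv)

insertions-↭ : ∀ {X : Set} (x : X) ys h → h ∈ insertions x ys → h ↭ (x ∷ ys)
insertions-↭ x [] h (here refl) = Perm.refl
insertions-↭ x (y ∷ ys) h (here refl) = Perm.refl
insertions-↭ x (y ∷ ys) h (there i) with ∈-map⁻ (y ∷_) i
... | r , ir , refl = Perm.trans (Perm.prep y (insertions-↭ x ys r ir)) (Perm.swap y x Perm.refl)

perms-↭ : ∀ {X : Set} (xs : List X) h → h ∈ perms xs → h ↭ xs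
perms-↭ [] h (here refl) = Perm.refl
perms-↭ (x ∷ xs) h i = go (perms xs) (λ r ir → perms-↭ xs r ir) (∈-concatMap⁻ (insertions x) {xs = perms xs} i)
  where
  go : ∀ rs → (∀ r → r ∈ rs → r ↭ xs) → Any (λ r → h ∈ insertions x r) rs → h ↭ (x ∷ xs)
  go (r ∷ rs) f (here hi) = Perm.trans (insertions-↭ x r h hi) (Perm.prep x (f r (here refl)))
  go (r ∷ rs) f (there a) = go rs (λ r' ir' → f r' (there ir')) a

self-perm : ∀ {X : Set} (xs : List X) → xs ∈ perms xs
self-perm [] = here refl
self-perm (x ∷ xs) = ∈-concatMap⁺' (perms xs) (self-perm xs)
  where
  ∈-concatMap⁺' : ∀ rs → xs ∈ rs → (x ∷ xs) ∈ concatMap (insertions x) rs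
  ∈-concatMap⁺' rs i = ∈-concatMap⁺ (insertions x) (lem rs i)
    where
    hd : ∀ ys → (x ∷ ys) ∈ insertions x ys
    hd [] = here refl
    hd (y ∷ ys) = here refl
    lem : ∀ rs → xs ∈ rs → Any (λ r → (x ∷ xs) ∈ insertions x r) rs
    lem (r ∷ rs) (here refl) = here (hd xs)
    lem (r ∷ rs) (there i) = there (lem rs i)

sidesOf : ∀ {m} → Fun m → List (Fin m) → Sub m
sidesOf e [] y = false
sidesOf e (x ∷ xs) y = ((x <ᵇF e x) ∧ ((x == y) ∨ (e x == y))) ∨ sidesOf e xs y

pairsOf : ∀ {m} → Fun m → List (Fin m) → List (Fin m × Fin m)
pairsOf e xs = map (λ x → x , e x) (filter (λ x → toℕ x ℕ.<? toℕ (e x)) xs)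

sidesOf-elim : ∀ {m} (e : Fun m) xs y → sidesOf e xs y ≡ true →
  Σ (Fin m) λ x' → x' ∈ xs × (x' <ᵇF e x') ≡ true × (x' ≡ y ⊎ e x' ≡ y)
sidesOf-elim e [] y ()
sidesOf-elim e (x ∷ xs) y h with ∨-elim h
... | inj₂ h2 with sidesOf-elim e xs y h2
... | x' , i , l , o = x' , there i , l , o
sidesOf-elim e (x ∷ xs) y h | inj₁ h1 with ∨-elim (∧-r (x <ᵇF e x) h1)
... | inj₁ q = x , here refl , ∧-l _ h1 , inj₁ (==⇒≡ q)
... | inj₂ q = x , here refl , ∧-l _ h1 , inj₂ (==⇒≡ q)

sidesOf-intro : ∀ {m} (e : Fun m) xs y x' → x' ∈ xs → (x' <ᵇF e x') ≡ true → ((x' == y) ∨ (e x' == y)) ≡ true → sidesOf e xs y ≡ true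
sidesOf-intro e (x ∷ xs) y .x (here refl) l o = ∨-introˡ (∧-intro l o)
sidesOf-intro e (x ∷ xs) y x' (there i) l o = ∨-introʳ _ (sidesOf-intro e xs y x' i l o)

All≢⇒∉ : ∀ {m} {x : Fin m} {xs} → All (λ y → x ≢ y) xs → x ∈ xs → ⊥
All≢⇒∉ (p ∷ ps) (here refl) = p refl
All≢⇒∉ (p ∷ ps) (there i) = All≢⇒∉ ps i

≢true⇒≡false : ∀ {b : Bool} → (b ≡ true → ⊥) → b ≡ false
≢true⇒≡false {true} h = ⊥-elim (h refl)
≢true⇒≡false {false} h = refl

covers-pairsOf : ∀ {m} (e : Fun m) → (∀ x → e (e x) ≡ x) → (∀ x → e x ≢ x) →
  ∀ xs → Unique xs → Covers (sidesOf e xs) e (pairsOf e xs)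
covers-pairsOf e eI nf [] u y = refl
covers-pairsOf e eI nf (x ∷ xs) (px ∷ u) with toℕ x ℕ.<ᵇ toℕ (e x) in eqlt
... | false = Covers-extL (sidesOf e xs) _ e (pairsOf e xs) (λ y → refl) (covers-pairsOf e eI nf xs u)
... | true = ∨-introˡ (∧-intro refl (∨-introˡ (==-refl x))) , refl ,
               Covers-extL (sidesOf e xs) (del2 S1 x (e x)) e (pairsOf e xs) pw (covers-pairsOf e eI nf xs u)
  where
  ltx : (x <ᵇF e x) ≡ true
  ltx = eqlt
  lt : toℕ x < toℕ (e x)
  lt = <ᵇF⇒< ltx
  S1 : Sub _
  S1 y = (true ∧ ((x == y) ∨ (e x == y))) ∨ sidesOf e xs y
  notlt-ex : (e x <ᵇF e (e x)) ≡ true → ⊥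
  notlt-ex q = <-asym lt (subst (λ u → toℕ (e x) < toℕ u) (eI x) (<ᵇF⇒< q))
  pw : ∀ y → sidesOf e xs y ≡ del2 S1 x (e x) y
  pw y = dc (y ≟ x) (y ≟ e x)
    where
    af : ∀ A B → (A ∧ false) ∧ B ≡ false
    af true B = refl
    af false B = refl
    dc : Dec (y ≡ x) → Dec (y ≡ e x) → sidesOf e xs y ≡ del2 S1 x (e x) y
    dc (yes refl) _ = trans (≢true⇒≡false h) (sym (trans (cong (λ u → (S1 y ∧ not u) ∧ not (y == e y)) (==-refl y)) (af (S1 y) _)))
      where
      h : sidesOf e xs y ≡ true → ⊥
      h q with sidesOf-elim e xs y q
      ... | x' , i , l , inj₁ refl = All≢⇒∉ px i
      ... | x' , i , l , inj₂ ex' = notlt-ex (subst (λ u → (u <ᵇF e u) ≡ true) (trans (sym (eI x')) (cong e ex')) l)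
    dc (no _) (yes refl) = trans (≢true⇒≡false h) (sym (trans (cong (λ u → (S1 y ∧ not (y == x)) ∧ not u) (==-refl y)) (∧-zeroʳ _)))
      where
      h : sidesOf e xs (e x) ≡ true → ⊥
      h q with sidesOf-elim e xs (e x) q
      ... | x' , i , l , inj₁ refl = notlt-ex l
      ... | x' , i , l , inj₂ ex' = All≢⇒∉ px (subst (_∈ xs) (trans (sym (eI x')) (trans (cong e ex') (eI x))) i)
    dc (no n1) (no n2) rewrite ≢⇒==false {x = y} {y = x} n1 | ≢⇒==false {x = y} {y = e x} n2
                            | ≢⇒==false {x = x} {y = y} (λ q → n1 (sym q)) | ≢⇒==false {x = e x} {y = y} (λ q → n2 (sym q))
                            = sym (trans (∧-identityʳ _) (∧-identityʳ _))

covers-allFin : ∀ {m} (e : Fun m) → (∀ x → e (e x) ≡ x) → (∀ x → e x ≢ x) → Covers (λ _ → true) e (pairsOf e (allFin m))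
covers-allFin {m} e eI nf = Covers-extL (sidesOf e (allFin m)) (λ _ → true) e _ all (covers-pairsOf e eI nf (allFin m) (allFin⁺ m))
  where
  all : ∀ y → sidesOf e (allFin m) y ≡ true
  all y with toℕ y ℕ.<? toℕ (e y)
  ... | yes lt = sidesOf-intro e (allFin m) y y (∈-allFin y) (<⇒<ᵇF lt) (∨-introˡ (==-refl y))
  ... | no nlt = sidesOf-intro e (allFin m) y (e y) (∈-allFin (e y)) lt' (∨-introʳ _ (≡⇒== (eI y)))
    where
    lt' : (e y <ᵇF e (e y)) ≡ true
    lt' = <⇒<ᵇF (subst (λ u → toℕ (e y) < toℕ u) (sym (eI y))
            (≤∧≢⇒< (≮⇒≥ nlt) (λ q → nf y (toℕ-injective q))))

≡ᵇ-refl : ∀ n → (n ℕ.≡ᵇ n) ≡ true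
≡ᵇ-refl zero = refl
≡ᵇ-refl (suc n) = ≡ᵇ-refl n

≢⇒≡ᵇ≡false : ∀ {m n} → m ≢ n → (m ℕ.≡ᵇ n) ≡ false
≢⇒≡ᵇ≡false {m} {n} m≢n with m ℕ.≡ᵇ n in eq
... | false = refl
... | true = ⊥-elim (m≢n (≡ᵇ⇒≡ m n (subst T (sym eq) tt)))

halfPow-positive : ∀ h → Positive (halfPow h)
halfPow-positive zero = _
halfPow-positive (suc h) = QP.pos*pos⇒pos ½ (halfPow h) {{halfPow-positive h}}

positive⇒≢0 : ∀ {p} → Positive p → p ≢ 0ℚ
positive⇒≢0 {p} p>0 p≡0 = QP.<-irrefl (sym p≡0) (QP.positive⁻¹ p {{p>0}})

even-parity : ∀ {z k c} → ℤ.+ (2 * c) ℤ.- z ≡ ℤ.+ k → EvenInt z ⇔ 2 ∣ k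
even-parity {z} {k} {c} eq = mk⇔
  (λ 2∣z → ∣⇒∣ᵤ (subst (ℤ.+ 2 ℤ∣_) eq (∣m∣n⇒∣m-n 2∣2c (∣ᵤ⇒∣ {i = z} 2∣z))))
  (λ 2∣k → ∣⇒∣ᵤ (subst (ℤ.+ 2 ℤ∣_) z≡ (∣m∣n⇒∣m-n 2∣2c (∣ᵤ⇒∣ {i = ℤ.+ k} 2∣k))))
  where
  2∣2c : ℤ.+ 2 ℤ∣ ℤ.+ (2 * c)
  2∣2c = ∣ᵤ⇒∣ {i = ℤ.+ (2 * c)} (m∣m*n c)
  z≡ : ℤ.+ (2 * c) ℤ.- ℤ.+ k ≡ z
  z≡ = trans (cong (ℤ._-_ (ℤ.+ (2 * c))) (sym eq)) (double-neg (ℤ.+ (2 * c)) z)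
    where
    double-neg : ∀ (x y : ℤ) → x ℤ.- (x ℤ.- y) ≡ y
    double-neg = ℤ-Solver.solve-∀

#edgesOn-all : ∀ {m} (e : Fun m) → #edgesOn (λ _ → true) e ≡ length (pairsOf e (allFin m))
#edgesOn-all {m} e = begin
  length (filter (λ x → T? (x <ᵇF e x)) (allFin m))
    ≡⟨ cong length (filter-≐ (λ x → T? (x <ᵇF e x)) (λ x → toℕ x ℕ.<? toℕ (e x)) (<ᵇ⇒< _ _ , <⇒<ᵇ) (allFin m)) ⟩
  length (filter (λ x → toℕ x ℕ.<? toℕ (e x)) (allFin m))
    ≡⟨ sym (length-map _ (filter (λ x → toℕ x ℕ.<? toℕ (e x)) (allFin m))) ⟩
  length (pairsOf e (allFin m)) ∎
  where open ≡-Reasoning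

module _ {m} (M : Map m) where

  twistCount : List (Fin m × Fin m) → ℕ
  twistCount h = proj₂ (histWt (raw M) h)

  involutionOn-all : (P : Pairing m) → InvolutionOn (λ _ → true) (pr P)
  involutionOn-all P = record { live = λ _ _ → refl ; inv = λ x _ → invol P x ; nofix = λ x _ → noFix P x }

  euler-history : ∀ h → h ∈ perms (edgeList M) →
    ∃ λ n → 2 * #components M + #edges M ≡ #vertices M + #faces M + twistCount h + 2 * n
  euler-history h h∈ = subst (λ E → ∃ λ n → 2 * #components M + E ≡ #vertices M + #faces M + twistCount h + 2 * n)
    (#edgesOn-all e)
    (history-invariant h (λ _ → true) b w e
      (involutionOn-all (𝓑 M)) (involutionOn-all (𝓦 M)) (involutionOn-all (𝓔 M))
      (Covers-↭ e (invol (𝓔 M)) (↭-sym (perms-↭ _ h h∈)) _ (covers-allFin e (invol (𝓔 M)) (noFix (𝓔 M)))))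
    where
    b w e : Fun m
    b = pr (𝓑 M)
    w = pr (𝓦 M)
    e = pr (𝓔 M)

  d≡twists+even : ∀ h → h ∈ perms (edgeList M) → ∃ λ n → d M ≡ ℤ.+ (twistCount h + 2 * n)
  d≡twists+even h h∈ with euler-history h h∈
  ... | n , euler = n , (begin
    d M                                 ≡⟨ rearrange (ℤ.+ (2 * C)) (ℤ.+ E) (ℤ.+ V) (ℤ.+ F) ⟩
    (ℤ.+ (2 * C) ℤ.+ ℤ.+ E) ℤ.- (ℤ.+ V ℤ.+ ℤ.+ F)
      ≡⟨ cong₂ (λ x y → x ℤ.- y) (cong ℤ.+_ euler) (pos-+ V F) ⟩
    ℤ.+ (V + F + k + 2 * n) ℤ.- ℤ.+ (V + F)
      ≡⟨ cong (λ x → x ℤ.- ℤ.+ (V + F)) (cong ℤ.+_ (+-assoc (V + F) k (2 * n))) ⟩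
    ℤ.+ (V + F + (k + 2 * n)) ℤ.- ℤ.+ (V + F)
      ≡⟨ cong (λ x → x ℤ.- ℤ.+ (V + F)) (pos-+ (V + F) (k + 2 * n)) ⟩
    ℤ.+ (V + F) ℤ.+ ℤ.+ (k + 2 * n) ℤ.- ℤ.+ (V + F)
      ≡⟨ cancel (ℤ.+ (V + F)) (ℤ.+ (k + 2 * n)) ⟩
    ℤ.+ (k + 2 * n) ∎)
    where
    open ≡-Reasoning
    C E V F k : ℕ
    C = #components M
    E = #edges M
    V = #vertices M
    F = #faces M
    k = twistCount h
    rearrange : ∀ (C E V F : ℤ) → C ℤ.- ((V ℤ.- E) ℤ.+ F) ≡ (C ℤ.+ E) ℤ.- (V ℤ.+ F)
    rearrange = ℤ-Solver.solve-∀
    cancel : ∀ (x y : ℤ) → x ℤ.+ y ℤ.- x ≡ y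
    cancel = ℤ-Solver.solve-∀

  χ-parity : ∀ h → h ∈ perms (edgeList M) → EvenInt (χ M) ⇔ 2 ∣ twistCount h
  χ-parity h h∈ with d≡twists+even h h∈
  ... | n , d≡ = mk⇔ (λ ev → drop-even (Equivalence.to (even-parity {χ M} {c = #components M} d≡) ev))
                     (λ 2∣k → Equivalence.from (even-parity {χ M} {c = #components M} d≡) (∣m∣n⇒∣m+n 2∣k (m∣m*n n)))
    where
    drop-even : 2 ∣ twistCount h + 2 * n → 2 ∣ twistCount h
    drop-even 2∣k+2n = ∣m+n∣m⇒∣n (subst (2 ∣_) (+-comm (twistCount h) (2 * n)) 2∣k+2n) (m∣m*n n)

  private
    -- The contribution of the history h to the coefficient of γ^k, exactly as in Defs.wtCoeff.
    term : ℕ → List (Fin m × Fin m) → ℚ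
    term k h = if twistCount h ℕ.≡ᵇ k then halfPow (proj₁ (histWt (raw M) h)) else 0ℚ

    sumTerms : ℕ → List (List (Fin m × Fin m)) → ℚ
    sumTerms k hs = foldr ℚ._+_ 0ℚ (map (term k) hs)

    normaliser : ℚ
    normaliser = (ℤ.+ 1 ℚ./ (#edges M !)) {{#edges M !≢0}}

    sumTerms-zero : ∀ k hs → (∀ h → h ∈ hs → twistCount h ≢ k) → sumTerms k hs ≡ 0ℚ
    sumTerms-zero k [] _ = refl
    sumTerms-zero k (h ∷ hs) ≢k = begin
      term k h ℚ.+ sumTerms k hs ≡⟨ cong₂ ℚ._+_ term-zero (sumTerms-zero k hs (λ h' h'∈ → ≢k h' (there h'∈))) ⟩
      0ℚ ℚ.+ 0ℚ                  ≡⟨ QP.+-identityʳ 0ℚ ⟩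
      0ℚ                         ∎
      where
      open ≡-Reasoning
      term-zero : term k h ≡ 0ℚ
      term-zero = cong (λ c → if c then halfPow (proj₁ (histWt (raw M) h)) else 0ℚ) (≢⇒≡ᵇ≡false (≢k h (here refl)))

    term-nonNeg : ∀ k h → NonNegative (term k h)
    term-nonNeg k h with twistCount h ℕ.≡ᵇ k
    ... | true = QP.pos⇒nonNeg (halfPow (proj₁ (histWt (raw M) h))) {{halfPow-positive (proj₁ (histWt (raw M) h))}}
    ... | false = _

    sumTerms-nonNeg : ∀ k hs → NonNegative (sumTerms k hs)
    sumTerms-nonNeg k [] = _
    sumTerms-nonNeg k (h ∷ hs) =
      QP.nonNeg+nonNeg⇒nonNeg (term k h) {{term-nonNeg k h}} (sumTerms k hs) {{sumTerms-nonNeg k hs}}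

    sumTerms-positive : ∀ h hs → h ∈ hs → Positive (sumTerms (twistCount h) hs)
    sumTerms-positive h (h' ∷ hs) (here refl) =
      QP.pos+nonNeg⇒pos (term (twistCount h) h) {{term-positive}} (sumTerms (twistCount h) hs) {{sumTerms-nonNeg _ hs}}
      where
      term-positive : Positive (term (twistCount h) h)
      term-positive = subst Positive (cong (λ c → if c then halfPow halves else 0ℚ) (sym (≡ᵇ-refl (twistCount h))))
                                     (halfPow-positive halves)
        where halves = proj₁ (histWt (raw M) h)
    sumTerms-positive h (h' ∷ hs) (there h∈) =
      QP.nonNeg+pos⇒pos (term _ h') {{term-nonNeg _ h'}} (sumTerms _ hs) {{sumTerms-positive h hs h∈}}

  wtCoeff-zero : ∀ k → (∀ h → h ∈ perms (edgeList M) → twistCount h ≢ k) → wtCoeff M k ≡ 0ℚ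
  wtCoeff-zero k ≢k = trans (cong (normaliser ℚ.*_) (sumTerms-zero k _ ≢k)) (QP.*-zeroʳ normaliser)

  wtCoeff-nonzero : ∀ h → h ∈ perms (edgeList M) → wtCoeff M (twistCount h) ≢ 0ℚ
  wtCoeff-nonzero h h∈ = positive⇒≢0 {wtCoeff M (twistCount h)} (QP.pos*pos⇒pos normaliser {{QP.normalize-pos 1 (#edges M !) {{#edges M !≢0}}}}
                                        _ {{sumTerms-positive h _ h∈}})

  wtCoeff-degree : DegreeAtMost (wtCoeff M) (d M)
  wtCoeff-degree k d<k = wtCoeff-zero k twists≤d
    where
    twists≤d : ∀ h → h ∈ perms (edgeList M) → twistCount h ≢ k
    twists≤d h h∈ refl with d≡twists+even h h∈
    ... | n , d≡ = m+n≮m (twistCount h) (2 * n) (ZP.drop‿+<+ (subst (ℤ._< ℤ.+ k) d≡ d<k))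

  even-wt⇔even-χ : EvenPoly (wtCoeff M) ⇔ EvenInt (χ M)
  even-wt⇔even-χ = mk⇔ to (λ ev k odd-k → wtCoeff-zero k (λ h h∈ tw≡k → odd-k (subst (2 ∣_) tw≡k (Equivalence.to (χ-parity h h∈) ev))))
    where
    h₀∈ : edgeList M ∈ perms (edgeList M)
    h₀∈ = self-perm (edgeList M)
    to : EvenPoly (wtCoeff M) → EvenInt (χ M)
    to even-wt with 2 ∣? twistCount (edgeList M)
    ... | yes 2∣k₀ = Equivalence.from (χ-parity _ h₀∈) 2∣k₀
    ... | no ¬2∣k₀ = ⊥-elim (wtCoeff-nonzero _ h₀∈ (even-wt _ ¬2∣k₀))

  odd-wt⇔odd-χ : OddPoly (wtCoeff M) ⇔ OddInt (χ M)
  odd-wt⇔odd-χ = mk⇔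
    (λ odd-wt ev → wtCoeff-nonzero _ h₀∈ (odd-wt _ (Equivalence.to (χ-parity _ h₀∈) ev)))
    (λ odd-χ k 2∣k → wtCoeff-zero k (λ h h∈ tw≡k → odd-χ (Equivalence.from (χ-parity h h∈) (subst (2 ∣_) (sym tw≡k) 2∣k))))
    where
    h₀∈ : edgeList M ∈ perms (edgeList M)
    h₀∈ = self-perm (edgeList M)

lemma3p8 : ∀ {m : ℕ} (M : Map m) →
    DegreeAtMost (wtCoeff M) (d M)
    × (EvenPoly (wtCoeff M) ⇔ EvenInt (χ M))
    × (OddPoly (wtCoeff M) ⇔ OddInt (χ M))
lemma3p8 M = wtCoeff-degree M , even-wt⇔even-χ M , odd-wt⇔odd-χ M
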